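{- Let $\alpha$ be a Lyndon composition and $n\ge1$. Then $\lambda_n(\alpha)=\alpha^{*n}+R$, where $\alpha^{*n}=\alpha*\alpha*\cdots*\alpha$ ($n$ factors) is the $n$-fold concatenation of $\alpha$ (viewed as a monomial quasisymmetric function) and $R$ is a $\mathbf{Z}$-linear combination of monomial quasisymmetric functions of compositions that are strictly smaller than $\alpha^{*n}$ in the wll-ordering.
   Context: A composition is a finite sequence $\beta=[b_1,\dots,b_m]$ of positive integers, with weight $\mathrm{wt}(\beta)=b_1+\cdots+b_m$ and length $m$; its monomial quasisymmetric function is $\sum_{i_1<\cdots<i_m}x_{i_1}^{b_1}\cdots x_{i_m}^{b_m}$ (bounded-degree power series over $\mathbf{Z}$ in $x_1,x_2,\dots$), and $QSymm$ is the ring with $\mathbf{Z}$-basis these functions. Concatenation of compositions is denoted $*$. Compositions are compared lexicographically as words over the ordered alphabet $\{1,2,\dots\}$ (a proper prefix is smaller). The wll-ordering compares first by weight, then (for equal weight) by length, then (for equal weight and length) lexicographically, larger weight/length being larger. A nonempty composition is Lyndon if it is lexicographically strictly smaller than each of its proper nonempty suffixes. For $k\ge1$, $\psi_k$ is the ring endomorphism $x_j\mapsto x_j^k$, and $\lambda_n$ on $QSymm$ is defined by $\sum_{n\ge0}\lambda_n(f)t^n=\exp\big(\sum_{k\ge1}\frac{(-1)^{k-1}}{k}\psi_k(f)t^k\big)$ (the $\lambda$-ring structure with $\lambda_1(x_j)=x_j$, $\lambda_i(x_j)=0$ for $i\ge2$). -}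

module Defs where

open import Data.Nat as ℕ using (ℕ; zero; suc; _<_; _!)
open import Data.Nat.Properties using (_!≢0)
open import Data.Integer as ℤ using (ℤ; +_; -[1+_])
open import Data.Rational as ℚ using (ℚ; 0ℚ; 1ℚ)
open import Data.List using (List; []; _∷_; _++_; map; concatMap; length; upTo; foldr; replicate; concat)
open import Data.Nat.ListAction using (sum)
open import Data.List.Properties using (≡-dec)
open import Data.List.Relation.Binary.Lex.Strict using (Lex-<)
open import Data.Product using (_×_; _,_; proj₁; proj₂)
open import Data.Sum using (_⊎_)
open import Relation.Binary.PropositionalEquality using (_≡_; _≢_)
open import Relation.Nullary using (yes; no)

-- Compositions: lists of natural numbers (positivity imposed where needed)

Composition : Set
Composition = List ℕ

IsComposition : Composition → Set
IsComposition β = Data.List.Relation.Unary.All.All (λ b → 0 < b) β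
  where import Data.List.Relation.Unary.All

wt : Composition → ℕ
wt = sum

-- lexicographic order on words over {1,2,...}; a proper prefix is smaller
_<lex_ : Composition → Composition → Set
_<lex_ = Lex-< _≡_ _<_

_<wll_ : Composition → Composition → Set
β <wll γ = (wt β < wt γ)
         ⊎ ((wt β ≡ wt γ) × ((length β < length γ)
         ⊎ ((length β ≡ length γ) × (β <lex γ))))

Lyndon : Composition → Set
Lyndon α = (α ≢ []) ×
  (∀ (p s : Composition) → p ≢ [] → s ≢ [] → p ++ s ≡ α → α <lex s)

concatPow : ℕ → Composition → Composition
concatPow zero    α = []
concatPow (suc n) α = α ++ concatPow n α

-- QSymm ⊗ ℚ in the monomial basis: finite formal sums Σ c_β M_β,
-- represented as lists of (β , c_β) (repetitions are added up).

QS : Set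
QS = List (Composition × ℚ)

coeff : QS → Composition → ℚ
coeff []             β = 0ℚ
coeff ((γ , c) ∷ f) β with ≡-dec ℕ._≟_ γ β
... | yes _ = c ℚ.+ coeff f β
... | no  _ = coeff f β

_≈QS_ : QS → QS → Set
f ≈QS g = ∀ β → coeff f β ≡ coeff g β

M : Composition → QS
M β = (β , 1ℚ) ∷ []

fromℤ : List (Composition × ℤ) → QS
fromℤ = map (λ p → proj₁ p , (proj₂ p ℚ./ 1))

_⊕_ : QS → QS → QS
_⊕_ = _++_

scale : ℚ → QS → QS
scale q = map (λ p → proj₁ p , q ℚ.* proj₂ p)

-- quasi-shuffles (overlapping shuffles): M_a M_b = Σ_{w ∈ qsh a b} M_w
qsh : Composition → Composition → List Composition
qsh []       b        = b ∷ []
qsh (x ∷ a)  []       = (x ∷ a) ∷ []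
qsh (x ∷ a)  (y ∷ b)  =
  map (x ∷_) (qsh a (y ∷ b)) ++ map (y ∷_) (qsh (x ∷ a) b) ++ map (x ℕ.+ y ∷_) (qsh a b)

_⊛_ : QS → QS → QS
f ⊛ g = concatMap (λ p → concatMap (λ q →
          map (λ w → w , proj₂ p ℚ.* proj₂ q) (qsh (proj₁ p) (proj₁ q))) g) f

-- Adams operation ψ_k (x_j ↦ x_j^k): M_β ↦ M_{kβ}
ψ : ℕ → QS → QS
ψ k = map (λ p → map (k ℕ.*_) (proj₁ p) , proj₂ p)

PS : Set
PS = ℕ → QS

_⋆_ : PS → PS → PS
(F ⋆ G) n = concatMap (λ i → F i ⊛ G (n ℕ.∸ i)) (upTo (suc n))

onePS : PS
onePS zero    = M []
onePS (suc _) = []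

powPS : ℕ → PS → PS
powPS zero    F = onePS
powPS (suc m) F = F ⋆ powPS m F

logSeries : QS → PS
logSeries f zero    = []
logSeries f (suc k) = scale ((ℤ.-1ℤ ℤ.^ k) ℚ./ suc k) (ψ (suc k) f)

-- coefficient of t^n in exp(G) for G with zero constant term:
-- Σ_{m=0}^{n} (1/m!) [t^n] G^m   (higher powers do not contribute)
expCoeff : ℕ → PS → QS
expCoeff n G = concatMap (λ m → scale (ℚ._/_ (+ 1) (m !) {{m !≢0}}) (powPS m G n)) (upTo (suc n))

λop : ℕ → QS → QS
λop n f = expCoeff n (logSeries f)

{-# OPTIONS --safe #-}
-- Evaluated in L = length β variables, M_α is the sum of the distinct monomials x^u (u ∈ Uα), and
-- λ_t(M_α) = exp(∑_k (-1)^(k-1) ψ_k(M_α) t^k / k) becomes ∏_u (1 + t x^u): both solve θX = (θ log) X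
-- for the Euler operator θ = t d/dt and agree in t-degree 0. Hence the coefficient of M_β in λ_n(M_α)
-- counts the n-subsets of Uα summing to β, a natural number.
-- For the leading term we induct on n using Newton's identity n λ_n = ∑_k (-1)^(k-1) ψ_k λ_(n-k) and
-- read off the products as quasi-shuffles: for k ≥ 2, ψ_k(α) has too few parts to reach α^n, and a shuffle
-- of α with a composition ≤wll α^(n-1) reaches α^n only when that composition is α^(n-1). Since α is
-- Lyndon, α^n is the lexicographically largest shuffle of α with α^(n-1), and it occurs exactly n times.

module Submission where

open import Data.Empty using (⊥-elim)
open import Data.Integer using (ℤ)
open import Data.List using (List; []; _∷_)
open import Data.List.Relation.Unary.All using (All; _∷_)
open import Data.Nat using (ℕ; _≥_; _<_)
open import Data.Product using (Σ; _×_; proj₁; proj₂)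
open import Relation.Binary.PropositionalEquality using (_≡_; refl)

open import Defs

module Sum where

  open import Data.List using (List; []; _∷_; _++_; map; concatMap; upTo; applyUpTo)
  open import Data.Nat as ℕ using (ℕ; zero; suc; _<_; z≤n; s≤s)
  open import Data.List.Relation.Unary.All using (All; []; _∷_)
  open import Data.Rational using (ℚ; 0ℚ; _+_; _*_)
  open import Data.Rational.Properties using (+-identityˡ; +-identityʳ; +-assoc; *-zeroʳ; *-distribˡ-+)
  open import Data.Rational.Solver using (module +-*-Solver)
  open import Relation.Binary.PropositionalEquality
  open +-*-Solver

  ∑ : {A : Set} → List A → (A → ℚ) → ℚ
  ∑ []       F = 0ℚ
  ∑ (x ∷ xs) F = F x + ∑ xs F

  infix 8 ∑
  syntax ∑ xs (λ x → e) = ∑[ x ∈ xs ] e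

  ∑-cong : {A : Set} (xs : List A) {F G : A → ℚ} → (∀ x → F x ≡ G x) → ∑ xs F ≡ ∑ xs G
  ∑-cong []       e = refl
  ∑-cong (x ∷ xs) e = cong₂ _+_ (e x) (∑-cong xs e)

  ∑-congᴬ : {A : Set} (xs : List A) {F G : A → ℚ} → All (λ x → F x ≡ G x) xs → ∑ xs F ≡ ∑ xs G
  ∑-congᴬ []       []       = refl
  ∑-congᴬ (x ∷ xs) (e ∷ es) = cong₂ _+_ e (∑-congᴬ xs es)

  ∑-zero : {A : Set} (xs : List A) (F : A → ℚ) → (∀ x → F x ≡ 0ℚ) → ∑ xs F ≡ 0ℚ
  ∑-zero []       F e = refl
  ∑-zero (x ∷ xs) F e = cong₂ _+_ (e x) (∑-zero xs F e)

  ∑-zeroᴬ : {A : Set} (xs : List A) (F : A → ℚ) → All (λ x → F x ≡ 0ℚ) xs → ∑ xs F ≡ 0ℚ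
  ∑-zeroᴬ []       F []       = refl
  ∑-zeroᴬ (x ∷ xs) F (e ∷ es) = cong₂ _+_ e (∑-zeroᴬ xs F es)

  ∑-++ : {A : Set} (xs ys : List A) (F : A → ℚ) → ∑ (xs ++ ys) F ≡ ∑ xs F + ∑ ys F
  ∑-++ []       ys F = sym (+-identityˡ _)
  ∑-++ (x ∷ xs) ys F = trans (cong (F x +_) (∑-++ xs ys F)) (sym (+-assoc (F x) _ _))

  ∑-+ : {A : Set} (xs : List A) (F G : A → ℚ) → ∑[ x ∈ xs ] (F x + G x) ≡ ∑ xs F + ∑ xs G
  ∑-+ []       F G = refl
  ∑-+ (x ∷ xs) F G = trans (cong ((F x + G x) +_) (∑-+ xs F G))
    (solve 4 (λ a b c d → (a :+ b) :+ (c :+ d) := (a :+ c) :+ (b :+ d)) refl (F x) (G x) (∑ xs F) (∑ xs G))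

  ∑-*ˡ : {A : Set} (xs : List A) (c : ℚ) (F : A → ℚ) → ∑[ x ∈ xs ] (c * F x) ≡ c * ∑ xs F
  ∑-*ˡ []       c F = sym (*-zeroʳ c)
  ∑-*ˡ (x ∷ xs) c F = trans (cong (c * F x +_) (∑-*ˡ xs c F)) (sym (*-distribˡ-+ c (F x) _))

  ∑-swap : {A B : Set} (xs : List A) (ys : List B) (F : A → B → ℚ) →
           ∑[ x ∈ xs ] ∑[ y ∈ ys ] F x y ≡ ∑[ y ∈ ys ] ∑[ x ∈ xs ] F x y
  ∑-swap []       ys F = sym (∑-zero ys _ (λ _ → refl))
  ∑-swap (x ∷ xs) ys F = trans (cong (∑ ys (F x) +_) (∑-swap xs ys F))
    (sym (∑-+ ys (F x) (λ y → ∑[ x′ ∈ xs ] F x′ y)))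

  ∑-map : {A B : Set} (f : A → B) (xs : List A) (F : B → ℚ) → ∑ (map f xs) F ≡ ∑[ x ∈ xs ] F (f x)
  ∑-map f []       F = refl
  ∑-map f (x ∷ xs) F = cong (F (f x) +_) (∑-map f xs F)

  ∑-concatMap : {A B : Set} (f : A → List B) (xs : List A) (F : B → ℚ) →
                ∑ (concatMap f xs) F ≡ ∑[ x ∈ xs ] ∑ (f x) F
  ∑-concatMap f []       F = refl
  ∑-concatMap f (x ∷ xs) F =
    trans (∑-++ (f x) (concatMap f xs) F) (cong (∑ (f x) F +_) (∑-concatMap f xs F))

  ∑< : ℕ → (ℕ → ℚ) → ℚ
  ∑< n F = ∑ (upTo n) F

  infix 8 ∑<
  syntax ∑< n (λ i → e) = ∑[ i < n ] e

  private
    ∑-applyUpTo : ∀ (g : ℕ → ℕ) n F → ∑ (applyUpTo g n) F ≡ ∑[ i < n ] F (g i)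
    ∑-applyUpTo g zero    F = refl
    ∑-applyUpTo g (suc n) F =
      cong (F (g 0) +_) (trans (∑-applyUpTo (λ i → g (suc i)) n F) (sym (∑-applyUpTo suc n (λ i → F (g i)))))

  ∑<-suc : ∀ n F → ∑< (suc n) F ≡ F 0 + ∑[ i < n ] F (suc i)
  ∑<-suc n F = cong (F 0 +_) (∑-applyUpTo suc n F)

  ∑<-cong : ∀ n {F G} → (∀ i → i < n → F i ≡ G i) → ∑< n F ≡ ∑< n G
  ∑<-cong zero    e = refl
  ∑<-cong (suc n) {F} {G} e = trans (∑<-suc n F)
    (trans (cong₂ _+_ (e 0 (s≤s z≤n)) (∑<-cong n (λ i i<n → e (suc i) (s≤s i<n)))) (sym (∑<-suc n G)))

  ∑<-zero : ∀ n F → (∀ i → i < n → F i ≡ 0ℚ) → ∑< n F ≡ 0ℚ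
  ∑<-zero n F e = trans (∑<-cong n e) (∑-zero (upTo n) _ (λ _ → refl))

  ∑<-+ : ∀ n F G → ∑[ i < n ] (F i + G i) ≡ ∑< n F + ∑< n G
  ∑<-+ n F G = ∑-+ (upTo n) F G

  ∑<-last : ∀ n F → ∑< (suc n) F ≡ ∑< n F + F n
  ∑<-last zero    F = trans (+-identityʳ (F 0)) (sym (+-identityˡ (F 0)))
  ∑<-last (suc n) F = begin
    ∑< (suc (suc n)) F                         ≡⟨ ∑<-suc (suc n) F ⟩
    F 0 + ∑[ i < suc n ] F (suc i)             ≡⟨ cong (F 0 +_) (∑<-last n (λ i → F (suc i))) ⟩
    F 0 + (∑[ i < n ] F (suc i) + F (suc n))   ≡⟨ sym (+-assoc (F 0) _ _) ⟩
    F 0 + ∑[ i < n ] F (suc i) + F (suc n)     ≡⟨ cong (_+ F (suc n)) (sym (∑<-suc n F)) ⟩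
    ∑< (suc n) F + F (suc n)                   ∎
    where open ≡-Reasoning

  ∑<-split : ∀ a b F → ∑< (a ℕ.+ b) F ≡ ∑< a F + ∑[ i < b ] F (a ℕ.+ i)
  ∑<-split zero    b F = sym (+-identityˡ _)
  ∑<-split (suc a) b F = begin
    ∑< (suc (a ℕ.+ b)) F                                        ≡⟨ ∑<-suc (a ℕ.+ b) F ⟩
    F 0 + ∑[ i < a ℕ.+ b ] F (suc i)                            ≡⟨ cong (F 0 +_) (∑<-split a b (λ i → F (suc i))) ⟩
    F 0 + (∑[ i < a ] F (suc i) + ∑[ i < b ] F (suc a ℕ.+ i))   ≡⟨ sym (+-assoc (F 0) _ _) ⟩
    F 0 + ∑[ i < a ] F (suc i) + ∑[ i < b ] F (suc a ℕ.+ i)     ≡⟨ cong (_+ ∑[ i < b ] F (suc a ℕ.+ i)) (sym (∑<-suc a F)) ⟩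
    ∑< (suc a) F + ∑[ i < b ] F (suc a ℕ.+ i)                   ∎
    where open ≡-Reasoning


module Combination where

  open import Data.List using (List; _++_; map; concatMap)
  open import Data.List.Relation.Unary.All as All using (All)
  open import Data.Product using (_×_; _,_; proj₁; proj₂)
  open import Data.Rational using (ℚ; 0ℚ; _+_; _*_)
  open import Data.Rational.Properties using (*-zeroʳ; *-assoc; *-distribˡ-+)
  open import Data.Rational.Solver using (module +-*-Solver)
  open import Relation.Binary.PropositionalEquality
  open +-*-Solver

  open Sum

  Combination : Set → Set
  Combination K = List (K × ℚ)

  -- Identities between combinations are proved after pairing with an arbitrary test function h.
  ⟪_,_⟫ : {K : Set} → Combination K → (K → ℚ) → ℚ
  ⟪ f , h ⟫ = ∑[ p ∈ f ] (proj₂ p * h (proj₁ p))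

  mapKeys : {K K′ : Set} → (K → K′) → Combination K → Combination K′
  mapKeys φ = map (λ p → φ (proj₁ p) , proj₂ p)

  scaleᶜ : {K : Set} → ℚ → Combination K → Combination K
  scaleᶜ q = map (λ p → proj₁ p , q * proj₂ p)

  ⟪⟫-cong : {K : Set} (f : Combination K) {h h′ : K → ℚ} → (∀ k → h k ≡ h′ k) → ⟪ f , h ⟫ ≡ ⟪ f , h′ ⟫
  ⟪⟫-cong f e = ∑-cong f (λ p → cong (proj₂ p *_) (e (proj₁ p)))

  ⟪⟫-congᴬ : {K : Set} (f : Combination K) {h h′ : K → ℚ} → All (λ p → h (proj₁ p) ≡ h′ (proj₁ p)) f → ⟪ f , h ⟫ ≡ ⟪ f , h′ ⟫
  ⟪⟫-congᴬ f es = ∑-congᴬ f (All.map (λ {p} e → cong (proj₂ p *_) e) es)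

  ⟪⟫-zero : {K : Set} (f : Combination K) (h : K → ℚ) → (∀ k → h k ≡ 0ℚ) → ⟪ f , h ⟫ ≡ 0ℚ
  ⟪⟫-zero f h e = ∑-zero f _ (λ p → trans (cong (proj₂ p *_) (e (proj₁ p))) (*-zeroʳ (proj₂ p)))

  ⟪⟫-zeroᴬ : {K : Set} (f : Combination K) (h : K → ℚ) → All (λ p → h (proj₁ p) ≡ 0ℚ) f → ⟪ f , h ⟫ ≡ 0ℚ
  ⟪⟫-zeroᴬ f h es = trans (∑-congᴬ f (All.map (λ {p} e → cong (proj₂ p *_) e) es))
                          (⟪⟫-zero f (λ _ → 0ℚ) (λ _ → refl))

  ⟪⟫-++ : {K : Set} (f g : Combination K) (h : K → ℚ) → ⟪ f ++ g , h ⟫ ≡ ⟪ f , h ⟫ + ⟪ g , h ⟫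
  ⟪⟫-++ f g h = ∑-++ f g _

  ⟪⟫-+ : {K : Set} (f : Combination K) (h h′ : K → ℚ) → ⟪ f , (λ k → h k + h′ k) ⟫ ≡ ⟪ f , h ⟫ + ⟪ f , h′ ⟫
  ⟪⟫-+ f h h′ = trans (∑-cong f (λ p → *-distribˡ-+ (proj₂ p) _ _)) (∑-+ f _ _)

  ⟪⟫-*ˡ : {K : Set} (f : Combination K) (c : ℚ) (h : K → ℚ) → ⟪ f , (λ k → c * h k) ⟫ ≡ c * ⟪ f , h ⟫
  ⟪⟫-*ˡ f c h = trans (∑-cong f (λ p → solve 3 (λ a b d → a :* (b :* d) := b :* (a :* d)) refl (proj₂ p) c (h (proj₁ p))))
                     (∑-*ˡ f c _)

  ⟪⟫-∑ : {K A : Set} (f : Combination K) (xs : List A) (H : A → K → ℚ) →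
         ⟪ f , (λ k → ∑[ x ∈ xs ] H x k) ⟫ ≡ ∑[ x ∈ xs ] ⟪ f , H x ⟫
  ⟪⟫-∑ f xs H = trans (∑-cong f (λ p → sym (∑-*ˡ xs (proj₂ p) (λ x → H x (proj₁ p))))) (∑-swap f xs _)

  ⟪⟫-scale : {K : Set} (q : ℚ) (f : Combination K) (h : K → ℚ) → ⟪ scaleᶜ q f , h ⟫ ≡ q * ⟪ f , h ⟫
  ⟪⟫-scale q f h = trans (∑-map _ f _) (trans (∑-cong f (λ p → *-assoc q (proj₂ p) _)) (∑-*ˡ f q _))

  ⟪⟫-concatMap : {K A : Set} (F : A → Combination K) (xs : List A) (h : K → ℚ) →
                 ⟪ concatMap F xs , h ⟫ ≡ ∑[ x ∈ xs ] ⟪ F x , h ⟫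
  ⟪⟫-concatMap F xs h = ∑-concatMap F xs _

  ⟪⟫-mapKeys : {K K′ : Set} (φ : K → K′) (f : Combination K) (h : K′ → ℚ) → ⟪ mapKeys φ f , h ⟫ ≡ ⟪ f , (λ k → h (φ k)) ⟫
  ⟪⟫-mapKeys φ f h = ∑-map _ f _

  ⟪⟫-swap : {K K′ : Set} (f : Combination K) (g : Combination K′) (H : K → K′ → ℚ) →
            ⟪ f , (λ k → ⟪ g , H k ⟫) ⟫ ≡ ⟪ g , (λ k′ → ⟪ f , (λ k → H k k′) ⟫) ⟫
  ⟪⟫-swap f g H = trans (∑-cong f (λ p → sym (⟪⟫-*ˡ g (proj₂ p) (H (proj₁ p)))))
    (trans (∑-swap f g _) (∑-cong g (λ q → trans (∑-cong f (λ p →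
       solve 3 (λ a b c → b :* (a :* c) := a :* (b :* c)) refl (proj₂ p) (proj₂ q) (H (proj₁ p) (proj₁ q))))
       (⟪⟫-*ˡ f (proj₂ q) _))))


module Coefficient where

  open import Data.Empty using (⊥-elim)
  open import Data.List using (List; []; _∷_; _++_; map; length)
  open import Data.List.Membership.Propositional using (_∈_)
  open import Data.List.Relation.Unary.Any using (here; there)
  open import Data.List.Properties using (≡-dec; ∷-injectiveˡ; ∷-injectiveʳ)
  open import Data.Nat as ℕ using (ℕ; suc; _≤_; _<_; _∸_; z≤n; s≤s)
  open import Data.Nat.Properties using (m≤n⇒m≤1+n; ≤-trans; ≤-refl; <-irrefl; m+n∸m≡n; m+[n∸m]≡n)
  open import Data.Product using (_,_; proj₁; proj₂)
  open import Data.Rational using (ℚ; 0ℚ; 1ℚ; _+_; _*_)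
  open import Data.Rational.Properties using (*-identityʳ; *-zeroˡ; *-zeroʳ; +-identityˡ; +-identityʳ; *-assoc)
  open import Data.Rational.Solver using (module +-*-Solver)
  open import Data.Sum using (_⊎_; inj₁; inj₂; map₁)
  open import Relation.Binary.PropositionalEquality
  open import Relation.Nullary using (Dec; yes; no; ¬_)
  open +-*-Solver

  open import Defs
  open Sum
  open Combination

  𝟙 : ∀ {A : Set} → Dec A → ℚ
  𝟙 (yes _) = 1ℚ
  𝟙 (no  _) = 0ℚ

  𝟙-yes : ∀ {A : Set} (d : Dec A) → A → 𝟙 d ≡ 1ℚ
  𝟙-yes (yes _) _ = refl
  𝟙-yes (no ¬a) a = ⊥-elim (¬a a)

  𝟙-no : ∀ {A : Set} (d : Dec A) → ¬ A → 𝟙 d ≡ 0ℚ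
  𝟙-no (yes a) ¬a = ⊥-elim (¬a a)
  𝟙-no (no _)  _  = refl

  𝟙-⇔ : ∀ {A B : Set} (d : Dec A) (d′ : Dec B) → (A → B) → (B → A) → 𝟙 d ≡ 𝟙 d′
  𝟙-⇔ (yes a) d′ f g = sym (𝟙-yes d′ (f a))
  𝟙-⇔ (no ¬a) d′ f g = sym (𝟙-no d′ (λ b → ¬a (g b)))

  δ : Composition → Composition → ℚ
  δ β γ = 𝟙 (≡-dec ℕ._≟_ γ β)

  δ-refl : ∀ β → δ β β ≡ 1ℚ
  δ-refl β = 𝟙-yes (≡-dec ℕ._≟_ β β) refl

  δ-≢ : ∀ β γ → γ ≢ β → δ β γ ≡ 0ℚ
  δ-≢ β γ = 𝟙-no (≡-dec ℕ._≟_ γ β)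

  δ-∷ : ∀ y β γ → δ (y ∷ β) (y ∷ γ) ≡ δ β γ
  δ-∷ y β γ = 𝟙-⇔ (≡-dec ℕ._≟_ (y ∷ γ) (y ∷ β)) (≡-dec ℕ._≟_ γ β) ∷-injectiveʳ (cong (y ∷_))

  δℕ : ℕ → ℕ → ℚ
  δℕ j d = 𝟙 (d ℕ.≟ j)

  δℕ-refl : ∀ j → δℕ j j ≡ 1ℚ
  δℕ-refl j = 𝟙-yes (j ℕ.≟ j) refl

  δℕ-≢ : ∀ j d → d ≢ j → δℕ j d ≡ 0ℚ
  δℕ-≢ j d = 𝟙-no (d ℕ.≟ j)

  δℕ-> : ∀ j d → j < d → δℕ j d ≡ 0ℚ
  δℕ-> j d j<d = δℕ-≢ j d (λ e → <-irrefl (sym e) j<d)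

  δℕ-+ : ∀ j i d → i ≤ j → δℕ j (i ℕ.+ d) ≡ δℕ (j ∸ i) d
  δℕ-+ j i d i≤j = 𝟙-⇔ (i ℕ.+ d ℕ.≟ j) (d ℕ.≟ j ∸ i)
    (λ e → trans (sym (m+n∸m≡n i d)) (cong (_∸ i) e)) (λ e → trans (cong (i ℕ.+_) e) (m+[n∸m]≡n i≤j))

  count : Composition → List Composition → ℚ
  count β ws = ∑ ws (δ β)

  count-++ : ∀ β ws vs → count β (ws ++ vs) ≡ count β ws + count β vs
  count-++ β ws vs = ∑-++ ws vs (δ β)

  count-map-∷ : ∀ y β ws → count (y ∷ β) (map (y ∷_) ws) ≡ count β ws
  count-map-∷ y β ws = trans (∑-map (y ∷_) ws (δ (y ∷ β))) (∑-cong ws (δ-∷ y β))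

  count-absent : ∀ β ws → (∀ w → w ∈ ws → w ≢ β) → count β ws ≡ 0ℚ
  count-absent β []       _      = refl
  count-absent β (w ∷ ws) absent =
    cong₂ _+_ (δ-≢ β w (absent w (here refl))) (count-absent β ws (λ w′ m → absent w′ (there m)))

  count-map-∷-≢ : ∀ {h z} β ws → h ≢ z → count (z ∷ β) (map (h ∷_) ws) ≡ 0ℚ
  count-map-∷-≢ {h} {z} β ws h≢z = trans (∑-map (h ∷_) ws (δ (z ∷ β)))
    (∑-zero ws _ (λ w → δ-≢ (z ∷ β) (h ∷ w) (λ e → h≢z (∷-injectiveˡ e))))

  count-[-] : ∀ β → count β (β ∷ []) ≡ 1ℚ
  count-[-] β = trans (cong (_+ 0ℚ) (δ-refl β)) (+-identityʳ 1ℚ)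

  coeff≡⟪⟫δ : (f : QS) (β : Composition) → coeff f β ≡ ⟪ f , δ β ⟫
  coeff≡⟪⟫δ []            β = refl
  coeff≡⟪⟫δ ((γ , c) ∷ f) β with ≡-dec ℕ._≟_ γ β
  ... | yes _ = cong₂ _+_ (sym (*-identityʳ c)) (coeff≡⟪⟫δ f β)
  ... | no  _ = trans (coeff≡⟪⟫δ f β) (sym (trans (cong (_+ ⟪ f , δ β ⟫) (*-zeroʳ c)) (+-identityˡ _)))

  coeff-++ : (f g : QS) (β : Composition) → coeff (f ++ g) β ≡ coeff f β + coeff g β
  coeff-++ f g β = begin
    coeff (f ++ g) β            ≡⟨ coeff≡⟪⟫δ (f ++ g) β ⟩
    ⟪ f ++ g , δ β ⟫            ≡⟨ ⟪⟫-++ f g (δ β) ⟩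
    ⟪ f , δ β ⟫ + ⟪ g , δ β ⟫   ≡⟨ sym (cong₂ _+_ (coeff≡⟪⟫δ f β) (coeff≡⟪⟫δ g β)) ⟩
    coeff f β + coeff g β       ∎
    where open ≡-Reasoning

  ⟪⟫-⊛ : (f g : QS) (h : Composition → ℚ) →
         ⟪ f ⊛ g , h ⟫ ≡ ⟪ f , (λ γ → ⟪ g , (λ γ′ → ∑ (qsh γ γ′) h) ⟫) ⟫
  ⟪⟫-⊛ f g h = trans (∑-concatMap _ f _) (∑-cong f (λ p →
    trans (∑-concatMap _ g _) (trans (∑-cong g (λ q →
      trans (∑-map _ (qsh (proj₁ p) (proj₁ q)) _)
       (trans (∑-*ˡ (qsh (proj₁ p) (proj₁ q)) (proj₂ p * proj₂ q) h)
         (*-assoc (proj₂ p) (proj₂ q) _))))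
     (∑-*ˡ g (proj₂ p) _))))

  coeff-⊛ : (f g : QS) (β : Composition) →
            coeff (f ⊛ g) β ≡ ⟪ f , (λ γ → ⟪ g , (λ γ′ → count β (qsh γ γ′)) ⟫) ⟫
  coeff-⊛ f g β = trans (coeff≡⟪⟫δ (f ⊛ g) β) (⟪⟫-⊛ f g (δ β))

  remove : Composition → QS → QS
  remove β []            = []
  remove β ((γ , c) ∷ f) with ≡-dec ℕ._≟_ γ β
  ... | yes _ = remove β f
  ... | no  _ = (γ , c) ∷ remove β f

  length-remove : (β : Composition) (f : QS) → length (remove β f) ≤ length f
  length-remove β []            = z≤n
  length-remove β ((γ , c) ∷ f) with ≡-dec ℕ._≟_ γ β
  ... | yes _ = m≤n⇒m≤1+n (length-remove β f)
  ... | no  _ = s≤s (length-remove β f)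

  ⟪⟫-remove : (β : Composition) (f : QS) (H : Composition → ℚ) →
              ⟪ f , H ⟫ ≡ coeff f β * H β + ⟪ remove β f , H ⟫
  ⟪⟫-remove β []            H = sym (trans (+-identityʳ _) (*-zeroˡ (H β)))
  ⟪⟫-remove β ((γ , c) ∷ f) H with ≡-dec ℕ._≟_ γ β
  ... | yes refl = trans (cong (c * H γ +_) (⟪⟫-remove γ f H))
        (solve 4 (λ a b d e → a :* b :+ (d :* b :+ e) := (a :+ d) :* b :+ e) refl c (H γ) (coeff f γ) _)
  ... | no  _    = trans (cong (c * H γ +_) (⟪⟫-remove β f H))
        (solve 4 (λ a b d e → a :+ (d :* b :+ e) := d :* b :+ (a :+ e)) refl (c * H γ) (H β) (coeff f β) _)

  coeff-remove-≡ : (β : Composition) (f : QS) → coeff (remove β f) β ≡ 0ℚ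
  coeff-remove-≡ β []            = refl
  coeff-remove-≡ β ((γ , c) ∷ f) with ≡-dec ℕ._≟_ γ β
  ... | yes _   = coeff-remove-≡ β f
  ... | no  γ≢β with ≡-dec ℕ._≟_ γ β
  ...   | yes γ≡β = ⊥-elim (γ≢β γ≡β)
  ...   | no  _   = coeff-remove-≡ β f

  coeff-remove-≢ : (β γ′ : Composition) (f : QS) → γ′ ≢ β → coeff (remove β f) γ′ ≡ coeff f γ′
  coeff-remove-≢ β γ′ []            _ = refl
  coeff-remove-≢ β γ′ ((γ , c) ∷ f) γ′≢β with ≡-dec ℕ._≟_ γ β
  ... | yes refl with ≡-dec ℕ._≟_ γ γ′
  ...   | yes refl = ⊥-elim (γ′≢β refl)
  ...   | no  _    = coeff-remove-≢ β γ′ f γ′≢β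
  coeff-remove-≢ β γ′ ((γ , c) ∷ f) γ′≢β | no _ with ≡-dec ℕ._≟_ γ γ′
  ...   | yes _ = cong (c +_) (coeff-remove-≢ β γ′ f γ′≢β)
  ...   | no  _ = coeff-remove-≢ β γ′ f γ′≢β

  Orthogonal : QS → (Composition → ℚ) → Set
  Orthogonal f H = ∀ γ → coeff f γ ≡ 0ℚ ⊎ H γ ≡ 0ℚ

  Orthogonal-remove : (β : Composition) (f : QS) (H : Composition → ℚ) →
                      (∀ γ → γ ≢ β → coeff f γ ≡ 0ℚ ⊎ H γ ≡ 0ℚ) → Orthogonal (remove β f) H
  Orthogonal-remove β f H hyp γ with ≡-dec ℕ._≟_ γ β
  ... | yes refl = inj₁ (coeff-remove-≡ γ f)
  ... | no  γ≢β  = map₁ (trans (coeff-remove-≢ β γ f γ≢β)) (hyp γ γ≢β)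

  remove-head : (γ : Composition) (c : ℚ) (f : QS) → remove γ ((γ , c) ∷ f) ≡ remove γ f
  remove-head γ c f with ≡-dec ℕ._≟_ γ γ
  ... | yes _   = refl
  ... | no γ≢γ = ⊥-elim (γ≢γ refl)

  -- A key may occur several times in f, so we induct on the length of f, removing one key at a time.
  ⟪⟫-orthogonal : (f : QS) (H : Composition → ℚ) → Orthogonal f H → ⟪ f , H ⟫ ≡ 0ℚ
  ⟪⟫-orthogonal f H = go (length f) f ≤-refl
    where
      product-zero : (a b : ℚ) → a ≡ 0ℚ ⊎ b ≡ 0ℚ → a * b ≡ 0ℚ
      product-zero a b (inj₁ refl) = *-zeroˡ b
      product-zero a b (inj₂ refl) = *-zeroʳ a

      go : (fuel : ℕ) (f : QS) → length f ≤ fuel → Orthogonal f H → ⟪ f , H ⟫ ≡ 0ℚ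
      go fuel       []                 _       _    = refl
      go (suc fuel) f@((γ , c) ∷ f′) (s≤s l) orth = begin
        ⟪ f , H ⟫                              ≡⟨ ⟪⟫-remove γ f H ⟩
        coeff f γ * H γ + ⟪ remove γ f , H ⟫   ≡⟨ cong₂ _+_ (product-zero _ _ (orth γ)) (go fuel (remove γ f) shorter orth′) ⟩
        0ℚ + 0ℚ                                ≡⟨ +-identityʳ 0ℚ ⟩
        0ℚ                                     ∎
        where
          open ≡-Reasoning
          shorter : length (remove γ f) ≤ fuel
          shorter rewrite remove-head γ c f′ = ≤-trans (length-remove γ f′) l
          orth′ : Orthogonal (remove γ f) H
          orth′ = Orthogonal-remove γ f H (λ γ′ _ → orth γ′)

  ⟪⟫-single : (f : QS) (H : Composition → ℚ) (β : Composition) →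
              (∀ γ → γ ≢ β → coeff f γ ≡ 0ℚ ⊎ H γ ≡ 0ℚ) → ⟪ f , H ⟫ ≡ coeff f β * H β
  ⟪⟫-single f H β hyp = begin
    ⟪ f , H ⟫                              ≡⟨ ⟪⟫-remove β f H ⟩
    coeff f β * H β + ⟪ remove β f , H ⟫   ≡⟨ cong (coeff f β * H β +_) (⟪⟫-orthogonal (remove β f) H (Orthogonal-remove β f H hyp)) ⟩
    coeff f β * H β + 0ℚ                   ≡⟨ +-identityʳ _ ⟩
    coeff f β * H β                        ∎
    where open ≡-Reasoning


module LexOrder where

  open import Data.List using (List; []; _∷_; _++_; length; take; drop)
  open import Data.List.Properties using (take++drop≡id; ++-assoc; length-++)
  open import Data.List.Relation.Binary.Lex.Core using (base; halt; this; next)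
  open import Data.Nat as ℕ using (ℕ; zero; suc; _≤_; _<_; z≤n; s≤s)
  open import Data.Nat.Properties using (<-irrefl; <-trans; ≤-trans; ≤-reflexive; m≤m+n)
  open import Data.Product using (Σ; ∃; _,_)
  open import Data.Sum using (_⊎_; inj₁; inj₂)
  open import Relation.Binary.PropositionalEquality
  open import Relation.Nullary using (¬_; Dec)
  open import Relation.Nullary.Decidable using (_×-dec_; _⊎-dec_)
  import Data.List.Relation.Binary.Lex.Strict as Lex
  import Data.List.Relation.Binary.Pointwise as Pointwise

  open import Defs using (wt; _<lex_; _<wll_)

  data LexAt : ℕ → List ℕ → List ℕ → Set where
    now   : ∀ {a b u v} → a < b → LexAt zero (a ∷ u) (b ∷ v)
    later : ∀ {d a u v} → LexAt d u v → LexAt (suc d) (a ∷ u) (a ∷ v)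

  _⊏_ : List ℕ → List ℕ → Set
  u ⊏ v = ∃ λ d → LexAt d u v

  _⊑_ : List ℕ → List ℕ → Set
  u ⊑ v = u ≡ v ⊎ u ⊏ v

  data _≼_ : List ℕ → List ℕ → Set where
    []≼     : ∀ {v} → [] ≼ v
    ≼[]     : ∀ {u} → u ≼ []
    ≼-now   : ∀ {a b u v} → a < b → (a ∷ u) ≼ (b ∷ v)
    ≼-later : ∀ {a u v} → u ≼ v → (a ∷ u) ≼ (a ∷ v)

  Prefix : List ℕ → List ℕ → Set
  Prefix u S = Σ (List ℕ) (λ z → u ++ z ≡ S)

  LexAt-++ʳ : ∀ {d u v} Y → LexAt d u v → LexAt d u (v ++ Y)
  LexAt-++ʳ Y (now p)   = now p
  LexAt-++ʳ Y (later l) = later (LexAt-++ʳ Y l)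

  LexAt-irrefl : ∀ {d u} → ¬ LexAt d u u
  LexAt-irrefl (now p)   = <-irrefl refl p
  LexAt-irrefl (later l) = LexAt-irrefl l

  LexAt-<-lengthʳ : ∀ {d u v} → LexAt d u v → d < length v
  LexAt-<-lengthʳ (now p)   = s≤s z≤n
  LexAt-<-lengthʳ (later l) = s≤s (LexAt-<-lengthʳ l)

  LexAt-take : ∀ {d u v} i → LexAt d u v → i ≤ d → take i u ≡ take i v
  LexAt-take zero    l         le        = refl
  LexAt-take (suc i) (later l) (s≤s le) = cong (_ ∷_) (LexAt-take i l le)

  LexAt⇒≼ : ∀ {d u v} → LexAt d u v → u ≼ v
  LexAt⇒≼ (now p)   = ≼-now p
  LexAt⇒≼ (later l) = ≼-later (LexAt⇒≼ l)

  LexAt⇒<lex : ∀ {d u v} → LexAt d u v → u <lex v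
  LexAt⇒<lex (now p)   = this p
  LexAt⇒<lex (later l) = next refl (LexAt⇒<lex l)

  LexAt-trans : ∀ {d e u v w} → LexAt d u v → LexAt e v w → u ⊏ w
  LexAt-trans (now p)   (now q)    = 0 , now (<-trans p q)
  LexAt-trans (now p)   (later l)  = 0 , now p
  LexAt-trans (later l) (now q)    = 0 , now q
  LexAt-trans (later l) (later l′) with LexAt-trans l l′
  ... | d , r = suc d , later r

  <lex⇒⊏ : ∀ {u v} → u <lex v → length v ≤ length u → u ⊏ v
  <lex⇒⊏ (base ())
  <lex⇒⊏ halt ()
  <lex⇒⊏ (this p) le = 0 , now p
  <lex⇒⊏ (next refl l) (s≤s le) with <lex⇒⊏ l le
  ... | d , r = suc d , later r

  ⊑-∷ : ∀ {a u v} → u ⊑ v → (a ∷ u) ⊑ (a ∷ v)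
  ⊑-∷ (inj₁ refl)    = inj₁ refl
  ⊑-∷ (inj₂ (d , l)) = inj₂ (suc d , later l)

  ≼-refl : ∀ u → u ≼ u
  ≼-refl []      = []≼
  ≼-refl (x ∷ u) = ≼-later (≼-refl u)

  Prefix⇒≼ : ∀ {u S} → Prefix u S → u ≼ S
  Prefix⇒≼ {[]}    _        = []≼
  Prefix⇒≼ {x ∷ u} (z , refl) = ≼-later (Prefix⇒≼ (z , refl))

  ≼-Prefixˡ : ∀ {A S v} → A ≼ S → Prefix v A → v ≼ S
  ≼-Prefixˡ {v = []}    p           _          = []≼
  ≼-Prefixˡ {v = x ∷ v} ≼[]         (z , e)    = ≼[]
  ≼-Prefixˡ {v = x ∷ v} (≼-now q)   (z , refl) = ≼-now q
  ≼-Prefixˡ {v = x ∷ v} (≼-later p) (z , refl) = ≼-later (≼-Prefixˡ p (z , refl))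
  ≼-Prefixˡ {v = x ∷ v} []≼         (z , ())

  ≼-LexAt⇒⊏ : ∀ {d α S} w → LexAt d α S → take (suc d) w ≼ α → suc d ≤ length w → w ⊏ S
  ≼-LexAt⇒⊏ (c ∷ w) (now p)   (≼-now q)   le        = 0 , now (<-trans q p)
  ≼-LexAt⇒⊏ (c ∷ w) (now p)   (≼-later q) le        = 0 , now p
  ≼-LexAt⇒⊏ (c ∷ w) (later l) (≼-now q)   le        = 0 , now q
  ≼-LexAt⇒⊏ (c ∷ w) (later l) (≼-later q) (s≤s le) with ≼-LexAt⇒⊏ w l q le
  ... | d , r = suc d , later r

  ≼-LexAt⇒≼ : ∀ {d α S} w → LexAt d α S → w ≼ α → length w ≤ d → w ≼ S
  ≼-LexAt⇒≼ []      l         p           le        = []≼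
  ≼-LexAt⇒≼ (c ∷ w) (later l) (≼-now q)   le        = ≼-now q
  ≼-LexAt⇒≼ (c ∷ w) (later l) (≼-later q) (s≤s le) = ≼-later (≼-LexAt⇒≼ w l q le)
  ≼-LexAt⇒≼ (c ∷ w) (now x)   p           ()

  take-++-≤ : ∀ n (xs ys : List ℕ) → n ≤ length xs → take n (xs ++ ys) ≡ take n xs
  take-++-≤ zero    xs       ys le        = refl
  take-++-≤ (suc n) (x ∷ xs) ys (s≤s le) = cong (x ∷_) (take-++-≤ n xs ys le)

  length-take-≤ : ∀ n (xs : List ℕ) → n ≤ length xs → length (take n xs) ≡ n
  length-take-≤ zero    xs       le        = refl
  length-take-≤ (suc n) (x ∷ xs) (s≤s le) = cong suc (length-take-≤ n xs le)

  Prefix-take : ∀ n (xs : List ℕ) → Prefix (take n xs) xs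
  Prefix-take n xs = drop n xs , take++drop≡id n xs

  Prefix-trans : ∀ {u v w} → Prefix u v → Prefix v w → Prefix u w
  Prefix-trans {u} (z , refl) (z′ , refl) = z ++ z′ , sym (++-assoc u z z′)

  take-Prefix : ∀ {u S} i → Prefix u S → i ≤ length u → take i u ≡ take i S
  take-Prefix {u} i (z , refl) le = sym (take-++-≤ i u z le)

  Prefix-length : ∀ {u S} → Prefix u S → length u ≤ length S
  Prefix-length {u} (z , refl) = ≤-trans (m≤m+n (length u) (length z)) (≤-reflexive (sym (length-++ u)))

  <lex-irrefl : ∀ {u} → ¬ (u <lex u)
  <lex-irrefl = Lex.<-irreflexive (λ e → <-irrefl e) (Pointwise.refl refl)

  _<lex?_ : ∀ u v → Dec (u <lex v)
  u <lex? v = Lex.<-decidable ℕ._≟_ ℕ._<?_ u v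

  <wll-irrefl : ∀ {u} → ¬ (u <wll u)
  <wll-irrefl (inj₁ w<w)                    = <-irrefl refl w<w
  <wll-irrefl (inj₂ (_ , inj₁ l<l))         = <-irrefl refl l<l
  <wll-irrefl (inj₂ (_ , inj₂ (_ , u<u)))   = <lex-irrefl u<u

  _<wll?_ : ∀ u v → Dec (u <wll v)
  u <wll? v = (wt u ℕ.<? wt v) ⊎-dec ((wt u ℕ.≟ wt v) ×-dec ((length u ℕ.<? length v) ⊎-dec ((length u ℕ.≟ length v) ×-dec (u <lex? v))))


module QuasiShuffle where

  open import Data.Empty using (⊥-elim)
  open import Data.List using (List; []; _∷_; _++_; map; length; take)
  open import Data.List.Properties using (length-++)
  open import Data.List.Membership.Propositional using (_∈_)
  open import Data.List.Membership.Propositional.Properties using (∈-++⁻; ∈-++⁺ˡ; ∈-++⁺ʳ; ∈-map⁻; ∈-map⁺)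
  open import Data.List.Relation.Unary.All using (_∷_)
  open import Data.Rational as ℚ using (0ℚ)
  open import Data.List.Relation.Unary.Any using (here)
  open import Data.Nat using (ℕ; zero; suc; _≤_; z≤n; s≤s; _+_)
  open import Data.Nat.Properties
    using (≤-refl; ≤-reflexive; ≤-trans; <-irrefl; <-≤-trans; n≤1+n; m≤m+n; +-suc; +-identityʳ; +-assoc; +-comm;
           suc-injective; ≤-pred; +-commutativeSemigroup)
  open import Data.Product using (Σ; Σ-syntax; _×_; _,_)
  open import Data.Sum using (inj₁; inj₂)
  open import Relation.Binary.PropositionalEquality
  open import Relation.Nullary using (¬_)
  open import Algebra.Properties.CommutativeSemigroup +-commutativeSemigroup using (interchange; x∙yz≈y∙xz)

  open import Defs
  open Coefficient
  open LexOrder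

  qsh-[]ʳ : (a : Composition) → qsh a [] ≡ a ∷ []
  qsh-[]ʳ []      = refl
  qsh-[]ʳ (x ∷ a) = refl

  ∈-qsh-[]ˡ : ∀ {b w} → w ∈ qsh [] b → w ≡ b
  ∈-qsh-[]ˡ (here e) = e

  ∈-qsh-[]ʳ : ∀ {a w} → w ∈ qsh a [] → w ≡ a
  ∈-qsh-[]ʳ {a} p rewrite qsh-[]ʳ a with p
  ... | here e = e

  data QshView (x y : ℕ) (a b : Composition) (w : Composition) : Set where
    takeˡ : ∀ w′ → w ≡ x ∷ w′       → w′ ∈ qsh a (y ∷ b) → QshView x y a b w
    takeʳ : ∀ w′ → w ≡ y ∷ w′       → w′ ∈ qsh (x ∷ a) b → QshView x y a b w
    merge : ∀ w′ → w ≡ (x + y) ∷ w′ → w′ ∈ qsh a b       → QshView x y a b w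

  qsh-view : ∀ {x y a b w} → w ∈ qsh (x ∷ a) (y ∷ b) → QshView x y a b w
  qsh-view {x} {y} {a} {b} p with ∈-++⁻ (map (x ∷_) (qsh a (y ∷ b))) p
  ... | inj₁ q with ∈-map⁻ (x ∷_) q
  ...   | w′ , m , e = takeˡ w′ e m
  qsh-view {x} {y} {a} {b} p | inj₂ q with ∈-++⁻ (map (y ∷_) (qsh (x ∷ a) b)) q
  ... | inj₁ r with ∈-map⁻ (y ∷_) r
  ...   | w′ , m , e = takeʳ w′ e m
  qsh-view {x} {y} {a} {b} p | inj₂ q | inj₂ r with ∈-map⁻ ((x + y) ∷_) r
  ...   | w′ , m , e = merge w′ e m

  ∈-qsh-∷ˡ : ∀ {x a b w} → w ∈ qsh a b → x ∷ w ∈ qsh (x ∷ a) b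
  ∈-qsh-∷ˡ {x} {a} {[]}    m rewrite ∈-qsh-[]ʳ m = here refl
  ∈-qsh-∷ˡ {x} {a} {y ∷ b} m = ∈-++⁺ˡ (∈-map⁺ (x ∷_) m)

  ∈-qsh-∷ʳ : ∀ {y a b w} → w ∈ qsh a b → y ∷ w ∈ qsh a (y ∷ b)
  ∈-qsh-∷ʳ {y} {[]}    {b} m rewrite ∈-qsh-[]ˡ m = here refl
  ∈-qsh-∷ʳ {y} {x ∷ a} {b} m = ∈-++⁺ʳ (map (x ∷_) (qsh a (y ∷ b))) (∈-++⁺ˡ (∈-map⁺ (y ∷_) m))

  ∈-qsh-merge : ∀ {x y a b w} → w ∈ qsh a b → (x + y) ∷ w ∈ qsh (x ∷ a) (y ∷ b)
  ∈-qsh-merge {x} {y} {a} {b} m =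
    ∈-++⁺ʳ (map (x ∷_) (qsh a (y ∷ b))) (∈-++⁺ʳ (map (y ∷_) (qsh (x ∷ a) b)) (∈-map⁺ ((x + y) ∷_) m))

  ++-∈-qsh : ∀ a b → a ++ b ∈ qsh a b
  ++-∈-qsh []      b = here refl
  ++-∈-qsh (x ∷ a) b = ∈-qsh-∷ˡ {x} {a} {b} (++-∈-qsh a b)

  ∈-qsh-comm : ∀ a b {w} → w ∈ qsh a b → w ∈ qsh b a
  ∈-qsh-comm []      []      m rewrite ∈-qsh-[]ˡ m = here refl
  ∈-qsh-comm []      (y ∷ b) m rewrite ∈-qsh-[]ˡ m = here refl
  ∈-qsh-comm (x ∷ a) []      m rewrite ∈-qsh-[]ʳ m = here refl
  ∈-qsh-comm (x ∷ a) (y ∷ b) m with qsh-view {x} {y} {a} {b} m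
  ... | takeˡ w′ refl m′ = ∈-qsh-∷ʳ {x} {y ∷ b} {a} (∈-qsh-comm a (y ∷ b) m′)
  ... | takeʳ w′ refl m′ = ∈-qsh-∷ˡ {y} {b} {x ∷ a} (∈-qsh-comm (x ∷ a) b m′)
  ... | merge w′ refl m′ rewrite +-comm x y = ∈-qsh-merge {y} {x} {b} {a} (∈-qsh-comm a b m′)

  qsh-length-≤ : ∀ a b {w} → w ∈ qsh a b → length w ≤ length a + length b
  qsh-length-≤ []      b m rewrite ∈-qsh-[]ˡ m = ≤-refl
  qsh-length-≤ (x ∷ a) [] m rewrite ∈-qsh-[]ʳ m = ≤-reflexive (cong suc (sym (+-identityʳ (length a))))
  qsh-length-≤ (x ∷ a) (y ∷ b) m with qsh-view {x} {y} {a} {b} m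
  ... | takeˡ w′ refl m′ = s≤s (qsh-length-≤ a (y ∷ b) m′)
  ... | takeʳ w′ refl m′ = ≤-trans (s≤s (qsh-length-≤ (x ∷ a) b m′)) (≤-reflexive (sym (+-suc (suc (length a)) (length b))))
  ... | merge w′ refl m′ = ≤-trans (s≤s (qsh-length-≤ a b m′))
                                   (s≤s (≤-trans (n≤1+n _) (≤-reflexive (sym (+-suc (length a) (length b))))))

  -- Shuffles without merging are exactly the quasi-shuffles of maximal length.
  FullLength : Composition → Composition → Composition → Set
  FullLength a b w = length w ≡ length a + length b

  FullLength-∷ˡ : ∀ {y u v w′} → FullLength (y ∷ u) v (y ∷ w′) → FullLength u v w′
  FullLength-∷ˡ = suc-injective

  FullLength-∷ʳ : ∀ {u y v w′} → FullLength u (y ∷ v) (y ∷ w′) → FullLength u v w′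
  FullLength-∷ʳ {u} {y} {v} f = suc-injective (trans f (+-suc (length u) (length v)))

  FullLength-comm : ∀ {u v w} → FullLength u v w → FullLength v u w
  FullLength-comm {u} {v} f = trans f (+-comm (length u) (length v))

  merge-not-full : ∀ x y a b w′ → w′ ∈ qsh a b → ¬ FullLength (x ∷ a) (y ∷ b) ((x + y) ∷ w′)
  merge-not-full x y a b w′ m full = <-irrefl (suc-injective full)
    (≤-trans (s≤s (qsh-length-≤ a b m)) (≤-reflexive (sym (+-suc (length a) (length b)))))

  wt-∈qsh : ∀ a b {w} → w ∈ qsh a b → wt w ≡ wt a + wt b
  wt-∈qsh []      b m rewrite ∈-qsh-[]ˡ m = refl
  wt-∈qsh (x ∷ a) [] m rewrite ∈-qsh-[]ʳ m = sym (+-identityʳ _)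
  wt-∈qsh (x ∷ a) (y ∷ b) m with qsh-view {x} {y} {a} {b} m
  ... | takeˡ w′ refl m′ = trans (cong (x +_) (wt-∈qsh a (y ∷ b) m′)) (sym (+-assoc x (wt a) _))
  ... | takeʳ w′ refl m′ = trans (cong (y +_) (wt-∈qsh (x ∷ a) b m′)) (x∙yz≈y∙xz y (x + wt a) (wt b))
  ... | merge w′ refl m′ = trans (cong ((x + y) +_) (wt-∈qsh a b m′)) (interchange x y (wt a) (wt b))

  IsComposition-∈qsh : ∀ a b {w} → IsComposition a → IsComposition b → w ∈ qsh a b → IsComposition w
  IsComposition-∈qsh []      b _ pb m rewrite ∈-qsh-[]ˡ m = pb
  IsComposition-∈qsh (x ∷ a) [] pa _ m rewrite ∈-qsh-[]ʳ m = pa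
  IsComposition-∈qsh (x ∷ a) (y ∷ b) (px ∷ pa) (py ∷ pb) m with qsh-view {x} {y} {a} {b} m
  ... | takeˡ w′ refl m′ = px ∷ IsComposition-∈qsh a (y ∷ b) pa (py ∷ pb) m′
  ... | takeʳ w′ refl m′ = py ∷ IsComposition-∈qsh (x ∷ a) b (px ∷ pa) pb m′
  ... | merge w′ refl m′ = <-≤-trans px (m≤m+n x y) ∷ IsComposition-∈qsh a b pa pb m′

  qsh-prefix : ∀ a b w → w ∈ qsh a b → FullLength a b w → ∀ k → k ≤ length w →
    Σ ℕ λ i → Σ ℕ λ j → i ≤ length a × j ≤ length b × i + j ≡ k × take k w ∈ qsh (take i a) (take j b)
  qsh-prefix a b w m f zero le = 0 , 0 , z≤n , z≤n , refl , subst ([] ∈_) (sym (qsh-[]ʳ [])) (here refl)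
  qsh-prefix [] b w m f (suc k) le rewrite ∈-qsh-[]ˡ m = 0 , suc k , z≤n , le , refl , here refl
  qsh-prefix (x ∷ a) [] w m f (suc k) le rewrite ∈-qsh-[]ʳ m =
    suc k , 0 , ≤-trans le (≤-reflexive (trans f (cong suc (+-identityʳ (length a))))) , z≤n , +-identityʳ _ ,
    subst (take (suc k) (x ∷ a) ∈_) (sym (qsh-[]ʳ (take (suc k) (x ∷ a)))) (here refl)
  qsh-prefix (x ∷ a) (y ∷ b) w m f (suc k) le with qsh-view {x} {y} {a} {b} m
  ... | takeˡ w′ refl m′ with qsh-prefix a (y ∷ b) w′ m′ (suc-injective f) k (≤-pred le)
  ...   | i , j , li , lj , e , m″ = suc i , j , s≤s li , lj , cong suc e , ∈-qsh-∷ˡ {x} {take i a} {take j (y ∷ b)} m″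
  qsh-prefix (x ∷ a) (y ∷ b) w m f (suc k) le | takeʳ w′ refl m′
    with qsh-prefix (x ∷ a) b w′ m′ (suc-injective (trans f (+-suc (suc (length a)) (length b)))) k (≤-pred le)
  ...   | i , j , li , lj , e , m″ = i , suc j , li , s≤s lj , trans (+-suc i j) (cong suc e) , ∈-qsh-∷ʳ {y} {take i (x ∷ a)} {take j b} m″
  qsh-prefix (x ∷ a) (y ∷ b) w m f (suc k) le | merge w′ refl m′ = ⊥-elim (merge-not-full x y a b w′ m′ f)

  count-qsh-∷ : ∀ T x y a b → count T (qsh (x ∷ a) (y ∷ b)) ≡
    count T (map (x ∷_) (qsh a (y ∷ b))) ℚ.+ (count T (map (y ∷_) (qsh (x ∷ a) b)) ℚ.+ count T (map ((x + y) ∷_) (qsh a b)))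
  count-qsh-∷ T x y a b = trans (count-++ T (map (x ∷_) (qsh a (y ∷ b))) _)
    (cong (count T (map (x ∷_) (qsh a (y ∷ b))) ℚ.+_) (count-++ T (map (y ∷_) (qsh (x ∷ a) b)) _))

  count-map-∷-⊏ : ∀ h A B T → (∀ w′ → w′ ∈ qsh A B → FullLength A B w′ → (h ∷ w′) ⊏ T) →
                  length T ≡ suc (length A + length B) → count T (map (h ∷_) (qsh A B)) ≡ 0ℚ
  count-map-∷-⊏ h A B T below length-T = count-absent T _ absent
    where
      absent : ∀ w → w ∈ map (h ∷_) (qsh A B) → w ≢ T
      absent w m w≡T with ∈-map⁻ (h ∷_) m
      ... | w′ , m′ , refl with below w′ m′ (suc-injective (trans (cong length w≡T) length-T))
      ...   | d , l rewrite w≡T = LexAt-irrefl l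

  record TopShuffle (u v T : List ℕ) (k : ℚ.ℚ) : Set where
    field
      below       : ∀ w → w ∈ qsh u v → FullLength u v w → w ⊑ T
      occurrences : count T (qsh u v) ≡ k

  shuffle-⊏-mono : ∀ a γ γ′ w → length γ ≡ length γ′ → γ ⊏ γ′ → w ∈ qsh a γ → FullLength a γ w →
                   Σ[ w′ ∈ List ℕ ] (w′ ∈ qsh a γ′ × FullLength a γ′ w′ × w ⊏ w′)
  shuffle-⊏-mono [] γ γ′ w _ γ⊏γ′ m _ rewrite ∈-qsh-[]ˡ m = γ′ , here refl , refl , γ⊏γ′
  shuffle-⊏-mono (x ∷ a) []      γ′ w _  (d , ()) m f
  shuffle-⊏-mono (x ∷ a) (g ∷ γ) [] w () _ m f
  shuffle-⊏-mono (x ∷ a) (g ∷ γ) (g′ ∷ γ′) w len γ⊏γ′ m f with qsh-view {x} {g} {a} {γ} m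
  ... | takeˡ w₁ refl m₁ with shuffle-⊏-mono a (g ∷ γ) (g′ ∷ γ′) w₁ len γ⊏γ′ m₁ (FullLength-∷ˡ {x} {a} {g ∷ γ} {w₁} f)
  ...   | w₁′ , m₁′ , f₁′ , (d , l) = x ∷ w₁′ , ∈-qsh-∷ˡ {x} {a} {g′ ∷ γ′} m₁′ , cong suc f₁′ , suc d , later l
  shuffle-⊏-mono (x ∷ a) (g ∷ γ) (g′ ∷ γ′) w len (zero , now g<g′) m f | takeʳ w₁ refl m₁ =
    g′ ∷ ((x ∷ a) ++ γ′) , ∈-qsh-∷ʳ {g′} {x ∷ a} {γ′} (++-∈-qsh (x ∷ a) γ′) ,
    cong suc (trans (cong suc (length-++ a)) (sym (+-suc (length a) (length γ′)))) , 0 , now g<g′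
  shuffle-⊏-mono (x ∷ a) (g ∷ γ) (g ∷ γ′) w len (suc d , later l) m f | takeʳ w₁ refl m₁
    with shuffle-⊏-mono (x ∷ a) γ γ′ w₁ (suc-injective len) (d , l) m₁ (FullLength-∷ʳ {x ∷ a} {g} {γ} {w₁} f)
  ... | w₁′ , m₁′ , f₁′ , (d′ , l′) = g ∷ w₁′ , ∈-qsh-∷ʳ {g} {x ∷ a} {γ′} m₁′ ,
        cong suc (trans f₁′ (sym (+-suc (length a) (length γ′)))) , suc d′ , later l′
  shuffle-⊏-mono (x ∷ a) (g ∷ γ) (g′ ∷ γ′) w len γ⊏γ′ m f | merge w₁ refl m₁ = ⊥-elim (merge-not-full x g a γ w₁ m₁ f)


module RationalArith where

  open import Data.Integer as ℤ using (ℤ; +_)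
  import Data.Integer.Properties as ℤ
  open import Data.Nat as ℕ using (ℕ; zero; suc; _!)
  open import Data.Nat.Properties using (_!≢0; m*n≢0)
  import Data.Nat.Properties as ℕ
  open import Data.Nat.Tactic.RingSolver using (solve-∀)
  open import Data.Rational using (ℚ; 1ℚ; _+_; _*_; -_; _/_; toℚᵘ)
  open import Data.Rational.Properties
    using (toℚᵘ-injective; toℚᵘ-homo-+; toℚᵘ-homo-*; toℚᵘ-homo‿-; toℚᵘ-fromℚᵘ; toℚᵘ-cong; +-identityˡ; +-assoc;
           *-assoc; *-comm; *-identityˡ)
  open import Data.Rational.Unnormalised using (mkℚᵘ; *≡*; _≃_)
  import Data.Rational.Unnormalised.Properties as ℚᵘ
  open import Relation.Binary.PropositionalEquality

  -- The embedding used by Defs.fromℤ (coefficients c / 1).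
  fromℕ : ℕ → ℚ
  fromℕ n = + n / 1

  sign : ℕ → ℚ
  sign k = (ℤ.-1ℤ ℤ.^ k) / 1

  invFactorial : ℕ → ℚ
  invFactorial m = ((+ 1) / (m !)) {{m !≢0}}

  -- Identities in ℚ are checked in ℚᵘ (via toℚᵘ), where they are cross-multiplication identities in ℤ.
  private
    toℚᵘ-fromℕ : ∀ n → toℚᵘ (fromℕ n) ≃ mkℚᵘ (+ n) 0
    toℚᵘ-fromℕ n = toℚᵘ-fromℚᵘ (mkℚᵘ (+ n) 0)

  fromℕ-suc : ∀ n → fromℕ (suc n) ≡ 1ℚ + fromℕ n
  fromℕ-suc n = toℚᵘ-injective (ℚᵘ.≃-trans (toℚᵘ-fromℕ (suc n)) (ℚᵘ.≃-trans (*≡* same-fraction)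
    (ℚᵘ.≃-sym (ℚᵘ.≃-trans (toℚᵘ-homo-+ 1ℚ (fromℕ n)) (ℚᵘ.+-cong (toℚᵘ-fromℕ 1) (toℚᵘ-fromℕ n))))))
    where
      same-fraction : + suc n ℤ.* + 1 ≡ (+ 1 ℤ.* + 1 ℤ.+ + n ℤ.* + 1) ℤ.* + 1
      same-fraction = trans (ℤ.*-identityʳ (+ suc n))
        (sym (trans (ℤ.*-identityʳ _) (cong₂ ℤ._+_ (ℤ.*-identityʳ (+ 1)) (ℤ.*-identityʳ (+ n)))))

  fromℕ-+ : ∀ a b → fromℕ (a ℕ.+ b) ≡ fromℕ a + fromℕ b
  fromℕ-+ zero    b = sym (+-identityˡ _)
  fromℕ-+ (suc a) b = begin
    fromℕ (suc (a ℕ.+ b))           ≡⟨ fromℕ-suc (a ℕ.+ b) ⟩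
    1ℚ + fromℕ (a ℕ.+ b)            ≡⟨ cong (λ q → 1ℚ + q) (fromℕ-+ a b) ⟩
    1ℚ + (fromℕ a + fromℕ b)        ≡⟨ sym (+-assoc 1ℚ (fromℕ a) (fromℕ b)) ⟩
    (1ℚ + fromℕ a) + fromℕ b        ≡⟨ cong (_+ fromℕ b) (sym (fromℕ-suc a)) ⟩
    fromℕ (suc a) + fromℕ b         ∎
    where open ≡-Reasoning

  fromℕ-injective : ∀ a b → fromℕ a ≡ fromℕ b → a ≡ b
  fromℕ-injective a b e
    with ℚᵘ.≃-trans (ℚᵘ.≃-sym (toℚᵘ-fromℕ a)) (ℚᵘ.≃-trans (toℚᵘ-cong e) (toℚᵘ-fromℕ b))
  ... | *≡* eq = ℤ.+-injective (trans (sym (ℤ.*-identityʳ (+ a))) (trans eq (ℤ.*-identityʳ (+ b))))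

  fromℕ-*-/ : ∀ z k → fromℕ (suc k) * (z / suc k) ≡ z / 1
  fromℕ-*-/ z k = toℚᵘ-injective (ℚᵘ.≃-trans (toℚᵘ-homo-* (fromℕ (suc k)) (z / suc k))
    (ℚᵘ.≃-trans (ℚᵘ.*-cong (toℚᵘ-fromℕ (suc k)) (toℚᵘ-fromℚᵘ (mkℚᵘ z k)))
    (ℚᵘ.≃-trans (*≡* (trans (ℤ.*-identityʳ _) (trans (ℤ.*-comm (+ suc k) z) (cong (z ℤ.*_) (cong +_ (sym (ℕ.*-identityˡ (suc k))))))))
      (ℚᵘ.≃-sym (toℚᵘ-fromℚᵘ (mkℚᵘ z 0))))))

  inverse-fromℕ-suc : ∀ n → (+ 1 / suc n) * fromℕ (suc n) ≡ 1ℚ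
  inverse-fromℕ-suc n = trans (*-comm (+ 1 / suc n) _) (fromℕ-*-/ (+ 1) n)

  fromℕ-suc-*-cancelˡ : ∀ n a b → fromℕ (suc n) * a ≡ fromℕ (suc n) * b → a ≡ b
  fromℕ-suc-*-cancelˡ n a b e = begin
    a                              ≡⟨ sym (*-identityˡ a) ⟩
    1ℚ * a                         ≡⟨ cong (_* a) (sym (inverse-fromℕ-suc n)) ⟩
    (1/n+1 * fromℕ (suc n)) * a    ≡⟨ *-assoc 1/n+1 _ a ⟩
    1/n+1 * (fromℕ (suc n) * a)    ≡⟨ cong (1/n+1 *_) e ⟩
    1/n+1 * (fromℕ (suc n) * b)    ≡⟨ sym (*-assoc 1/n+1 _ b) ⟩
    (1/n+1 * fromℕ (suc n)) * b    ≡⟨ cong (_* b) (inverse-fromℕ-suc n) ⟩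
    1ℚ * b                         ≡⟨ *-identityˡ b ⟩
    b                              ∎
    where
      open ≡-Reasoning
      1/n+1 : ℚ
      1/n+1 = + 1 / suc n

  inv-*-fromℕ : ∀ a d .{{_ : ℕ.NonZero d}} →
                ((+ 1 / (suc a ℕ.* d)) {{m*n≢0 (suc a) d}}) * fromℕ (suc a) ≡ + 1 / d
  inv-*-fromℕ a (suc d) = toℚᵘ-injective (ℚᵘ.≃-trans (toℚᵘ-homo-* (+ 1 / (suc a ℕ.* suc d)) (fromℕ (suc a)))
    (ℚᵘ.≃-trans (ℚᵘ.*-cong (toℚᵘ-fromℚᵘ (mkℚᵘ (+ 1) (d ℕ.+ a ℕ.* suc d))) (toℚᵘ-fromℕ (suc a)))
    (ℚᵘ.≃-trans (*≡* (cong +_ (same-fraction a d))) (ℚᵘ.≃-sym (toℚᵘ-fromℚᵘ (mkℚᵘ (+ 1) d))))))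
    where
      same-fraction : ∀ a d → (1 ℕ.* suc a) ℕ.* suc d ≡ 1 ℕ.* ((suc a ℕ.* suc d) ℕ.* 1)
      same-fraction = solve-∀

  invFactorial-suc : ∀ m → invFactorial (suc m) * fromℕ (suc m) ≡ invFactorial m
  invFactorial-suc m = inv-*-fromℕ m (m !) {{m !≢0}}

  sign-suc : ∀ k → sign (suc k) ≡ - sign k
  sign-suc k = toℚᵘ-injective (ℚᵘ.≃-trans (toℚᵘ-fromℚᵘ (mkℚᵘ (ℤ.-1ℤ ℤ.^ suc k) 0))
    (ℚᵘ.≃-trans (*≡* (cong (ℤ._* + 1) (ℤ.-1*i≡-i (ℤ.-1ℤ ℤ.^ k))))
    (ℚᵘ.≃-sym (ℚᵘ.≃-trans (toℚᵘ-homo‿- (sign k)) (ℚᵘ.-‿cong (toℚᵘ-fromℚᵘ (mkℚᵘ (ℤ.-1ℤ ℤ.^ k) 0)))))))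


module LyndonShuffle (x : ℕ) (a′ : List ℕ) (lyndon : Lyndon (x ∷ a′)) (0<x : 0 < x) where

  open import Data.List using (List; []; _∷_; _++_; map; length; take)
  open import Data.Nat as ℕ using (ℕ; zero; suc; _≤_; _<_; s≤s; _+_)
  open import Data.Empty using (⊥-elim)
  open import Data.List.Membership.Propositional using (_∈_)
  open import Data.List.Properties using (∷-injectiveˡ; ∷-injectiveʳ; length-++; ++-assoc; ++-identityʳ; ++-conicalˡ; take-all)
  open import Data.Nat.Properties
    using (≤-refl; ≤-reflexive; ≤-trans; ≤-pred; <⇒≤; ≰⇒>; n≤1+n; m≤m+n; m≤n+m; m∸n≤m; m+n∸n≡m; +-suc; +-comm; +-assoc;
           <-irrefl; m<n+m; m<m+n)
  open import Data.Product using (Σ; _×_; _,_; proj₂)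
  open import Data.Rational as ℚ using (ℚ; 0ℚ; 1ℚ)
  open import Data.Rational.Properties using (+-identityˡ; +-identityʳ)
  open import Data.Sum using (inj₁; inj₂)
  open import Relation.Binary.PropositionalEquality
  open import Relation.Nullary using (Dec; yes; no)
  open import Data.Nat.Tactic.RingSolver using (solve-∀)

  open import Defs
  open Coefficient
  open QuasiShuffle
  open LexOrder
  open RationalArith

  α : List ℕ
  α = x ∷ a′

  α^ : ℕ → List ℕ
  α^ i = concatPow i α

  Suffix : List ℕ → Set
  Suffix S = Σ (List ℕ) (λ p → p ++ S ≡ α)

  Suffix-length : ∀ {S} → Suffix S → length S ≤ length α
  Suffix-length {S} (p , e) =
    subst (λ z → length S ≤ length z) e (≤-trans (m≤n+m (length S) (length p)) (≤-reflexive (sym (length-++ p))))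

  Suffix-∷ : ∀ {y S} → Suffix (y ∷ S) → Suffix S
  Suffix-∷ {y} {S} (p , e) = p ++ (y ∷ []) , trans (++-assoc p (y ∷ []) S) e

  α⊏properSuffix : ∀ {p S} → p ≢ [] → S ≢ [] → p ++ S ≡ α → α ⊏ S
  α⊏properSuffix {p} {S} p≢[] S≢[] e = <lex⇒⊏ (proj₂ lyndon p S p≢[] S≢[] e) (Suffix-length (p , e))

  α≼suffix : ∀ {S} → Suffix S → α ≼ S
  α≼suffix {S}     ([] , refl)    = ≼-refl α
  α≼suffix {[]}    (p ∷ ps , e) = ≼[]
  α≼suffix {y ∷ S} (p ∷ ps , e) = LexAt⇒≼ (proj₂ (α⊏properSuffix {p ∷ ps} {y ∷ S} (λ ()) (λ ()) e))

  Prefix-α-∷ : ∀ {y u} → Prefix (y ∷ u) α → y ≡ x × Prefix u a′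
  Prefix-α-∷ (z , e) = ∷-injectiveˡ e , z , ∷-injectiveʳ e

  -- n bounds the total length and is the induction measure.
  ShufflesBelowSuffixes : ℕ → Set
  ShufflesBelowSuffixes n = ∀ S u v w → Suffix S → Prefix u S → Prefix v α →
    length u + length v ≤ length S → length u + length v ≤ n → w ∈ qsh u v → FullLength u v w → w ≼ S

  shuffles-≼-α : ∀ n → ShufflesBelowSuffixes n → ∀ u v w → Prefix u α → Prefix v α →
    length u + length v ≤ length α → length u + length v ≤ suc n → w ∈ qsh u v → FullLength u v w → w ≼ α
  shuffles-≼-α n below [] v w pu pv ls ln m f rewrite ∈-qsh-[]ˡ m = Prefix⇒≼ pv
  shuffles-≼-α n below (y ∷ u) [] w pu pv ls ln m f rewrite ∈-qsh-[]ʳ m = Prefix⇒≼ pu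
  shuffles-≼-α n below (y ∷ u) (y′ ∷ v) w pu pv ls ln m f with qsh-view {y} {y′} {u} {v} m
  ... | takeˡ w′ refl m′ with Prefix-α-∷ pu
  ...   | refl , pu′ = ≼-later (below a′ u (y′ ∷ v) w′ (x ∷ [] , refl) pu′ pv (≤-pred ls) (≤-pred ln) m′
                                 (FullLength-∷ˡ {y} {u} {y′ ∷ v} {w′} f))
  shuffles-≼-α n below (y ∷ u) (y′ ∷ v) w pu pv ls ln m f | takeʳ w′ refl m′ with Prefix-α-∷ pv
  ...   | refl , pv′ = ≼-later (below a′ v (y ∷ u) w′ (x ∷ [] , refl) pv′ pu
            (≤-pred (subst (_≤ length α) swap ls)) (≤-pred (subst (_≤ suc n) swap ln))
            (∈-qsh-comm (y ∷ u) v m′) (FullLength-comm {y ∷ u} {v} {w′} (FullLength-∷ʳ {y ∷ u} {y′} {v} {w′} f)))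
    where swap = +-comm (length (y ∷ u)) (length (y′ ∷ v))
  shuffles-≼-α n below (y ∷ u) (y′ ∷ v) w pu pv ls ln m f | merge w′ refl m′ = ⊥-elim (merge-not-full y y′ u v w′ m′ f)

  -- If α first drops below S = y ∷ u ++ z at position d, then up to d the word w = y′ ∷ w′
  -- is a shuffle of prefixes of α (u agrees with α there), hence ≼ α.
  prefixes-≼-α : ∀ n → ShufflesBelowSuffixes n → ∀ {d y u z y′ v w′} →
    LexAt d α (y ∷ u ++ z) → Suffix (y ∷ u ++ z) → Prefix (y′ ∷ v) α →
    w′ ∈ qsh (y ∷ u) v → FullLength (y ∷ u) (y′ ∷ v) (y′ ∷ w′) → length (y ∷ u) + length (y′ ∷ v) ≤ suc n →
    ∀ k′ → k′ ≤ length w′ → k′ ≤ d → take (suc k′) (y′ ∷ w′) ≼ α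
  prefixes-≼-α n below {d} {y} {u} {z} {y′} {v} {w′} l suf pv m′ f ln k′ k′≤w′ k′≤d
    with qsh-prefix (y ∷ u) v w′ m′ (FullLength-∷ʳ {y ∷ u} {y′} {v} {w′} f) k′ k′≤w′
  ... | i , j , i≤ , j≤ , i+j≡k′ , m″ =
    shuffles-≼-α n below (take i α) (take (suc j) (y′ ∷ v)) (take (suc k′) (y′ ∷ w′))
      (Prefix-take i α) (Prefix-trans (Prefix-take (suc j) (y′ ∷ v)) pv) (subst (_≤ length α) (sym total) bound-α)
      (subst (_≤ suc n) (sym total) bound-n) mem full
    where
      w = y′ ∷ w′
      u≤α : length (y ∷ u ++ z) ≤ length α
      u≤α = Suffix-length suf
      i≤d : i ≤ d
      i≤d = ≤-trans (≤-reflexive (trans (sym (m+n∸n≡m i j)) (cong (ℕ._∸ j) i+j≡k′))) (≤-trans (m∸n≤m k′ j) k′≤d)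
      agree : take i (y ∷ u) ≡ take i α
      agree = trans (take-Prefix i (z , refl) i≤) (sym (LexAt-take i l i≤d))
      mem : take (suc k′) w ∈ qsh (take i α) (take (suc j) (y′ ∷ v))
      mem = subst (λ q → take (suc k′) w ∈ qsh q (take (suc j) (y′ ∷ v))) agree (∈-qsh-∷ʳ {y′} {take i (y ∷ u)} {take j v} m″)
      i≤α : i ≤ length α
      i≤α = ≤-trans i≤ (≤-trans (Prefix-length {y ∷ u} {y ∷ u ++ z} (z , refl)) u≤α)
      total : length (take i α) + length (take (suc j) (y′ ∷ v)) ≡ suc k′
      total = trans (cong₂ _+_ (length-take-≤ i α i≤α) (length-take-≤ (suc j) (y′ ∷ v) (s≤s j≤)))
                    (trans (+-suc i j) (cong suc i+j≡k′))
      bound-α : suc k′ ≤ length α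
      bound-α = ≤-trans (s≤s k′≤d) (≤-trans (LexAt-<-lengthʳ l) u≤α)
      bound-n : suc k′ ≤ suc n
      bound-n = ≤-trans (s≤s k′≤w′) (≤-trans (≤-reflexive f) ln)
      full : FullLength (take i α) (take (suc j) (y′ ∷ v)) (take (suc k′) w)
      full = trans (length-take-≤ (suc k′) w (s≤s k′≤w′)) (sym total)

  shuffles-≼-suffix : ∀ n → ShufflesBelowSuffixes n
  shuffles-≼-suffix zero S [] v w ([] , refl) pu pv ls ln m f rewrite ∈-qsh-[]ˡ m = Prefix⇒≼ pv
  shuffles-≼-suffix zero S (y ∷ u) v w ([] , refl) pu pv ls () m f
  shuffles-≼-suffix (suc n) S u v w ([] , refl) pu pv ls ln m f = shuffles-≼-α n (shuffles-≼-suffix n) u v w pu pv ls ln m f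
  shuffles-≼-suffix n S [] v w (p ∷ ps , e) pu pv ls ln m f rewrite ∈-qsh-[]ˡ m = ≼-Prefixˡ (α≼suffix (p ∷ ps , e)) pv
  shuffles-≼-suffix n S (y ∷ u) [] w (p ∷ ps , e) pu pv ls ln m f rewrite ∈-qsh-[]ʳ m = Prefix⇒≼ pu
  shuffles-≼-suffix zero S (y ∷ u) (y′ ∷ v) w (p ∷ ps , e) pu pv ls () m f
  shuffles-≼-suffix (suc n) S (y ∷ u) (y′ ∷ v) w (p ∷ ps , e) pu pv ls ln m f with qsh-view {y} {y′} {u} {v} m
  shuffles-≼-suffix (suc n) S (y ∷ u) (y′ ∷ v) w (p ∷ ps , e) (z , refl) pv ls ln m f | takeˡ w′ refl m′ =
    ≼-later (shuffles-≼-suffix n (u ++ z) u (y′ ∷ v) w′ (Suffix-∷ (p ∷ ps , e)) (z , refl) pv (≤-pred ls) (≤-pred ln) m′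
                               (FullLength-∷ˡ {y} {u} {y′ ∷ v} {w′} f))
  shuffles-≼-suffix (suc n) S (y ∷ u) (y′ ∷ v) w (p ∷ ps , e) pu pv ls ln m f | merge w′ refl m′ =
    ⊥-elim (merge-not-full y y′ u v w′ m′ f)
  shuffles-≼-suffix (suc n) S (y ∷ u) (y′ ∷ v) w (p ∷ ps , e) (z , refl) pv ls ln m f | takeʳ w′ refl m′
    with α⊏properSuffix {p ∷ ps} {y ∷ u ++ z} (λ ()) (λ ()) e
  ... | d , l = by-length (suc d ℕ.≤? length w)
    where
      ≼α : ∀ k′ → k′ ≤ length w′ → k′ ≤ d → take (suc k′) w ≼ α
      ≼α = prefixes-≼-α n (shuffles-≼-suffix n) l (p ∷ ps , e) pv m′ f ln
      by-length : Dec (suc d ≤ length w) → w ≼ (y ∷ u ++ z)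
      by-length (yes d<w) = LexAt⇒≼ (proj₂ (≼-LexAt⇒⊏ w l (≼α d (≤-pred d<w) ≤-refl) d<w))
      by-length (no d≮w)  = ≼-LexAt⇒≼ w l (subst (_≼ α) (take-all (suc (length w′)) w ≤-refl)
                              (≼α (length w′) ≤-refl (≤-trans (n≤1+n _) w≤d))) w≤d
        where w≤d = ≤-pred (≰⇒> d≮w)

  -- Up to the position where α drops below S, the word x ∷ w′ is a shuffle of prefixes of α.
  x∷shuffle⊏properSuffix : ∀ S X B w′ p → p ≢ [] → p ++ S ≡ α → S ≢ [] → Prefix S B →
    w′ ∈ qsh (a′ ++ X) B → FullLength (a′ ++ X) B w′ → ∀ Z → (x ∷ w′) ⊏ (S ++ Z)
  x∷shuffle⊏properSuffix S X B w′ p p≢[] e S≢[] S≤B m f Z with α⊏properSuffix p≢[] S≢[] e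
  ... | d , l with ≼-LexAt⇒⊏ (x ∷ w′) l prefix≼α (s≤s d≤w′)
    where
      S≤α : length S ≤ length α
      S≤α = Suffix-length (p , e)
      d≤w′ : d ≤ length w′
      d≤w′ = ≤-trans (<⇒≤ (LexAt-<-lengthʳ l))
               (≤-trans (Prefix-length S≤B) (≤-trans (m≤n+m (length B) (length (a′ ++ X))) (≤-reflexive (sym f))))
      prefix≼α : take (suc d) (x ∷ w′) ≼ α
      prefix≼α with qsh-prefix (a′ ++ X) B w′ m f d d≤w′
      ... | i , j , i≤ , j≤ , i+j≡d , m″ =
        shuffles-≼-suffix (suc d) α (take (suc i) α) (take j α) (take (suc d) (x ∷ w′)) ([] , refl)
          (Prefix-take (suc i) α) (Prefix-take j α) (subst (_≤ length α) (sym total) d<α) (≤-reflexive total) mem full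
        where
          d<α : suc d ≤ length α
          d<α = ≤-trans (LexAt-<-lengthʳ l) S≤α
          j≤d : j ≤ d
          j≤d = ≤-trans (m≤n+m j i) (≤-reflexive i+j≡d)
          i<α : suc i ≤ length α
          i<α = ≤-trans (s≤s (≤-trans (m≤m+n i j) (≤-reflexive i+j≡d))) d<α
          j≤α : j ≤ length α
          j≤α = ≤-trans j≤d (≤-trans (n≤1+n d) d<α)
          B-agrees : take j B ≡ take j α
          B-agrees = trans (sym (take-Prefix j S≤B (≤-trans j≤d (<⇒≤ (LexAt-<-lengthʳ l))))) (sym (LexAt-take j l j≤d))
          mem : take (suc d) (x ∷ w′) ∈ qsh (take (suc i) α) (take j α)
          mem = subst₂ (λ q r → take (suc d) (x ∷ w′) ∈ qsh q r) (take-++-≤ (suc i) α X i<α) B-agrees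
                  (∈-qsh-∷ˡ {x} {take i (a′ ++ X)} {take j B} m″)
          total : length (take (suc i) α) + length (take j α) ≡ suc d
          total = trans (cong₂ _+_ (length-take-≤ (suc i) α i<α) (length-take-≤ j α j≤α)) (cong suc i+j≡d)
          full : FullLength (take (suc i) α) (take j α) (take (suc d) (x ∷ w′))
          full = trans (length-take-≤ (suc d) (x ∷ w′) (s≤s d≤w′)) (sym total)
  ...   | d′ , l′ = d′ , LexAt-++ʳ Z l′

  merged-head-≢ : ∀ {y z} → 0 < y → y + z ≢ z
  merged-head-≢ {y} {z} 0<y e = <-irrefl (sym e) (m<n+m z 0<y)

  suffix-top-shuffle : ∀ c p → p ≢ [] → p ++ c ≡ α → ∀ i → TopShuffle c (α^ i) (c ++ α^ i) 1ℚ
  suffix-top-shuffle [] p _ _ i = record { below = λ w m _ → inj₁ (∈-qsh-[]ˡ m) ; occurrences = count-[-] (α^ i) }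
  suffix-top-shuffle (y ∷ c) p _ _ zero = record
    { below       = λ w m _ → inj₁ (trans (∈-qsh-[]ʳ m) (sym (++-identityʳ (y ∷ c))))
    ; occurrences = subst (λ q → count q ((y ∷ c) ∷ []) ≡ 1ℚ) (sym (++-identityʳ (y ∷ c))) (count-[-] (y ∷ c))
    }
  suffix-top-shuffle (y ∷ c) p p≢[] e (suc i) = record { below = below ; occurrences = occurrences }
    where
      D = a′ ++ α^ i
      IH : TopShuffle c (α^ (suc i)) (c ++ α^ (suc i)) 1ℚ
      IH = suffix-top-shuffle c (p ++ y ∷ []) (λ q → p≢[] (++-conicalˡ p _ q)) (trans (++-assoc p (y ∷ []) c) e) (suc i)
      x-first⊏ : ∀ w′ → w′ ∈ qsh (y ∷ c) D → FullLength (y ∷ c) D w′ → (x ∷ w′) ⊏ ((y ∷ c) ++ α^ (suc i))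
      x-first⊏ w′ m′ f′ = x∷shuffle⊏properSuffix (y ∷ c) (α^ i) (y ∷ c) w′ p p≢[] e (λ ()) ([] , ++-identityʳ (y ∷ c))
                            (∈-qsh-comm (y ∷ c) D m′) (FullLength-comm {y ∷ c} {D} {w′} f′) (α^ (suc i))
      below : ∀ w → w ∈ qsh (y ∷ c) (α^ (suc i)) → FullLength (y ∷ c) (α^ (suc i)) w → w ⊑ ((y ∷ c) ++ α^ (suc i))
      below w m f with qsh-view {y} {x} {c} {D} m
      ... | takeˡ w′ refl m′ = ⊑-∷ (TopShuffle.below IH w′ m′ (FullLength-∷ˡ {y} {c} {α^ (suc i)} {w′} f))
      ... | takeʳ w′ refl m′ = inj₂ (x-first⊏ w′ m′ (FullLength-∷ʳ {y ∷ c} {x} {D} {w′} f))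
      ... | merge w′ refl m′ = ⊥-elim (merge-not-full y x c D w′ m′ f)
      occurrences : count ((y ∷ c) ++ α^ (suc i)) (qsh (y ∷ c) (α^ (suc i))) ≡ 1ℚ
      occurrences = begin
        count T (qsh (y ∷ c) (x ∷ D))
          ≡⟨ count-qsh-∷ T y x c D ⟩
        count T (map (y ∷_) (qsh c (x ∷ D))) ℚ.+ (count T (map (x ∷_) (qsh (y ∷ c) D)) ℚ.+ count T (map ((y + x) ∷_) (qsh c D)))
          ≡⟨ cong₂ ℚ._+_ (trans (count-map-∷ y (c ++ α^ (suc i)) (qsh c (x ∷ D))) (TopShuffle.occurrences IH))
                         (cong₂ ℚ._+_ (count-map-∷-⊏ x (y ∷ c) D T x-first⊏ (cong suc (trans (length-++ c) (+-suc (length c) (length D)))))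
                                      (count-map-∷-≢ (c ++ α^ (suc i)) (qsh c D) (λ e → merged-head-≢ 0<x (trans (+-comm x y) e)))) ⟩
        1ℚ ℚ.+ (0ℚ ℚ.+ 0ℚ)
          ≡⟨ refl ⟩
        1ℚ ∎
        where
          open ≡-Reasoning
          T = (y ∷ c) ++ α^ (suc i)

  private
    α-top-shuffle-α^ : ∀ i → TopShuffle a′ (α^ (suc i)) (a′ ++ α^ (suc i)) 1ℚ →
      TopShuffle α (a′ ++ α^ i) (a′ ++ α^ (suc i)) (fromℕ (suc i)) → TopShuffle α (α^ (suc i)) (α^ (suc (suc i))) (fromℕ (suc (suc i)))
    α-top-shuffle-α^ i IHc IHα = record { below = below ; occurrences = occurrences }
      where
        D = a′ ++ α^ i
        below : ∀ w → w ∈ qsh α (α^ (suc i)) → FullLength α (α^ (suc i)) w → w ⊑ α^ (suc (suc i))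
        below w m f with qsh-view {x} {x} {a′} {D} m
        ... | takeˡ w′ refl m′ = ⊑-∷ (TopShuffle.below IHc w′ m′ (FullLength-∷ˡ {x} {a′} {α^ (suc i)} {w′} f))
        ... | takeʳ w′ refl m′ = ⊑-∷ (TopShuffle.below IHα w′ m′ (FullLength-∷ʳ {α} {x} {D} {w′} f))
        ... | merge w′ refl m′ = ⊥-elim (merge-not-full x x a′ D w′ m′ f)
        occurrences : count (α^ (suc (suc i))) (qsh α (α^ (suc i))) ≡ fromℕ (suc (suc i))
        occurrences = begin
          count T (qsh α (x ∷ D))
            ≡⟨ count-qsh-∷ T x x a′ D ⟩
          count T (map (x ∷_) (qsh a′ (x ∷ D))) ℚ.+ (count T (map (x ∷_) (qsh α D)) ℚ.+ count T (map ((x + x) ∷_) (qsh a′ D)))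
            ≡⟨ cong₂ ℚ._+_ (trans (count-map-∷ x (a′ ++ α^ (suc i)) (qsh a′ (x ∷ D))) (TopShuffle.occurrences IHc))
                           (cong₂ ℚ._+_ (trans (count-map-∷ x (a′ ++ α^ (suc i)) (qsh α D)) (TopShuffle.occurrences IHα))
                                        (count-map-∷-≢ (a′ ++ α^ (suc i)) (qsh a′ D) (merged-head-≢ 0<x))) ⟩
          1ℚ ℚ.+ (fromℕ (suc i) ℚ.+ 0ℚ)
            ≡⟨ cong (1ℚ ℚ.+_) (+-identityʳ (fromℕ (suc i))) ⟩
          1ℚ ℚ.+ fromℕ (suc i)
            ≡⟨ sym (fromℕ-suc (suc i)) ⟩
          fromℕ (suc (suc i)) ∎
          where
            open ≡-Reasoning
            T = α^ (suc (suc i))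

    α-top-shuffle-∷ : ∀ i y s p → p ≢ [] → p ++ y ∷ s ≡ α → TopShuffle α (s ++ α^ i) (s ++ α^ (suc i)) (fromℕ (suc i)) →
      TopShuffle α ((y ∷ s) ++ α^ i) ((y ∷ s) ++ α^ (suc i)) (fromℕ (suc i))
    α-top-shuffle-∷ i y s p p≢[] e IH = record { below = below ; occurrences = occurrences }
      where
        D = s ++ α^ i
        T = (y ∷ s) ++ α^ (suc i)
        x-first⊏ : ∀ w′ → w′ ∈ qsh a′ (y ∷ D) → FullLength a′ (y ∷ D) w′ → (x ∷ w′) ⊏ T
        x-first⊏ w′ m′ f′ = x∷shuffle⊏properSuffix (y ∷ s) [] (y ∷ D) w′ p p≢[] e (λ ()) (α^ i , refl)
            (subst (λ q → w′ ∈ qsh q (y ∷ D)) (sym (++-identityʳ a′)) m′)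
            (subst (λ q → FullLength q (y ∷ D) w′) (sym (++-identityʳ a′)) f′) (α^ (suc i))
        below : ∀ w → w ∈ qsh α ((y ∷ s) ++ α^ i) → FullLength α ((y ∷ s) ++ α^ i) w → w ⊑ T
        below w m f with qsh-view {x} {y} {a′} {D} m
        ... | takeˡ w′ refl m′ = inj₂ (x-first⊏ w′ m′ (FullLength-∷ˡ {x} {a′} {y ∷ D} {w′} f))
        ... | takeʳ w′ refl m′ = ⊑-∷ (TopShuffle.below IH w′ m′ (FullLength-∷ʳ {α} {y} {D} {w′} f))
        ... | merge w′ refl m′ = ⊥-elim (merge-not-full x y a′ D w′ m′ f)
        length-T : length T ≡ suc (length a′ + length (y ∷ D))
        length-T = cong suc (begin
          length (s ++ α^ (suc i))                   ≡⟨ length-++ s ⟩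
          length s + suc (length (a′ ++ α^ i))       ≡⟨ cong (λ q → length s + suc q) (length-++ a′) ⟩
          length s + suc (length a′ + length (α^ i)) ≡⟨ swap (length s) (length a′) (length (α^ i)) ⟩
          length a′ + suc (length s + length (α^ i)) ≡⟨ cong (λ q → length a′ + suc q) (sym (length-++ s)) ⟩
          length a′ + suc (length D)                 ∎)
          where
            open ≡-Reasoning
            swap : ∀ S A P → S + suc (A + P) ≡ A + suc (S + P)
            swap = solve-∀
        occurrences : count T (qsh α ((y ∷ s) ++ α^ i)) ≡ fromℕ (suc i)
        occurrences = begin
          count T (qsh α (y ∷ D))
            ≡⟨ count-qsh-∷ T x y a′ D ⟩
          count T (map (x ∷_) (qsh a′ (y ∷ D))) ℚ.+ (count T (map (y ∷_) (qsh α D)) ℚ.+ count T (map ((x + y) ∷_) (qsh a′ D)))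
            ≡⟨ cong₂ ℚ._+_ (count-map-∷-⊏ x a′ (y ∷ D) T x-first⊏ length-T)
                           (cong₂ ℚ._+_ (trans (count-map-∷ y (s ++ α^ (suc i)) (qsh α D)) (TopShuffle.occurrences IH))
                                        (count-map-∷-≢ (s ++ α^ (suc i)) (qsh a′ D) (merged-head-≢ 0<x))) ⟩
          0ℚ ℚ.+ (fromℕ (suc i) ℚ.+ 0ℚ)
            ≡⟨ trans (+-identityˡ _) (+-identityʳ _) ⟩
          fromℕ (suc i) ∎
          where open ≡-Reasoning

  α-top-shuffle : ∀ i s p → p ≢ [] → p ++ s ≡ α → TopShuffle α (s ++ α^ i) (s ++ α^ (suc i)) (fromℕ (suc i))
  α-top-shuffle zero [] p _ _ = record
    { below       = λ w m _ → inj₁ (trans (∈-qsh-[]ʳ m) (sym (++-identityʳ α)))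
    ; occurrences = subst (λ q → count q (α ∷ []) ≡ 1ℚ) (sym (++-identityʳ α)) (count-[-] α)
    }
  α-top-shuffle (suc i) [] p _ _ =
    α-top-shuffle-α^ i (suffix-top-shuffle a′ (x ∷ []) (λ ()) refl (suc i)) (α-top-shuffle i a′ (x ∷ []) (λ ()) refl)
  α-top-shuffle i (y ∷ s) p p≢[] e = α-top-shuffle-∷ i y s p p≢[] e
    (α-top-shuffle i s (p ++ y ∷ []) (λ q → p≢[] (++-conicalˡ p _ q)) (trans (++-assoc p (y ∷ []) s) e))


module Exponents where

  open import Data.List using (List; []; _∷_; _++_; map; length)
  open import Data.List.Properties using (∷-injectiveˡ)
  open import Data.List.Relation.Unary.All using (_∷_)
  open import Data.Nat as ℕ using (ℕ; zero; suc; _+_; _*_)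
  open import Data.Nat.Properties using (+-comm; +-assoc; *-zeroʳ; <-irrefl)
  import Data.Nat.Properties as ℕ
  open import Data.Product using (_,_; proj₁; proj₂)
  open import Data.Rational as ℚ using (ℚ; 0ℚ)
  open import Data.Rational.Properties using (+-identityʳ)
  open import Data.Rational.Solver using (module +-*-Solver)
  open import Data.Vec as V using (Vec; zipWith; replicate; fromList)
  open import Data.Vec.Properties using (∷-injective)
  import Data.Vec.Properties as Vec
  open import Relation.Binary.PropositionalEquality
  open import Relation.Nullary using (Dec; yes; no)
  open +-*-Solver

  open import Defs
  open Sum
  open Coefficient

  infixl 6 _+ᵛ_
  infixr 7 _·ᵛ_

  _+ᵛ_ : ∀ {L} → Vec ℕ L → Vec ℕ L → Vec ℕ L
  _+ᵛ_ = zipWith _+_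

  0ᵛ : ∀ {L} → Vec ℕ L
  0ᵛ = replicate _ 0

  _·ᵛ_ : ∀ {L} → ℕ → Vec ℕ L → Vec ℕ L
  k ·ᵛ u = V.map (k *_) u

  +ᵛ-comm : ∀ {L} (a b : Vec ℕ L) → a +ᵛ b ≡ b +ᵛ a
  +ᵛ-comm V.[]       V.[]       = refl
  +ᵛ-comm (x V.∷ a) (y V.∷ b) = cong₂ V._∷_ (+-comm x y) (+ᵛ-comm a b)

  +ᵛ-assoc : ∀ {L} (a b c : Vec ℕ L) → (a +ᵛ b) +ᵛ c ≡ a +ᵛ (b +ᵛ c)
  +ᵛ-assoc V.[]       V.[]       V.[]       = refl
  +ᵛ-assoc (x V.∷ a) (y V.∷ b) (z V.∷ c) = cong₂ V._∷_ (+-assoc x y z) (+ᵛ-assoc a b c)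

  +ᵛ-identityˡ : ∀ {L} (a : Vec ℕ L) → 0ᵛ +ᵛ a ≡ a
  +ᵛ-identityˡ V.[]       = refl
  +ᵛ-identityˡ (x V.∷ a) = cong (x V.∷_) (+ᵛ-identityˡ a)

  +ᵛ-identityʳ : ∀ {L} (a : Vec ℕ L) → a +ᵛ 0ᵛ ≡ a
  +ᵛ-identityʳ a = trans (+ᵛ-comm a 0ᵛ) (+ᵛ-identityˡ a)

  ·ᵛ-0ᵛ : ∀ {L} k → k ·ᵛ 0ᵛ {L} ≡ 0ᵛ
  ·ᵛ-0ᵛ {zero}  k = refl
  ·ᵛ-0ᵛ {suc L} k = cong₂ V._∷_ (*-zeroʳ k) (·ᵛ-0ᵛ {L} k)

  ·ᵛ-1 : ∀ {L} (u : Vec ℕ L) → 1 ·ᵛ u ≡ u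
  ·ᵛ-1 V.[]       = refl
  ·ᵛ-1 (x V.∷ u) = cong₂ V._∷_ (ℕ.+-identityʳ x) (·ᵛ-1 u)

  ·ᵛ-suc : ∀ {L} k (u : Vec ℕ L) → k ·ᵛ u +ᵛ u ≡ suc k ·ᵛ u
  ·ᵛ-suc k V.[]       = refl
  ·ᵛ-suc k (x V.∷ u) = cong₂ V._∷_ (+-comm (k * x) x) (·ᵛ-suc k u)

  -- The exponent vectors of the monomials of M_γ in the variables x₁, …, x_L.
  exponents : Composition → (L : ℕ) → List (Vec ℕ L)
  exponents []      L       = 0ᵛ ∷ []
  exponents (g ∷ γ) zero    = []
  exponents (g ∷ γ) (suc L) = map (g V.∷_) (exponents γ L) ++ map (0 V.∷_) (exponents (g ∷ γ) L)

  ∑-exponents-∷ : ∀ h γ L (H : Vec ℕ (suc L) → ℚ) →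
    ∑ (exponents (h ∷ γ) (suc L)) H ≡ (∑[ e ∈ exponents γ L ] H (h V.∷ e)) ℚ.+ (∑[ e ∈ exponents (h ∷ γ) L ] H (0 V.∷ e))
  ∑-exponents-∷ h γ L H =
    trans (∑-++ (map (h V.∷_) (exponents γ L)) _ H) (cong₂ ℚ._+_ (∑-map _ (exponents γ L) H) (∑-map _ (exponents (h ∷ γ) L) H))

  ∑-exponents-map-* : ∀ k γ L (H : Vec ℕ L → ℚ) → ∑ (exponents (map (k *_) γ) L) H ≡ ∑[ e ∈ exponents γ L ] H (k ·ᵛ e)
  ∑-exponents-map-* k []      L       H = cong (λ q → H q ℚ.+ 0ℚ) (sym (·ᵛ-0ᵛ k))
  ∑-exponents-map-* k (g ∷ γ) zero    H = refl
  ∑-exponents-map-* k (g ∷ γ) (suc L) H = begin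
    ∑ (exponents (map (k *_) (g ∷ γ)) (suc L)) H
      ≡⟨ ∑-exponents-∷ (k * g) (map (k *_) γ) L H ⟩
    (∑[ e ∈ exponents (map (k *_) γ) L ] H ((k * g) V.∷ e)) ℚ.+ (∑[ e ∈ exponents (map (k *_) (g ∷ γ)) L ] H (0 V.∷ e))
      ≡⟨ cong₂ ℚ._+_ (∑-exponents-map-* k γ L _)
                     (trans (∑-exponents-map-* k (g ∷ γ) L _)
                            (∑-cong (exponents (g ∷ γ) L) (λ e → cong (λ q → H (q V.∷ k ·ᵛ e)) (sym (*-zeroʳ k))))) ⟩
    (∑[ e ∈ exponents γ L ] H (k ·ᵛ (g V.∷ e))) ℚ.+ (∑[ e ∈ exponents (g ∷ γ) L ] H (k ·ᵛ (0 V.∷ e)))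
      ≡⟨ sym (∑-exponents-∷ g γ L (λ e → H (k ·ᵛ e))) ⟩
    ∑[ e ∈ exponents (g ∷ γ) (suc L) ] H (k ·ᵛ e) ∎
    where open ≡-Reasoning

  private
    ∑-map-∷-exponents : ∀ h (ws : List Composition) L (H : Vec ℕ (suc L) → ℚ) →
      ∑[ w ∈ map (h ∷_) ws ] ∑ (exponents w (suc L)) H
        ≡ (∑[ w ∈ ws ] ∑[ e ∈ exponents w L ] H (h V.∷ e)) ℚ.+ (∑[ w ∈ ws ] ∑[ e ∈ exponents (h ∷ w) L ] H (0 V.∷ e))
    ∑-map-∷-exponents h ws L H = trans (∑-map _ ws _) (trans (∑-cong ws (λ w → ∑-exponents-∷ h w L H)) (∑-+ ws _ _))

    ∑-qsh-∷ : ∀ x y a b (F : Composition → ℚ) → ∑ (qsh (x ∷ a) (y ∷ b)) F ≡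
      ∑ (map (x ∷_) (qsh a (y ∷ b))) F ℚ.+ (∑ (map (y ∷_) (qsh (x ∷ a) b)) F ℚ.+ ∑ (map ((x + y) ∷_) (qsh a b)) F)
    ∑-qsh-∷ x y a b F = trans (∑-++ (map (x ∷_) (qsh a (y ∷ b))) _ F)
      (cong (∑ (map (x ∷_) (qsh a (y ∷ b))) F ℚ.+_) (∑-++ (map (y ∷_) (qsh (x ∷ a) b)) (map ((x + y) ∷_) (qsh a b)) F))

    ∑-exponents²-∷ : ∀ x a y b L (H : Vec ℕ (suc L) → ℚ) →
      ∑[ e ∈ exponents (x ∷ a) (suc L) ] ∑[ e′ ∈ exponents (y ∷ b) (suc L) ] H (e +ᵛ e′)
        ≡ ((∑[ e ∈ exponents a L ] ∑[ e′ ∈ exponents b L ] H ((x + y) V.∷ (e +ᵛ e′)))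
           ℚ.+ (∑[ e ∈ exponents a L ] ∑[ e′ ∈ exponents (y ∷ b) L ] H (x V.∷ (e +ᵛ e′))))
          ℚ.+ ((∑[ e ∈ exponents (x ∷ a) L ] ∑[ e′ ∈ exponents b L ] H (y V.∷ (e +ᵛ e′)))
           ℚ.+ (∑[ e ∈ exponents (x ∷ a) L ] ∑[ e′ ∈ exponents (y ∷ b) L ] H (0 V.∷ (e +ᵛ e′))))
    ∑-exponents²-∷ x a y b L H = trans (∑-exponents-∷ x a L _) (cong₂ ℚ._+_
      (trans (∑-cong (exponents a L) (split-B x))
        (trans (∑-+ (exponents a L) (λ e → ∑[ e′ ∈ exponents b L ] H ((x + y) V.∷ (e +ᵛ e′)))
                                    (λ e → ∑[ e′ ∈ exponents (y ∷ b) L ] H ((x + 0) V.∷ (e +ᵛ e′))))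
        (cong ((∑[ e ∈ exponents a L ] ∑[ e′ ∈ exponents b L ] H ((x + y) V.∷ (e +ᵛ e′))) ℚ.+_)
              (∑-cong (exponents a L) (λ e → ∑-cong (exponents (y ∷ b) L) (λ e′ → cong (λ q → H (q V.∷ (e +ᵛ e′))) (ℕ.+-identityʳ x)))))))
      (trans (∑-cong (exponents (x ∷ a) L) (split-B 0))
        (∑-+ (exponents (x ∷ a) L) (λ e → ∑[ e′ ∈ exponents b L ] H (y V.∷ (e +ᵛ e′)))
                                   (λ e → ∑[ e′ ∈ exponents (y ∷ b) L ] H (0 V.∷ (e +ᵛ e′))))))
      where
        split-B : ∀ c e → ∑[ e′ ∈ exponents (y ∷ b) (suc L) ] H ((c V.∷ e) +ᵛ e′)
          ≡ (∑[ e′ ∈ exponents b L ] H ((c + y) V.∷ (e +ᵛ e′))) ℚ.+ (∑[ e′ ∈ exponents (y ∷ b) L ] H ((c + 0) V.∷ (e +ᵛ e′)))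
        split-B c e = ∑-exponents-∷ y b L (λ e′ → H ((c V.∷ e) +ᵛ e′))

  -- Evaluating M_a M_b = ∑_{w ∈ qsh a b} M_w in L variables: the first variable either carries the
  -- first part of a, of b, of both (merged), or of neither.
  ∑-qsh-exponents : ∀ L a b (H : Vec ℕ L → ℚ) →
    ∑[ w ∈ qsh a b ] ∑ (exponents w L) H ≡ ∑[ e ∈ exponents a L ] ∑[ e′ ∈ exponents b L ] H (e +ᵛ e′)
  ∑-qsh-exponents L [] b H =
    trans (+-identityʳ _) (sym (trans (+-identityʳ _) (∑-cong (exponents b L) (λ e′ → cong H (+ᵛ-identityˡ e′)))))
  ∑-qsh-exponents L (x ∷ a) [] H =
    trans (+-identityʳ _) (∑-cong (exponents (x ∷ a) L) (λ e → sym (trans (+-identityʳ _) (cong H (+ᵛ-identityʳ e)))))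
  ∑-qsh-exponents zero (x ∷ a) (y ∷ b) H = trans (∑-qsh-∷ x y a b _)
    (cong₂ ℚ._+_ (no-variables x (qsh a (y ∷ b))) (cong₂ ℚ._+_ (no-variables y (qsh (x ∷ a) b)) (no-variables (x + y) (qsh a b))))
    where
      no-variables : ∀ h ws → ∑[ w ∈ map (h ∷_) ws ] ∑ (exponents w zero) H ≡ 0ℚ
      no-variables h ws = trans (∑-map _ ws _) (∑-zero ws _ (λ _ → refl))
  ∑-qsh-exponents (suc L) (x ∷ a) (y ∷ b) H = begin
    ∑[ w ∈ qsh A B ] ∑ (exponents w (suc L)) H
      ≡⟨ trans (∑-qsh-∷ x y a b _)
               (cong₂ ℚ._+_ (∑-map-∷-exponents x (qsh a B) L H)
                            (cong₂ ℚ._+_ (∑-map-∷-exponents y (qsh A b) L H) (∑-map-∷-exponents (x + y) (qsh a b) L H))) ⟩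
    (X′ ℚ.+ Z₁) ℚ.+ ((Y′ ℚ.+ Z₂) ℚ.+ (W′ ℚ.+ Z₃))
      ≡⟨ cong₂ ℚ._+_ (cong (ℚ._+ Z₁) (∑-qsh-exponents L a B (λ e → H (x V.∷ e))))
                     (cong₂ ℚ._+_ (cong (ℚ._+ Z₂) (∑-qsh-exponents L A b (λ e → H (y V.∷ e))))
                                  (cong (ℚ._+ Z₃) (∑-qsh-exponents L a b (λ e → H ((x + y) V.∷ e))))) ⟩
    (X ℚ.+ Z₁) ℚ.+ ((Y ℚ.+ Z₂) ℚ.+ (W ℚ.+ Z₃))
      ≡⟨ solve 7 (λ X Y W Z₁ Z₂ Z₃ Z → (X :+ Z₁) :+ ((Y :+ Z₂) :+ (W :+ Z₃)) := (W :+ X) :+ (Y :+ (Z₁ :+ (Z₂ :+ Z₃))))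
                 refl X Y W Z₁ Z₂ Z₃ Z ⟩
    (W ℚ.+ X) ℚ.+ (Y ℚ.+ (Z₁ ℚ.+ (Z₂ ℚ.+ Z₃)))
      ≡⟨ cong (λ q → (W ℚ.+ X) ℚ.+ (Y ℚ.+ q)) neither ⟩
    (W ℚ.+ X) ℚ.+ (Y ℚ.+ Z)
      ≡⟨ sym (∑-exponents²-∷ x a y b L H) ⟩
    ∑[ e ∈ exponents A (suc L) ] ∑[ e′ ∈ exponents B (suc L) ] H (e +ᵛ e′) ∎
    where
      open ≡-Reasoning
      A = x ∷ a
      B = y ∷ b
      zero-first : Composition → ℚ
      zero-first w = ∑[ e ∈ exponents w L ] H (0 V.∷ e)
      X′ = ∑[ w ∈ qsh a B ] ∑[ e ∈ exponents w L ] H (x V.∷ e)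
      Y′ = ∑[ w ∈ qsh A b ] ∑[ e ∈ exponents w L ] H (y V.∷ e)
      W′ = ∑[ w ∈ qsh a b ] ∑[ e ∈ exponents w L ] H ((x + y) V.∷ e)
      X = ∑[ e ∈ exponents a L ] ∑[ e′ ∈ exponents B L ] H (x V.∷ (e +ᵛ e′))
      Y = ∑[ e ∈ exponents A L ] ∑[ e′ ∈ exponents b L ] H (y V.∷ (e +ᵛ e′))
      W = ∑[ e ∈ exponents a L ] ∑[ e′ ∈ exponents b L ] H ((x + y) V.∷ (e +ᵛ e′))
      Z = ∑[ e ∈ exponents A L ] ∑[ e′ ∈ exponents B L ] H (0 V.∷ (e +ᵛ e′))
      Z₁ = ∑[ w ∈ qsh a B ] zero-first (x ∷ w)
      Z₂ = ∑[ w ∈ qsh A b ] zero-first (y ∷ w)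
      Z₃ = ∑[ w ∈ qsh a b ] zero-first ((x + y) ∷ w)
      neither : Z₁ ℚ.+ (Z₂ ℚ.+ Z₃) ≡ Z
      neither = trans (sym (trans (∑-qsh-∷ x y a b zero-first)
                         (cong₂ ℚ._+_ (∑-map _ (qsh a B) _) (cong₂ ℚ._+_ (∑-map _ (qsh A b) _) (∑-map _ (qsh a b) _)))))
                      (∑-qsh-exponents L A B (λ e → H (0 V.∷ e)))

  δᵛ : ∀ {L} → Vec ℕ L → Vec ℕ L → ℚ
  δᵛ v e = 𝟙 (Vec.≡-dec ℕ._≟_ e v)

  δᵛ-∷ : ∀ {L} b (v e : Vec ℕ L) → δᵛ (b V.∷ v) (b V.∷ e) ≡ δᵛ v e
  δᵛ-∷ b v e = 𝟙-⇔ (Vec.≡-dec ℕ._≟_ (b V.∷ e) (b V.∷ v)) (Vec.≡-dec ℕ._≟_ e v) (λ q → proj₂ (∷-injective q)) (cong (b V.∷_))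

  δᵛ-≢ : ∀ {L} b g (v e : Vec ℕ L) → g ≢ b → δᵛ (b V.∷ v) (g V.∷ e) ≡ 0ℚ
  δᵛ-≢ b g v e g≢b = 𝟙-no (Vec.≡-dec ℕ._≟_ (g V.∷ e) (b V.∷ v)) (λ q → g≢b (proj₁ (∷-injective q)))

  ∑-exponents-δᵛ : ∀ β γ → IsComposition β → IsComposition γ → ∑ (exponents γ (length β)) (δᵛ (fromList β)) ≡ δ β γ
  ∑-exponents-δᵛ [] [] _ _ = trans (+-identityʳ _) (trans (𝟙-yes (Vec.≡-dec ℕ._≟_ V.[] V.[]) refl) (sym (δ-refl [])))
  ∑-exponents-δᵛ [] (g ∷ γ) _ _ = sym (δ-≢ [] (g ∷ γ) (λ ()))
  ∑-exponents-δᵛ (b ∷ β) [] (0<b ∷ _) _ =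
    trans (+-identityʳ _) (trans (δᵛ-≢ b 0 (fromList β) 0ᵛ (λ q → <-irrefl q 0<b)) (sym (δ-≢ (b ∷ β) [] (λ ()))))
  ∑-exponents-δᵛ (b ∷ β) (g ∷ γ) (0<b ∷ pβ) (_ ∷ pγ) = begin
    ∑ (exponents (g ∷ γ) (suc (length β))) (δᵛ (fromList (b ∷ β)))
      ≡⟨ ∑-exponents-∷ g γ (length β) _ ⟩
    (∑[ e ∈ exponents γ (length β) ] δᵛ (fromList (b ∷ β)) (g V.∷ e)) ℚ.+ (∑[ e ∈ exponents (g ∷ γ) (length β) ] δᵛ (fromList (b ∷ β)) (0 V.∷ e))
      ≡⟨ cong (λ q → (∑[ e ∈ exponents γ (length β) ] δᵛ (fromList (b ∷ β)) (g V.∷ e)) ℚ.+ q)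
              (∑-zero (exponents (g ∷ γ) (length β)) _ (λ e → δᵛ-≢ b 0 (fromList β) e (λ q → <-irrefl q 0<b))) ⟩
    (∑[ e ∈ exponents γ (length β) ] δᵛ (fromList (b ∷ β)) (g V.∷ e)) ℚ.+ 0ℚ
      ≡⟨ trans (+-identityʳ _) (first-part (g ℕ.≟ b)) ⟩
    δ (b ∷ β) (g ∷ γ) ∎
    where
      open ≡-Reasoning
      first-part : Dec (g ≡ b) → ∑[ e ∈ exponents γ (length β) ] δᵛ (fromList (b ∷ β)) (g V.∷ e) ≡ δ (b ∷ β) (g ∷ γ)
      first-part (yes refl) = trans (∑-cong (exponents γ (length β)) (δᵛ-∷ g (fromList β)))
                                    (trans (∑-exponents-δᵛ β γ pβ pγ) (sym (δ-∷ g β γ)))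
      first-part (no g≢b)   = trans (∑-zero (exponents γ (length β)) _ (λ e → δᵛ-≢ b g (fromList β) e g≢b))
                                    (sym (δ-≢ (b ∷ β) (g ∷ γ) (λ q → g≢b (∷-injectiveˡ q))))


-- ℚ[t, x₁, …, x_L] as formal combinations of monomials t^d x^e, keyed by (d , e).
module Polynomials (L : ℕ) where

  open import Data.List using ([]; _∷_; map; concatMap)
  open import Data.Nat as ℕ using (ℕ; zero; suc; _+_)
  import Data.Nat.Properties as ℕ
  open import Data.Product using (_×_; _,_; proj₁; proj₂)
  open import Data.Rational as ℚ using (ℚ; 0ℚ; 1ℚ; _*_)
  open import Data.Rational.Properties using (+-identityʳ; *-identityˡ; *-zeroˡ; *-assoc; *-distribʳ-+)
  open import Data.Rational.Solver using (module +-*-Solver)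
  open import Data.Vec using (Vec)
  open import Relation.Binary.PropositionalEquality
  open +-*-Solver

  open import Defs
  open Sum
  open Combination
  open Coefficient
  open Exponents
  open RationalArith

  Key : Set
  Key = ℕ × Vec ℕ L

  deg : Key → ℕ
  deg = proj₁

  infixl 6 _⊞_
  infixl 7 _*ᴾ_

  _⊞_ : Key → Key → Key
  (d , e) ⊞ (d′ , e′) = d + d′ , e +ᵛ e′

  0ᴷ : Key
  0ᴷ = 0 , 0ᵛ

  ⊞-comm : ∀ κ κ′ → κ ⊞ κ′ ≡ κ′ ⊞ κ
  ⊞-comm (d , e) (d′ , e′) = cong₂ _,_ (ℕ.+-comm d d′) (+ᵛ-comm e e′)

  ⊞-assoc : ∀ κ κ′ κ″ → (κ ⊞ κ′) ⊞ κ″ ≡ κ ⊞ (κ′ ⊞ κ″)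
  ⊞-assoc (d , e) (d′ , e′) (d″ , e″) = cong₂ _,_ (ℕ.+-assoc d d′ d″) (+ᵛ-assoc e e′ e″)

  ⊞-identityˡ : ∀ κ → 0ᴷ ⊞ κ ≡ κ
  ⊞-identityˡ (d , e) = cong (d ,_) (+ᵛ-identityˡ e)

  ⊞-swap : ∀ κ κ′ κ″ → κ ⊞ (κ′ ⊞ κ″) ≡ κ′ ⊞ (κ ⊞ κ″)
  ⊞-swap κ κ′ κ″ = trans (sym (⊞-assoc κ κ′ κ″)) (trans (cong (_⊞ κ″) (⊞-comm κ κ′)) (⊞-assoc κ′ κ κ″))

  Poly : Set
  Poly = Combination Key

  _*ᴾ_ : Poly → Poly → Poly
  f *ᴾ g = concatMap (λ p → map (λ q → proj₁ p ⊞ proj₁ q , proj₂ p * proj₂ q) g) f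

  1ᴾ : Poly
  1ᴾ = (0ᴷ , 1ℚ) ∷ []

  powᴾ : ℕ → Poly → Poly
  powᴾ zero    X = 1ᴾ
  powᴾ (suc m) X = X *ᴾ powᴾ m X

  θ : Poly → Poly
  θ = map (λ p → proj₁ p , fromℕ (deg (proj₁ p)) * proj₂ p)

  shiftKey : ℕ → Key → Key
  shiftKey i (d , e) = d + i , e

  shift : ℕ → Poly → Poly
  shift i = mapKeys (shiftKey i)

  evaluate : QS → Poly
  evaluate f = concatMap (λ p → map (λ e → (0 , e) , proj₂ p) (exponents (proj₁ p) L)) f

  ⟪⟫-*ᴾ : ∀ f g h → ⟪ f *ᴾ g , h ⟫ ≡ ⟪ f , (λ κ → ⟪ g , (λ κ′ → h (κ ⊞ κ′)) ⟫) ⟫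
  ⟪⟫-*ᴾ f g h = trans (∑-concatMap _ f _) (∑-cong f (λ p →
    trans (∑-map _ g _) (trans (∑-cong g (λ q → *-assoc (proj₂ p) (proj₂ q) _)) (∑-*ˡ g (proj₂ p) _))))

  ⟪⟫-1ᴾ : ∀ h → ⟪ 1ᴾ , h ⟫ ≡ h 0ᴷ
  ⟪⟫-1ᴾ h = trans (+-identityʳ _) (*-identityˡ _)

  ⟪⟫-θ : ∀ f h → ⟪ θ f , h ⟫ ≡ ⟪ f , (λ κ → fromℕ (deg κ) * h κ) ⟫
  ⟪⟫-θ f h = trans (∑-map _ f _) (∑-cong f (λ p →
    solve 3 (λ a b c → (a :* b) :* c := b :* (a :* c)) refl (fromℕ (deg (proj₁ p))) (proj₂ p) (h (proj₁ p))))

  ⟪⟫-θ-1ᴾ : ∀ h → ⟪ θ 1ᴾ , h ⟫ ≡ 0ℚ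
  ⟪⟫-θ-1ᴾ h = trans (⟪⟫-θ 1ᴾ h) (trans (⟪⟫-1ᴾ (λ κ → fromℕ (deg κ) * h κ)) (*-zeroˡ (h 0ᴷ)))

  ⟪⟫-shift : ∀ i f h → ⟪ shift i f , h ⟫ ≡ ⟪ f , (λ κ → h (shiftKey i κ)) ⟫
  ⟪⟫-shift i f h = ⟪⟫-mapKeys (shiftKey i) f h

  θ-*ᴾ : ∀ f g h → ⟪ θ (f *ᴾ g) , h ⟫ ≡ ⟪ θ f *ᴾ g , h ⟫ ℚ.+ ⟪ f *ᴾ θ g , h ⟫
  θ-*ᴾ f g h = begin
    ⟪ θ (f *ᴾ g) , h ⟫
      ≡⟨ trans (⟪⟫-θ (f *ᴾ g) h) (⟪⟫-*ᴾ f g _) ⟩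
    ⟪ f , (λ κ → ⟪ g , (λ κ′ → fromℕ (deg κ + deg κ′) * h (κ ⊞ κ′)) ⟫) ⟫
      ≡⟨ ⟪⟫-cong f (λ κ → trans (⟪⟫-cong g (λ κ′ → Leibniz κ κ′)) (⟪⟫-+ g _ _)) ⟩
    ⟪ f , (λ κ → ⟪ g , (λ κ′ → fromℕ (deg κ) * h (κ ⊞ κ′)) ⟫ ℚ.+ ⟪ g , (λ κ′ → fromℕ (deg κ′) * h (κ ⊞ κ′)) ⟫) ⟫
      ≡⟨ ⟪⟫-+ f _ _ ⟩
    ⟪ f , (λ κ → ⟪ g , (λ κ′ → fromℕ (deg κ) * h (κ ⊞ κ′)) ⟫) ⟫ ℚ.+ ⟪ f , (λ κ → ⟪ g , (λ κ′ → fromℕ (deg κ′) * h (κ ⊞ κ′)) ⟫) ⟫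
      ≡⟨ sym (cong₂ ℚ._+_ (trans (⟪⟫-*ᴾ (θ f) g h) (trans (⟪⟫-θ f _) (⟪⟫-cong f (λ κ → sym (⟪⟫-*ˡ g (fromℕ (deg κ)) (λ κ′ → h (κ ⊞ κ′)))))))
                          (trans (⟪⟫-*ᴾ f (θ g) h) (⟪⟫-cong f (λ κ → ⟪⟫-θ g _)))) ⟩
    ⟪ θ f *ᴾ g , h ⟫ ℚ.+ ⟪ f *ᴾ θ g , h ⟫ ∎
    where
      open ≡-Reasoning
      Leibniz : ∀ κ κ′ → fromℕ (deg κ + deg κ′) * h (κ ⊞ κ′) ≡ fromℕ (deg κ) * h (κ ⊞ κ′) ℚ.+ fromℕ (deg κ′) * h (κ ⊞ κ′)
      Leibniz κ κ′ = trans (cong (_* h (κ ⊞ κ′)) (fromℕ-+ (deg κ) (deg κ′))) (*-distribʳ-+ (h (κ ⊞ κ′)) (fromℕ (deg κ)) (fromℕ (deg κ′)))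

  θ-powᴾ : ∀ m X h → ⟪ θ (powᴾ (suc m) X) , h ⟫ ≡ fromℕ (suc m) * ⟪ θ X *ᴾ powᴾ m X , h ⟫
  θ-powᴾ zero X h = begin
    ⟪ θ (X *ᴾ 1ᴾ) , h ⟫                           ≡⟨ θ-*ᴾ X 1ᴾ h ⟩
    ⟪ θ X *ᴾ 1ᴾ , h ⟫ ℚ.+ ⟪ X *ᴾ θ 1ᴾ , h ⟫       ≡⟨ cong (⟪ θ X *ᴾ 1ᴾ , h ⟫ ℚ.+_) θ1-term ⟩
    ⟪ θ X *ᴾ 1ᴾ , h ⟫ ℚ.+ 0ℚ                      ≡⟨ trans (+-identityʳ ⟪ θ X *ᴾ 1ᴾ , h ⟫) (sym (*-identityˡ ⟪ θ X *ᴾ 1ᴾ , h ⟫)) ⟩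
    1ℚ * ⟪ θ X *ᴾ 1ᴾ , h ⟫                        ∎
    where
      open ≡-Reasoning
      θ1-term : ⟪ X *ᴾ θ 1ᴾ , h ⟫ ≡ 0ℚ
      θ1-term = trans (⟪⟫-*ᴾ X (θ 1ᴾ) h) (⟪⟫-zero X _ (λ κ → ⟪⟫-θ-1ᴾ (λ κ′ → h (κ ⊞ κ′))))
  θ-powᴾ (suc m) X h = begin
    ⟪ θ (X *ᴾ powᴾ (suc m) X) , h ⟫                        ≡⟨ θ-*ᴾ X (powᴾ (suc m) X) h ⟩
    Y ℚ.+ ⟪ X *ᴾ θ (powᴾ (suc m) X) , h ⟫                  ≡⟨ cong (Y ℚ.+_) inner ⟩
    Y ℚ.+ fromℕ (suc m) * Y                                ≡⟨ solve 2 (λ y c → y :+ c :* y := (con 1ℚ :+ c) :* y) refl Y (fromℕ (suc m)) ⟩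
    (1ℚ ℚ.+ fromℕ (suc m)) * Y                             ≡⟨ cong (_* Y) (sym (fromℕ-suc (suc m))) ⟩
    fromℕ (suc (suc m)) * Y                                ∎
    where
      open ≡-Reasoning
      Y = ⟪ θ X *ᴾ powᴾ (suc m) X , h ⟫
      -- θ X commutes past the first factor X.
      inner : ⟪ X *ᴾ θ (powᴾ (suc m) X) , h ⟫ ≡ fromℕ (suc m) * Y
      inner = begin
        ⟪ X *ᴾ θ (powᴾ (suc m) X) , h ⟫
          ≡⟨ trans (⟪⟫-*ᴾ X _ h) (⟪⟫-cong X (λ κ → trans (θ-powᴾ m X (λ κ′ → h (κ ⊞ κ′)))
                                                   (cong (fromℕ (suc m) *_) (⟪⟫-*ᴾ (θ X) (powᴾ m X) _)))) ⟩
        ⟪ X , (λ κ → fromℕ (suc m) * ⟪ θ X , (λ κ′ → ⟪ powᴾ m X , (λ κ″ → h (κ ⊞ (κ′ ⊞ κ″))) ⟫) ⟫) ⟫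
          ≡⟨ ⟪⟫-*ˡ X (fromℕ (suc m)) _ ⟩
        fromℕ (suc m) * ⟪ X , (λ κ → ⟪ θ X , (λ κ′ → ⟪ powᴾ m X , (λ κ″ → h (κ ⊞ (κ′ ⊞ κ″))) ⟫) ⟫) ⟫
          ≡⟨ cong (fromℕ (suc m) *_) (trans (⟪⟫-swap X (θ X) _)
               (⟪⟫-cong (θ X) (λ κ′ → ⟪⟫-cong X (λ κ → ⟪⟫-cong (powᴾ m X) (λ κ″ → cong h (⊞-swap κ κ′ κ″)))))) ⟩
        fromℕ (suc m) * ⟪ θ X , (λ κ′ → ⟪ X , (λ κ → ⟪ powᴾ m X , (λ κ″ → h (κ′ ⊞ (κ ⊞ κ″))) ⟫) ⟫) ⟫
          ≡⟨ cong (fromℕ (suc m) *_) (sym (trans (⟪⟫-*ᴾ (θ X) _ h) (⟪⟫-cong (θ X) (λ κ′ → ⟪⟫-*ᴾ X (powᴾ m X) _)))) ⟩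
        fromℕ (suc m) * Y ∎

  ⟪⟫-evaluate : ∀ f h → ⟪ evaluate f , h ⟫ ≡ ⟪ f , (λ γ → ∑[ e ∈ exponents γ L ] h (0 , e)) ⟫
  ⟪⟫-evaluate f h = trans (∑-concatMap _ f _)
    (∑-cong f (λ p → trans (∑-map _ (exponents (proj₁ p) L) _) (∑-*ˡ (exponents (proj₁ p) L) (proj₂ p) _)))

  ⟪⟫-evaluate-⊛ : ∀ f g h → ⟪ evaluate (f ⊛ g) , h ⟫ ≡ ⟪ evaluate f *ᴾ evaluate g , h ⟫
  ⟪⟫-evaluate-⊛ f g h = begin
    ⟪ evaluate (f ⊛ g) , h ⟫
      ≡⟨ trans (⟪⟫-evaluate (f ⊛ g) h) (⟪⟫-⊛ f g _) ⟩
    ⟪ f , (λ γ → ⟪ g , (λ γ′ → ∑[ w ∈ qsh γ γ′ ] ∑[ e ∈ exponents w L ] h (0 , e)) ⟫) ⟫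
      ≡⟨ ⟪⟫-cong f (λ γ → ⟪⟫-cong g (λ γ′ → ∑-qsh-exponents L γ γ′ (λ e → h (0 , e)))) ⟩
    ⟪ f , (λ γ → ⟪ g , (λ γ′ → ∑[ e ∈ exponents γ L ] ∑[ e′ ∈ exponents γ′ L ] h (0 , e +ᵛ e′)) ⟫) ⟫
      ≡⟨ ⟪⟫-cong f (λ γ → trans (⟪⟫-∑ g (exponents γ L) (λ e γ′ → ∑[ e′ ∈ exponents γ′ L ] h (0 , e +ᵛ e′)))
                                (∑-cong (exponents γ L) (λ e → sym (⟪⟫-evaluate g _)))) ⟩
    ⟪ f , (λ γ → ∑[ e ∈ exponents γ L ] ⟪ evaluate g , (λ κ′ → h ((0 , e) ⊞ κ′)) ⟫) ⟫
      ≡⟨ sym (trans (⟪⟫-*ᴾ (evaluate f) (evaluate g) h) (⟪⟫-evaluate f _)) ⟩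
    ⟪ evaluate f *ᴾ evaluate g , h ⟫ ∎
    where open ≡-Reasoning

  ⟪⟫-evaluate-concatMap : ∀ {A : Set} (F : A → QS) xs h → ⟪ evaluate (concatMap F xs) , h ⟫ ≡ ∑[ x ∈ xs ] ⟪ evaluate (F x) , h ⟫
  ⟪⟫-evaluate-concatMap F xs h =
    trans (⟪⟫-evaluate (concatMap F xs) h) (trans (⟪⟫-concatMap F xs _) (∑-cong xs (λ x → sym (⟪⟫-evaluate (F x) h))))

  ⟪⟫-evaluate-scale : ∀ c f h → ⟪ evaluate (scale c f) , h ⟫ ≡ c * ⟪ evaluate f , h ⟫
  ⟪⟫-evaluate-scale c f h = trans (⟪⟫-evaluate (scale c f) h) (trans (⟪⟫-scale c f _) (cong (c *_) (sym (⟪⟫-evaluate f h))))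


module Exponential (L : ℕ) (G : ℕ → QS) (G₀≡[] : G 0 ≡ []) (n : ℕ) where

  open import Data.Integer using (+_)
  open import Data.List using (List; []; concatMap; upTo)
  open import Data.Nat as ℕ using (ℕ; zero; suc; _≤_; _<_; z≤n; s≤s; _+_; _∸_)
  import Data.Nat.Properties as ℕ
  open import Data.Product using (_,_; proj₂)
  open import Data.Rational as ℚ using (ℚ; 0ℚ; 1ℚ; _*_; _/_)
  open import Data.Rational.Properties using (+-identityˡ; +-identityʳ; *-identityˡ; *-zeroˡ; *-zeroʳ; *-assoc)
  open import Data.Vec using (Vec)
  open import Relation.Binary.PropositionalEquality
  open import Relation.Nullary using (Dec; yes; no)
  open import Relation.Binary.PropositionalEquality using (_≢_)

  open import Defs
  open Sum
  open Combination
  open Coefficient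
  open Exponents
  open RationalArith
  open Polynomials L

  logᴾ : Poly
  logᴾ = concatMap (λ k → shift k (evaluate (G k))) (upTo (suc n))

  θlogᴾ : Poly
  θlogᴾ = θ logᴾ

  expᴾ : Poly
  expᴾ = concatMap (λ m → scaleᶜ (invFactorial m) (powᴾ m logᴾ)) (upTo (suc n))

  VanishAbove : ℕ → (Key → ℚ) → Set
  VanishAbove j h = ∀ κ → j < deg κ → h κ ≡ 0ℚ

  onDegree : ℕ → (Key → ℚ) → Key → ℚ
  onDegree j h κ = δℕ j (deg κ) * h κ

  ⟪⟫-logᴾ : ∀ F → ⟪ logᴾ , F ⟫ ≡ ∑[ k < suc n ] ⟪ G k , (λ γ → ∑[ e ∈ exponents γ L ] F (k , e)) ⟫
  ⟪⟫-logᴾ F = trans (⟪⟫-concatMap (λ k → shift k (evaluate (G k))) (upTo (suc n)) F)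
    (∑-cong (upTo (suc n)) (λ k → trans (⟪⟫-shift k (evaluate (G k)) F) (⟪⟫-evaluate (G k) _)))

  -- Only positive t-degrees occur in logᴾ, since G 0 = [].
  ⟪⟫-logᴾ-cong : ∀ F F′ → (∀ κ → 1 ≤ deg κ → F κ ≡ F′ κ) → ⟪ logᴾ , F ⟫ ≡ ⟪ logᴾ , F′ ⟫
  ⟪⟫-logᴾ-cong F F′ e = trans (⟪⟫-logᴾ F) (trans (∑<-cong (suc n) termwise) (sym (⟪⟫-logᴾ F′)))
    where
      termwise : ∀ k → k < suc n →
        ⟪ G k , (λ γ → ∑[ e ∈ exponents γ L ] F (k , e)) ⟫ ≡ ⟪ G k , (λ γ → ∑[ e ∈ exponents γ L ] F′ (k , e)) ⟫
      termwise zero    _ rewrite G₀≡[] = refl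
      termwise (suc k) _ = ⟪⟫-cong (G (suc k)) (λ γ → ∑-cong (exponents γ L) (λ v → e (suc k , v) (s≤s z≤n)))

  ⟪⟫-logᴾ-vanish : ∀ F → (∀ κ → 1 ≤ deg κ → F κ ≡ 0ℚ) → ⟪ logᴾ , F ⟫ ≡ 0ℚ
  ⟪⟫-logᴾ-vanish F e = trans (⟪⟫-logᴾ-cong F (λ _ → 0ℚ) e) (⟪⟫-zero logᴾ _ (λ _ → refl))

  ⟪⟫-θlogᴾ-cong : ∀ F F′ → (∀ κ → 1 ≤ deg κ → F κ ≡ F′ κ) → ⟪ θlogᴾ , F ⟫ ≡ ⟪ θlogᴾ , F′ ⟫
  ⟪⟫-θlogᴾ-cong F F′ e =
    trans (⟪⟫-θ logᴾ F) (trans (⟪⟫-logᴾ-cong _ _ (λ κ 1≤ → cong (fromℕ (deg κ) *_) (e κ 1≤))) (sym (⟪⟫-θ logᴾ F′)))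

  ⟪⟫-θlogᴾ-vanish : ∀ F → (∀ κ → 1 ≤ deg κ → F κ ≡ 0ℚ) → ⟪ θlogᴾ , F ⟫ ≡ 0ℚ
  ⟪⟫-θlogᴾ-vanish F e = trans (⟪⟫-θlogᴾ-cong F (λ _ → 0ℚ) e) (⟪⟫-zero θlogᴾ _ (λ _ → refl))

  ⟪⟫-powᴾ-vanish : ∀ m F → (∀ κ → m ≤ deg κ → F κ ≡ 0ℚ) → ⟪ powᴾ m logᴾ , F ⟫ ≡ 0ℚ
  ⟪⟫-powᴾ-vanish zero    F e = ⟪⟫-zero 1ᴾ F (λ κ → e κ z≤n)
  ⟪⟫-powᴾ-vanish (suc m) F e = trans (⟪⟫-*ᴾ logᴾ (powᴾ m logᴾ) F)
    (⟪⟫-logᴾ-vanish _ (λ κ 1≤ → ⟪⟫-powᴾ-vanish m _ (λ κ′ m≤ → e (κ ⊞ κ′) (ℕ.+-mono-≤ 1≤ m≤))))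

  ⟪⟫-expᴾ : ∀ h → ⟪ expᴾ , h ⟫ ≡ ∑[ m < suc n ] (invFactorial m * ⟪ powᴾ m logᴾ , h ⟫)
  ⟪⟫-expᴾ h = trans (⟪⟫-concatMap (λ m → scaleᶜ (invFactorial m) (powᴾ m logᴾ)) (upTo (suc n)) h)
    (∑-cong (upTo (suc n)) (λ m → ⟪⟫-scale (invFactorial m) (powᴾ m logᴾ) h))

  ⟪⟫-expᴾ-degree0 : ∀ h → VanishAbove 0 h → ⟪ expᴾ , h ⟫ ≡ h 0ᴷ
  ⟪⟫-expᴾ-degree0 h van = begin
    ⟪ expᴾ , h ⟫                                                   ≡⟨ trans (⟪⟫-expᴾ h) (∑<-suc n (λ m → invFactorial m * ⟪ powᴾ m logᴾ , h ⟫)) ⟩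
    1ℚ * ⟪ 1ᴾ , h ⟫ ℚ.+ (∑[ m < n ] (invFactorial (suc m) * ⟪ powᴾ (suc m) logᴾ , h ⟫))
      ≡⟨ cong₂ ℚ._+_ (trans (*-identityˡ _) (⟪⟫-1ᴾ h)) (∑<-zero n _ (λ m _ → higher m)) ⟩
    h 0ᴷ ℚ.+ 0ℚ                                                    ≡⟨ +-identityʳ _ ⟩
    h 0ᴷ                                                           ∎
    where
      open ≡-Reasoning
      higher : ∀ m → invFactorial (suc m) * ⟪ powᴾ (suc m) logᴾ , h ⟫ ≡ 0ℚ
      higher m = trans (cong (invFactorial (suc m) *_) (⟪⟫-powᴾ-vanish (suc m) h (λ κ le → van κ (ℕ.<-≤-trans (s≤s z≤n) le))))
                       (*-zeroʳ (invFactorial (suc m)))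

  ⟪⟫-θlogᴾ-*ᴾ-expᴾ : ∀ h → ⟪ θlogᴾ *ᴾ expᴾ , h ⟫ ≡ ∑[ m < suc n ] (invFactorial m * ⟪ θlogᴾ *ᴾ powᴾ m logᴾ , h ⟫)
  ⟪⟫-θlogᴾ-*ᴾ-expᴾ h = begin
    ⟪ θlogᴾ *ᴾ expᴾ , h ⟫
      ≡⟨ trans (⟪⟫-*ᴾ θlogᴾ expᴾ h) (⟪⟫-cong θlogᴾ (λ κ → ⟪⟫-expᴾ (λ κ′ → h (κ ⊞ κ′)))) ⟩
    ⟪ θlogᴾ , (λ κ → ∑[ m < suc n ] (invFactorial m * ⟪ powᴾ m logᴾ , (λ κ′ → h (κ ⊞ κ′)) ⟫)) ⟫
      ≡⟨ ⟪⟫-∑ θlogᴾ (upTo (suc n)) (λ m κ → invFactorial m * ⟪ powᴾ m logᴾ , (λ κ′ → h (κ ⊞ κ′)) ⟫) ⟩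
    ∑[ m < suc n ] ⟪ θlogᴾ , (λ κ → invFactorial m * ⟪ powᴾ m logᴾ , (λ κ′ → h (κ ⊞ κ′)) ⟫) ⟫
      ≡⟨ ∑-cong (upTo (suc n)) (λ m → trans (⟪⟫-*ˡ θlogᴾ (invFactorial m) _)
                                             (cong (invFactorial m *_) (sym (⟪⟫-*ᴾ θlogᴾ (powᴾ m logᴾ) h)))) ⟩
    ∑[ m < suc n ] (invFactorial m * ⟪ θlogᴾ *ᴾ powᴾ m logᴾ , h ⟫) ∎
    where open ≡-Reasoning

  -- θ expᴾ = θlogᴾ · expᴾ in t-degrees ≤ n: the m-th term of θ expᴾ is (1/(m-1)!) θlogᴾ · logᴾ^(m-1),
  -- and the top term θlogᴾ · logᴾ^n only lives in degrees > n.
  θ-expᴾ : ∀ h → VanishAbove n h → ⟪ θ expᴾ , h ⟫ ≡ ⟪ θlogᴾ *ᴾ expᴾ , h ⟫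
  θ-expᴾ h van = begin
    ⟪ θ expᴾ , h ⟫
      ≡⟨ trans (⟪⟫-θ expᴾ h) (trans (⟪⟫-expᴾ θh) (∑<-suc n (λ m → invFactorial m * ⟪ powᴾ m logᴾ , θh ⟫))) ⟩
    invFactorial 0 * ⟪ 1ᴾ , θh ⟫ ℚ.+ (∑[ m < n ] (invFactorial (suc m) * ⟪ powᴾ (suc m) logᴾ , θh ⟫))
      ≡⟨ cong₂ ℚ._+_ (trans (cong (invFactorial 0 *_) (trans (sym (⟪⟫-θ 1ᴾ h)) (⟪⟫-θ-1ᴾ h))) (*-zeroʳ (invFactorial 0)))
                     (∑<-cong n (λ m _ → term m)) ⟩
    0ℚ ℚ.+ (∑[ m < n ] (invFactorial m * Y m))
      ≡⟨ +-identityˡ _ ⟩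
    ∑[ m < n ] (invFactorial m * Y m)
      ≡⟨ sym (trans (cong (λ q → (∑[ m < n ] (invFactorial m * Y m)) ℚ.+ q) (trans (cong (invFactorial n *_) top-vanishes) (*-zeroʳ (invFactorial n))))
                    (+-identityʳ _)) ⟩
    (∑[ m < n ] (invFactorial m * Y m)) ℚ.+ invFactorial n * Y n
      ≡⟨ sym (∑<-last n (λ m → invFactorial m * Y m)) ⟩
    ∑[ m < suc n ] (invFactorial m * Y m)
      ≡⟨ sym (⟪⟫-θlogᴾ-*ᴾ-expᴾ h) ⟩
    ⟪ θlogᴾ *ᴾ expᴾ , h ⟫ ∎
    where
      open ≡-Reasoning
      θh : Key → ℚ
      θh κ = fromℕ (deg κ) * h κ
      Y : ℕ → ℚ
      Y m = ⟪ θlogᴾ *ᴾ powᴾ m logᴾ , h ⟫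
      term : ∀ m → invFactorial (suc m) * ⟪ powᴾ (suc m) logᴾ , θh ⟫ ≡ invFactorial m * Y m
      term m = begin
        invFactorial (suc m) * ⟪ powᴾ (suc m) logᴾ , θh ⟫       ≡⟨ cong (invFactorial (suc m) *_) (trans (sym (⟪⟫-θ (powᴾ (suc m) logᴾ) h)) (θ-powᴾ m logᴾ h)) ⟩
        invFactorial (suc m) * (fromℕ (suc m) * Y m)           ≡⟨ sym (*-assoc (invFactorial (suc m)) (fromℕ (suc m)) (Y m)) ⟩
        invFactorial (suc m) * fromℕ (suc m) * Y m             ≡⟨ cong (_* Y m) (invFactorial-suc m) ⟩
        invFactorial m * Y m                                   ∎
      top-vanishes : Y n ≡ 0ℚ
      top-vanishes = trans (⟪⟫-*ᴾ θlogᴾ _ h)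
        (⟪⟫-θlogᴾ-vanish _ (λ κ 1≤ → ⟪⟫-powᴾ-vanish n _ (λ κ′ n≤ → van (κ ⊞ κ′) (ℕ.+-mono-≤ 1≤ n≤))))

  VanishAbove-onDegree : ∀ j h → VanishAbove j (onDegree j h)
  VanishAbove-onDegree j h κ j<d = trans (cong (_* h κ) (δℕ-> j (deg κ) j<d)) (*-zeroˡ (h κ))

  SolvesODE : Poly → Set
  SolvesODE X = ∀ h → VanishAbove n h → ⟪ θ X , h ⟫ ≡ ⟪ θlogᴾ *ᴾ X , h ⟫

  private
    below : ℕ → (Key → ℚ) → Key → ℚ
    below j h κ = 𝟙 (deg κ ℕ.≤? j) * h κ

    VanishAbove-below : ∀ j h → VanishAbove j (below j h)
    VanishAbove-below j h κ j<d = trans (cong (_* h κ) (𝟙-no (deg κ ℕ.≤? j) (ℕ.<⇒≱ j<d))) (*-zeroˡ (h κ))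


    onDegree-≢ : ∀ j h κ → deg κ ≢ j → onDegree j h κ ≡ 0ℚ
    onDegree-≢ j h κ d≢j = trans (cong (_* h κ) (δℕ-≢ j (deg κ) d≢j)) (*-zeroˡ (h κ))

    onDegree-≡ : ∀ j h κ → deg κ ≡ j → onDegree j h κ ≡ h κ
    onDegree-≡ j h κ refl = trans (cong (_* h κ) (δℕ-refl (deg κ))) (*-identityˡ (h κ))

    split-top : ∀ j h → VanishAbove (suc j) h → ∀ κ → h κ ≡ below j h κ ℚ.+ onDegree (suc j) h κ
    split-top j h van κ = by-degree (deg κ ℕ.≤? j) (deg κ ℕ.≟ suc j)
      where
        below≡ : ∀ c → 𝟙 (deg κ ℕ.≤? j) ≡ c → below j h κ ≡ c * h κ
        below≡ c e = cong (_* h κ) e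
        by-degree : Dec (deg κ ≤ j) → Dec (deg κ ≡ suc j) → h κ ≡ below j h κ ℚ.+ onDegree (suc j) h κ
        by-degree (yes d≤j) _ = sym (trans (cong₂ ℚ._+_ (trans (below≡ 1ℚ (𝟙-yes (deg κ ℕ.≤? j) d≤j)) (*-identityˡ (h κ)))
                                                        (onDegree-≢ (suc j) h κ (λ e → ℕ.<-irrefl e (s≤s d≤j))))
                                           (+-identityʳ (h κ)))
        by-degree (no d≰j) (yes d≡j+1) = sym (trans (cong₂ ℚ._+_ (trans (below≡ 0ℚ (𝟙-no (deg κ ℕ.≤? j) d≰j)) (*-zeroˡ (h κ)))
                                                                 (onDegree-≡ (suc j) h κ d≡j+1))
                                                    (+-identityˡ (h κ)))
        by-degree (no d≰j) (no d≢j+1) = trans (van κ (ℕ.≤∧≢⇒< (ℕ.≰⇒> d≰j) (λ e → d≢j+1 (sym e))))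
          (sym (trans (cong₂ ℚ._+_ (trans (below≡ 0ℚ (𝟙-no (deg κ ℕ.≤? j) d≰j)) (*-zeroˡ (h κ))) (onDegree-≢ (suc j) h κ d≢j+1))
                      (+-identityˡ 0ℚ)))

    onDegree-θ : ∀ j h κ → onDegree (suc j) h κ ≡ (+ 1 / suc j) * (fromℕ (deg κ) * onDegree (suc j) h κ)
    onDegree-θ j h κ = by-degree (deg κ ℕ.≟ suc j)
      where
        open ≡-Reasoning
        by-degree : Dec (deg κ ≡ suc j) → onDegree (suc j) h κ ≡ (+ 1 / suc j) * (fromℕ (deg κ) * onDegree (suc j) h κ)
        by-degree (yes d≡j+1) = sym (begin
          (+ 1 / suc j) * (fromℕ (deg κ) * onDegree (suc j) h κ)   ≡⟨ cong (λ d → (+ 1 / suc j) * (fromℕ d * onDegree (suc j) h κ)) d≡j+1 ⟩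
          (+ 1 / suc j) * (fromℕ (suc j) * onDegree (suc j) h κ)   ≡⟨ sym (*-assoc (+ 1 / suc j) (fromℕ (suc j)) _) ⟩
          (+ 1 / suc j) * fromℕ (suc j) * onDegree (suc j) h κ     ≡⟨ cong (_* onDegree (suc j) h κ) (inverse-fromℕ-suc j) ⟩
          1ℚ * onDegree (suc j) h κ                                ≡⟨ *-identityˡ _ ⟩
          onDegree (suc j) h κ                                     ∎)
        by-degree (no d≢j+1) = trans zero-here (sym (trans (cong (λ q → (+ 1 / suc j) * (fromℕ (deg κ) * q)) zero-here)
                                                         (trans (cong ((+ 1 / suc j) *_) (*-zeroʳ (fromℕ (deg κ)))) (*-zeroʳ (+ 1 / suc j)))))
          where zero-here = onDegree-≢ (suc j) h κ d≢j+1

    ⟪⟫-onDegree : ∀ Z → SolvesODE Z → ∀ j h → suc j ≤ n →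
      ⟪ Z , onDegree (suc j) h ⟫ ≡ (+ 1 / suc j) * ⟪ θlogᴾ , (λ κ → ⟪ Z , (λ κ′ → onDegree (suc j) h (κ ⊞ κ′)) ⟫) ⟫
    ⟪⟫-onDegree Z ode j h j<n = begin
      ⟪ Z , onDegree (suc j) h ⟫
        ≡⟨ trans (⟪⟫-cong Z (onDegree-θ j h)) (⟪⟫-*ˡ Z (+ 1 / suc j) (λ κ → fromℕ (deg κ) * onDegree (suc j) h κ)) ⟩
      (+ 1 / suc j) * ⟪ Z , (λ κ → fromℕ (deg κ) * onDegree (suc j) h κ) ⟫
        ≡⟨ cong ((+ 1 / suc j) *_) (trans (sym (⟪⟫-θ Z _)) (trans (ode _ (λ κ n<d → VanishAbove-onDegree (suc j) h κ (ℕ.≤-<-trans j<n n<d)))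
                                                                   (⟪⟫-*ᴾ θlogᴾ Z _))) ⟩
      (+ 1 / suc j) * ⟪ θlogᴾ , (λ κ → ⟪ Z , (λ κ′ → onDegree (suc j) h (κ ⊞ κ′)) ⟫) ⟫ ∎
      where open ≡-Reasoning

  -- The degree-(j+1) part of a solution is determined by its parts of degree ≤ j.
  ODE-unique : ∀ X Y → SolvesODE X → SolvesODE Y → (∀ h → VanishAbove 0 h → ⟪ X , h ⟫ ≡ ⟪ Y , h ⟫) →
               ∀ j → j ≤ n → ∀ h → VanishAbove j h → ⟪ X , h ⟫ ≡ ⟪ Y , h ⟫
  ODE-unique X Y odeX odeY agree₀ zero    _   h van = agree₀ h van
  ODE-unique X Y odeX odeY agree₀ (suc j) j<n h van = begin
    ⟪ X , h ⟫                                                  ≡⟨ split X ⟩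
    ⟪ X , below j h ⟫ ℚ.+ ⟪ X , onDegree (suc j) h ⟫           ≡⟨ cong₂ ℚ._+_ (IH (below j h) (VanishAbove-below j h)) top ⟩
    ⟪ Y , below j h ⟫ ℚ.+ ⟪ Y , onDegree (suc j) h ⟫           ≡⟨ sym (split Y) ⟩
    ⟪ Y , h ⟫                                                  ∎
    where
      open ≡-Reasoning
      IH : ∀ h → VanishAbove j h → ⟪ X , h ⟫ ≡ ⟪ Y , h ⟫
      IH = ODE-unique X Y odeX odeY agree₀ j (ℕ.≤-trans (ℕ.n≤1+n j) j<n)
      split : ∀ Z → ⟪ Z , h ⟫ ≡ ⟪ Z , below j h ⟫ ℚ.+ ⟪ Z , onDegree (suc j) h ⟫
      split Z = trans (⟪⟫-cong Z (split-top j h van)) (⟪⟫-+ Z _ _)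
      shifted-vanish : ∀ κ → 1 ≤ deg κ → VanishAbove j (λ κ′ → onDegree (suc j) h (κ ⊞ κ′))
      shifted-vanish κ 1≤ κ′ j<d = VanishAbove-onDegree (suc j) h (κ ⊞ κ′) (ℕ.+-mono-≤ 1≤ j<d)
      top : ⟪ X , onDegree (suc j) h ⟫ ≡ ⟪ Y , onDegree (suc j) h ⟫
      top = trans (⟪⟫-onDegree X odeX j h j<n)
            (trans (cong ((+ 1 / suc j) *_) (⟪⟫-θlogᴾ-cong _ _ (λ κ 1≤ → IH _ (shifted-vanish κ 1≤))))
                   (sym (⟪⟫-onDegree Y odeY j h j<n)))

  private
    split-at : ∀ j → j ≤ n → ∀ F → ∑< (suc n) F ≡ ∑< (suc j) F ℚ.+ (∑[ i < n ∸ j ] F (suc j + i))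
    split-at j j≤n F = subst (λ q → ∑< (suc q) F ≡ ∑< (suc j) F ℚ.+ (∑[ i < n ∸ j ] F (suc j + i)))
                             (ℕ.m+[n∸m]≡n j≤n) (∑<-split (suc j) (n ∸ j) F)

  -- powPS m G j is the t^j-coefficient of (∑_k G_k t^k)^m.
  ⟪⟫-evaluate-powPS : ∀ m j → j ≤ n → (g : Vec ℕ L → ℚ) →
    ⟪ evaluate (powPS m G j) , (λ κ → g (proj₂ κ)) ⟫ ≡ ⟪ powᴾ m logᴾ , onDegree j (λ κ → g (proj₂ κ)) ⟫
  ⟪⟫-evaluate-powPS zero zero _ g = begin
    ⟪ evaluate (M []) , (λ κ → g (proj₂ κ)) ⟫
      ≡⟨ trans (⟪⟫-evaluate (M []) (λ κ → g (proj₂ κ))) (trans (+-identityʳ _) (trans (*-identityˡ _) (+-identityʳ (g 0ᵛ)))) ⟩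
    g 0ᵛ
      ≡⟨ sym (trans (⟪⟫-1ᴾ (onDegree 0 (λ κ → g (proj₂ κ)))) (trans (cong (_* g 0ᵛ) (δℕ-refl 0)) (*-identityˡ (g 0ᵛ)))) ⟩
    ⟪ 1ᴾ , onDegree 0 (λ κ → g (proj₂ κ)) ⟫ ∎
    where open ≡-Reasoning
  ⟪⟫-evaluate-powPS zero (suc j) _ g =
    sym (trans (⟪⟫-1ᴾ (onDegree (suc j) (λ κ → g (proj₂ κ)))) (trans (cong (_* g 0ᵛ) (δℕ-≢ (suc j) 0 (λ ()))) (*-zeroˡ (g 0ᵛ))))
  ⟪⟫-evaluate-powPS (suc m) j j≤n g = begin
    ⟪ evaluate (powPS (suc m) G j) , (λ κ → g (proj₂ κ)) ⟫
      ≡⟨ ⟪⟫-evaluate-concatMap (λ i → G i ⊛ powPS m G (j ∸ i)) (upTo (suc j)) _ ⟩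
    ∑[ i < suc j ] ⟪ evaluate (G i ⊛ powPS m G (j ∸ i)) , (λ κ → g (proj₂ κ)) ⟫
      ≡⟨ ∑<-cong (suc j) term ⟩
    ∑< (suc j) T
      ≡⟨ sym (trans (cong (∑< (suc j) T ℚ.+_) tail-vanishes) (+-identityʳ _)) ⟩
    ∑< (suc j) T ℚ.+ (∑[ i < n ∸ j ] T (suc j + i))
      ≡⟨ sym (split-at j j≤n T) ⟩
    ∑< (suc n) T
      ≡⟨ sym (trans (⟪⟫-*ᴾ logᴾ (powᴾ m logᴾ) _) (⟪⟫-logᴾ _)) ⟩
    ⟪ powᴾ (suc m) logᴾ , onDegree j (λ κ → g (proj₂ κ)) ⟫ ∎
    where
      open ≡-Reasoning
      T : ℕ → ℚ
      T i = ⟪ G i , (λ γ → ∑[ e ∈ exponents γ L ] ⟪ powᴾ m logᴾ , (λ κ′ → δℕ j (i + deg κ′) * g (e +ᵛ proj₂ κ′)) ⟫) ⟫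
      term : ∀ i → i < suc j → ⟪ evaluate (G i ⊛ powPS m G (j ∸ i)) , (λ κ → g (proj₂ κ)) ⟫ ≡ T i
      term i i≤j = trans (⟪⟫-evaluate-⊛ (G i) (powPS m G (j ∸ i)) _)
        (trans (⟪⟫-*ᴾ (evaluate (G i)) (evaluate (powPS m G (j ∸ i))) _) (trans (⟪⟫-evaluate (G i) _)
          (⟪⟫-cong (G i) (λ γ → ∑-cong (exponents γ L) (λ e →
            trans (⟪⟫-evaluate-powPS m (j ∸ i) (ℕ.≤-trans (ℕ.m∸n≤m j i) j≤n) (λ e′ → g (e +ᵛ e′)))
                  (⟪⟫-cong (powᴾ m logᴾ) (λ κ′ → cong (_* g (e +ᵛ proj₂ κ′)) (sym (δℕ-+ j i (deg κ′) (ℕ.≤-pred i≤j))))))))))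
      tail-vanishes : ∑[ i < n ∸ j ] T (suc j + i) ≡ 0ℚ
      tail-vanishes = ∑<-zero (n ∸ j) _ (λ i _ → ⟪⟫-zero (G (suc j + i)) _ (λ γ → ∑-zero (exponents γ L) _ (λ e →
        ⟪⟫-zero (powᴾ m logᴾ) _ (λ κ′ → trans (cong (_* g (e +ᵛ proj₂ κ′))
          (δℕ-> j (suc j + i + deg κ′) (s≤s (ℕ.≤-trans (ℕ.m≤m+n j i) (ℕ.m≤m+n (j + i) (deg κ′)))))) (*-zeroˡ (g (e +ᵛ proj₂ κ′)))))))

  ⟪⟫-evaluate-expCoeff : ∀ j → j ≤ n → (g : Vec ℕ L → ℚ) →
    ⟪ evaluate (expCoeff j G) , (λ κ → g (proj₂ κ)) ⟫ ≡ ⟪ expᴾ , onDegree j (λ κ → g (proj₂ κ)) ⟫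
  ⟪⟫-evaluate-expCoeff j j≤n g = begin
    ⟪ evaluate (expCoeff j G) , (λ κ → g (proj₂ κ)) ⟫
      ≡⟨ ⟪⟫-evaluate-concatMap (λ m → scale (invFactorial m) (powPS m G j)) (upTo (suc j)) _ ⟩
    ∑[ m < suc j ] ⟪ evaluate (scale (invFactorial m) (powPS m G j)) , (λ κ → g (proj₂ κ)) ⟫
      ≡⟨ ∑<-cong (suc j) (λ m _ → trans (⟪⟫-evaluate-scale (invFactorial m) (powPS m G j) _)
                                        (cong (invFactorial m *_) (⟪⟫-evaluate-powPS m j j≤n g))) ⟩
    ∑< (suc j) T
      ≡⟨ sym (trans (cong (∑< (suc j) T ℚ.+_) tail-vanishes) (+-identityʳ _)) ⟩
    ∑< (suc j) T ℚ.+ (∑[ i < n ∸ j ] T (suc j + i))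
      ≡⟨ sym (trans (⟪⟫-expᴾ (onDegree j (λ κ → g (proj₂ κ)))) (split-at j j≤n T)) ⟩
    ⟪ expᴾ , onDegree j (λ κ → g (proj₂ κ)) ⟫ ∎
    where
      open ≡-Reasoning
      T : ℕ → ℚ
      T m = invFactorial m * ⟪ powᴾ m logᴾ , onDegree j (λ κ → g (proj₂ κ)) ⟫
      tail-vanishes : ∑[ i < n ∸ j ] T (suc j + i) ≡ 0ℚ
      tail-vanishes = ∑<-zero (n ∸ j) _ (λ i _ → trans (cong (invFactorial (suc j + i) *_)
        (⟪⟫-powᴾ-vanish (suc j + i) _ (λ κ le → trans (cong (_* g (proj₂ κ)) (δℕ-> j (deg κ) (ℕ.≤-trans (s≤s (ℕ.m≤m+n j i)) le)))
                                                      (*-zeroˡ (g (proj₂ κ))))))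
        (*-zeroʳ (invFactorial (suc j + i))))


module ProductFormula (α : Composition) (L n : ℕ) where

  import Data.Integer as ℤ
  open import Data.List using (List; []; _∷_)
  open import Data.Nat as ℕ using (ℕ; zero; suc; _<_; z≤n; s≤s)
  import Data.Nat.Properties as ℕ
  open import Data.Product using (_,_)
  open import Data.Rational as ℚ using (ℚ; 0ℚ; 1ℚ; _*_; _+_; -_)
  open import Data.Rational.Properties using (+-identityˡ; +-identityʳ; *-zeroʳ)
  open import Data.Rational.Solver using (module +-*-Solver)
  open import Data.Vec using (Vec)
  open import Relation.Binary.PropositionalEquality
  open +-*-Solver

  open import Defs
  open Sum
  open Combination
  open Exponents
  open RationalArith
  open Polynomials L
  open Exponential L (logSeries (M α)) refl n

  Uα : List (Vec ℕ L)
  Uα = exponents α L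

  1+tx^ : Vec ℕ L → Poly
  1+tx^ u = (0ᴷ , 1ℚ) ∷ ((1 , u) , 1ℚ) ∷ []

  ∏ : List (Vec ℕ L) → Poly
  ∏ []      = 1ᴾ
  ∏ (u ∷ V) = 1+tx^ u *ᴾ ∏ V

  powerKey : ℕ → Vec ℕ L → Key
  powerKey k u = suc k , suc k ·ᵛ u

  -- The pairing of (∑_{v ∈ V} ∑_{k < n} (-1)^k t^(k+1) x^((k+1)v)) · X with h: the truncated
  -- logarithmic derivative θ log ∏ V, multiplied by X.
  dlog : List (Vec ℕ L) → Poly → (Key → ℚ) → ℚ
  dlog V X h = ∑[ k < n ] (sign k * ∑[ v ∈ V ] ⟪ X , (λ κ′ → h (powerKey k v ⊞ κ′)) ⟫)

  ⟪⟫-1+tx^ : ∀ u H → ⟪ 1+tx^ u , H ⟫ ≡ H 0ᴷ + H (1 , u)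
  ⟪⟫-1+tx^ u H = solve 2 (λ a b → con 1ℚ :* a :+ (con 1ℚ :* b :+ con 0ℚ) := a :+ b) refl (H 0ᴷ) (H (1 , u))

  ⟪⟫-∏-∷ : ∀ u V H → ⟪ ∏ (u ∷ V) , H ⟫ ≡ ⟪ ∏ V , H ⟫ + ⟪ ∏ V , (λ κ′ → H ((1 , u) ⊞ κ′)) ⟫
  ⟪⟫-∏-∷ u V H = trans (⟪⟫-*ᴾ (1+tx^ u) (∏ V) H) (trans (⟪⟫-1+tx^ u (λ κ → ⟪ ∏ V , (λ κ′ → H (κ ⊞ κ′)) ⟫))
    (cong (_+ ⟪ ∏ V , (λ κ′ → H ((1 , u) ⊞ κ′)) ⟫) (⟪⟫-cong (∏ V) (λ κ′ → cong H (⊞-identityˡ κ′)))))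

  ⟪⟫-∏-degree0 : ∀ V h → VanishAbove 0 h → ⟪ ∏ V , h ⟫ ≡ h 0ᴷ
  ⟪⟫-∏-degree0 []      h van = ⟪⟫-1ᴾ h
  ⟪⟫-∏-degree0 (u ∷ V) h van = trans (⟪⟫-∏-∷ u V h)
    (trans (cong₂ _+_ (⟪⟫-∏-degree0 V h van) (⟪⟫-zero (∏ V) _ (λ κ′ → van _ (s≤s z≤n)))) (+-identityʳ _))

  -- ψ_(k+1)(M_α) evaluates to ∑_u x^((k+1)u), so θlogᴾ is the logarithmic derivative of ∏ Uα.
  ⟪⟫-θlogᴾ : ∀ Φ → ⟪ θlogᴾ , Φ ⟫ ≡ ∑[ k < n ] (sign k * ∑[ u ∈ Uα ] Φ (powerKey k u))
  ⟪⟫-θlogᴾ Φ = trans (⟪⟫-θ logᴾ Φ) (trans (⟪⟫-logᴾ _)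
    (trans (∑<-suc n (λ k → ⟪ logSeries (M α) k , (λ γ → ∑[ e ∈ exponents γ L ] (fromℕ k * Φ (k , e))) ⟫))
    (trans (+-identityˡ _) (∑<-cong n (λ k _ → term k)))))
    where
      term : ∀ k → ⟪ logSeries (M α) (suc k) , (λ γ → ∑[ e ∈ exponents γ L ] (fromℕ (suc k) * Φ (suc k , e))) ⟫
                 ≡ sign k * ∑[ u ∈ Uα ] Φ (powerKey k u)
      term k = trans (cong (λ q → (((ℤ.-1ℤ ℤ.^ k) ℚ./ suc k) * 1ℚ) * q + 0ℚ)
                           (trans (∑-exponents-map-* (suc k) α L _) (∑-*ˡ Uα (fromℕ (suc k)) _)))
        (trans (solve 3 (λ c f s → (c :* con 1ℚ) :* (f :* s) :+ con 0ℚ := (f :* c) :* s) refl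
                        ((ℤ.-1ℤ ℤ.^ k) ℚ./ suc k) (fromℕ (suc k)) (∑[ u ∈ Uα ] Φ (powerKey k u)))
               (cong (_* ∑[ u ∈ Uα ] Φ (powerKey k u)) (fromℕ-*-/ (ℤ.-1ℤ ℤ.^ k) k)))

  ∑<-telescope : ∀ m (F : ℕ → ℚ) → ∑[ k < m ] (sign k * (F (suc k) + F (suc (suc k)))) ≡ F 1 + (- sign m) * F (suc m)
  ∑<-telescope zero    F = solve 1 (λ a → con 0ℚ := a :+ (:- con 1ℚ) :* a) refl (F 1)
  ∑<-telescope (suc m) F = begin
    ∑[ k < suc m ] (sign k * (F (suc k) + F (suc (suc k))))
      ≡⟨ ∑<-last m _ ⟩
    ∑[ k < m ] (sign k * (F (suc k) + F (suc (suc k)))) + sign m * (F (suc m) + F (suc (suc m)))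
      ≡⟨ cong (_+ sign m * (F (suc m) + F (suc (suc m)))) (∑<-telescope m F) ⟩
    F 1 + (- sign m) * F (suc m) + sign m * (F (suc m) + F (suc (suc m)))
      ≡⟨ solve 4 (λ f₁ s a b → (f₁ :+ (:- s) :* a) :+ s :* (a :+ b) := f₁ :+ (:- (:- s)) :* b) refl (F 1) (sign m) (F (suc m)) (F (suc (suc m))) ⟩
    F 1 + (- (- sign m)) * F (suc (suc m))
      ≡⟨ cong (λ q → F 1 + (- q) * F (suc (suc m))) (sym (sign-suc m)) ⟩
    F 1 + (- sign (suc m)) * F (suc (suc m)) ∎
    where open ≡-Reasoning

  -- By telescoping, t x^u = ∑_{k<n} (-1)^k (t x^u)^(k+1) (1 + t x^u) up to t-degree n.
  factor-dlog : ∀ u V h → VanishAbove n h →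
    ⟪ ∏ V , (λ κ′ → h ((1 , u) ⊞ κ′)) ⟫ ≡ ∑[ k < n ] (sign k * ⟪ ∏ (u ∷ V) , (λ κ′ → h (powerKey k u ⊞ κ′)) ⟫)
  factor-dlog u V h van = sym (begin
    ∑[ k < n ] (sign k * ⟪ ∏ (u ∷ V) , (λ κ′ → h (powerKey k u ⊞ κ′)) ⟫)
      ≡⟨ ∑<-cong n (λ k _ → cong (sign k *_) (trans (⟪⟫-∏-∷ u V _) (cong (F (suc k) +_) (⟪⟫-cong (∏ V) (λ κ′ → cong h (next-power k κ′)))))) ⟩
    ∑[ k < n ] (sign k * (F (suc k) + F (suc (suc k))))
      ≡⟨ ∑<-telescope n F ⟩
    F 1 + (- sign n) * F (suc n)
      ≡⟨ cong₂ (λ p q → p + (- sign n) * q) (⟪⟫-cong (∏ V) (λ κ′ → cong (λ z → h ((1 , z) ⊞ κ′)) (·ᵛ-1 u))) beyond-n ⟩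
    ⟪ ∏ V , (λ κ′ → h ((1 , u) ⊞ κ′)) ⟫ + (- sign n) * 0ℚ
      ≡⟨ trans (cong (⟪ ∏ V , (λ κ′ → h ((1 , u) ⊞ κ′)) ⟫ +_) (*-zeroʳ (- sign n))) (+-identityʳ _) ⟩
    ⟪ ∏ V , (λ κ′ → h ((1 , u) ⊞ κ′)) ⟫ ∎)
    where
      open ≡-Reasoning
      F : ℕ → ℚ
      F j = ⟪ ∏ V , (λ κ′ → h ((j , j ·ᵛ u) ⊞ κ′)) ⟫
      next-power : ∀ k κ′ → powerKey k u ⊞ ((1 , u) ⊞ κ′) ≡ powerKey (suc k) u ⊞ κ′
      next-power k κ′ = trans (sym (⊞-assoc (powerKey k u) (1 , u) κ′))
                              (cong (_⊞ κ′) (cong₂ _,_ (ℕ.+-comm (suc k) 1) (·ᵛ-suc (suc k) u)))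
      beyond-n : F (suc n) ≡ 0ℚ
      beyond-n = ⟪⟫-zero (∏ V) _ (λ κ′ → van _ (ℕ.≤-trans (ℕ.n<1+n n) (ℕ.m≤m+n (suc n) (deg κ′))))

  dlog-∷ : ∀ u V X h → dlog (u ∷ V) X h ≡ ∑[ k < n ] (sign k * ⟪ X , (λ κ′ → h (powerKey k u ⊞ κ′)) ⟫) + dlog V X h
  dlog-∷ u V X h = trans (∑<-cong n (λ k _ → *-distribˡ-+′ (sign k) _ _)) (∑<-+ n _ _)
    where
      *-distribˡ-+′ : ∀ s a b → s * (a + b) ≡ s * a + s * b
      *-distribˡ-+′ s a b = solve 3 (λ s a b → s :* (a :+ b) := s :* a :+ s :* b) refl s a b

  dlog-∏-∷ : ∀ u V W h → dlog W (∏ (u ∷ V)) h ≡ dlog W (∏ V) h + dlog W (∏ V) (λ κ′ → h ((1 , u) ⊞ κ′))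
  dlog-∏-∷ u V W h = begin
    dlog W (∏ (u ∷ V)) h
      ≡⟨ ∑<-cong n (λ k _ → cong (sign k *_) (trans (∑-cong W (λ v → trans (⟪⟫-∏-∷ u V _)
           (cong (⟪ ∏ V , (λ κ′ → h (powerKey k v ⊞ κ′)) ⟫ +_) (⟪⟫-cong (∏ V) (λ κ′ → cong h (⊞-swap (powerKey k v) (1 , u) κ′))))))
           (∑-+ W _ _))) ⟩
    ∑[ k < n ] (sign k * (∑[ v ∈ W ] ⟪ ∏ V , (λ κ′ → h (powerKey k v ⊞ κ′)) ⟫ + ∑[ v ∈ W ] ⟪ ∏ V , (λ κ′ → h ((1 , u) ⊞ (powerKey k v ⊞ κ′))) ⟫))
      ≡⟨ trans (∑<-cong n (λ k _ → solve 3 (λ s a b → s :* (a :+ b) := s :* a :+ s :* b) refl (sign k) _ _)) (∑<-+ n _ _) ⟩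
    dlog W (∏ V) h + dlog W (∏ V) (λ κ′ → h ((1 , u) ⊞ κ′)) ∎
    where open ≡-Reasoning

  θ-∏ : ∀ V h → VanishAbove n h → ⟪ θ (∏ V) , h ⟫ ≡ dlog V (∏ V) h
  θ-∏ []      h van = trans (⟪⟫-θ-1ᴾ h) (sym (∑<-zero n _ (λ k _ → *-zeroʳ (sign k))))
  θ-∏ (u ∷ V) h van = begin
    ⟪ θ (1+tx^ u *ᴾ ∏ V) , h ⟫
      ≡⟨ θ-*ᴾ (1+tx^ u) (∏ V) h ⟩
    ⟪ θ (1+tx^ u) *ᴾ ∏ V , h ⟫ + ⟪ 1+tx^ u *ᴾ θ (∏ V) , h ⟫
      ≡⟨ cong₂ _+_ θ-factor (trans (⟪⟫-*ᴾ (1+tx^ u) (θ (∏ V)) h) (⟪⟫-1+tx^ u (λ κ → ⟪ θ (∏ V) , (λ κ′ → h (κ ⊞ κ′)) ⟫))) ⟩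
    ⟪ ∏ V , h₁ ⟫ + (⟪ θ (∏ V) , (λ κ′ → h (0ᴷ ⊞ κ′)) ⟫ + ⟪ θ (∏ V) , h₁ ⟫)
      ≡⟨ cong₂ _+_ (factor-dlog u V h van)
                   (cong₂ _+_ (trans (⟪⟫-cong (θ (∏ V)) (λ κ′ → cong h (⊞-identityˡ κ′))) (θ-∏ V h van))
                              (θ-∏ V h₁ (λ κ′ n<d → van ((1 , u) ⊞ κ′) (ℕ.<-trans n<d (ℕ.n<1+n _))))) ⟩
    ∑[ k < n ] (sign k * ⟪ ∏ (u ∷ V) , (λ κ′ → h (powerKey k u ⊞ κ′)) ⟫) + (dlog V (∏ V) h + dlog V (∏ V) h₁)
      ≡⟨ cong (∑[ k < n ] (sign k * ⟪ ∏ (u ∷ V) , (λ κ′ → h (powerKey k u ⊞ κ′)) ⟫) +_) (sym (dlog-∏-∷ u V V h)) ⟩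
    ∑[ k < n ] (sign k * ⟪ ∏ (u ∷ V) , (λ κ′ → h (powerKey k u ⊞ κ′)) ⟫) + dlog V (∏ (u ∷ V)) h
      ≡⟨ sym (dlog-∷ u V (∏ (u ∷ V)) h) ⟩
    dlog (u ∷ V) (∏ (u ∷ V)) h ∎
    where
      open ≡-Reasoning
      h₁ : Key → ℚ
      h₁ κ′ = h ((1 , u) ⊞ κ′)
      θ-factor : ⟪ θ (1+tx^ u) *ᴾ ∏ V , h ⟫ ≡ ⟪ ∏ V , h₁ ⟫
      θ-factor = trans (⟪⟫-*ᴾ (θ (1+tx^ u)) (∏ V) h)
        (trans (⟪⟫-θ (1+tx^ u) (λ κ → ⟪ ∏ V , (λ κ′ → h (κ ⊞ κ′)) ⟫))
        (trans (⟪⟫-1+tx^ u (λ κ → fromℕ (deg κ) * ⟪ ∏ V , (λ κ′ → h (κ ⊞ κ′)) ⟫))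
               (solve 2 (λ x f → con 0ℚ :* x :+ con 1ℚ :* f := f) refl ⟪ ∏ V , (λ κ′ → h (0ᴷ ⊞ κ′)) ⟫ ⟪ ∏ V , h₁ ⟫)))

  θ-∏Uα : SolvesODE (∏ Uα)
  θ-∏Uα h van = trans (θ-∏ Uα h van) (sym (trans (⟪⟫-*ᴾ θlogᴾ (∏ Uα) h) (⟪⟫-θlogᴾ _)))

  expᴾ≡∏ : ∀ h → VanishAbove n h → ⟪ expᴾ , h ⟫ ≡ ⟪ ∏ Uα , h ⟫
  expᴾ≡∏ h van = ODE-unique expᴾ (∏ Uα) θ-expᴾ θ-∏Uα
    (λ h′ van′ → trans (⟪⟫-expᴾ-degree0 h′ van′) (sym (⟪⟫-∏-degree0 Uα h′ van′))) n ℕ.≤-refl h van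


module Integrality where

  open import Data.List using (List; []; _∷_; length; foldr; upTo; concatMap)
  open import Data.List.Relation.Unary.All as All using (All; []; _∷_)
  open import Data.List.Relation.Unary.All.Properties using (map⁺; concat⁺)
  open import Data.Nat as ℕ using (ℕ; zero; suc; _+_; _∸_; _<_)
  import Data.Nat.Properties as ℕ
  open import Data.Product using (_,_; proj₁; proj₂)
  open import Data.Rational as ℚ using (ℚ; 0ℚ; 1ℚ; _*_)
  open import Data.Rational.Properties using (*-identityˡ; *-zeroˡ; *-zeroʳ)
  open import Data.Vec as V using (Vec; fromList)
  import Data.Vec.Properties as Vec
  open import Relation.Binary.PropositionalEquality
  open import Relation.Nullary using (Dec; yes; no; ¬_)

  open import Defs
  open Sum
  open Combination
  open Coefficient
  open QuasiShuffle
  open Exponents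
  open RationalArith


  AllCompositions : QS → Set
  AllCompositions f = All (λ p → IsComposition (proj₁ p)) f

  All-concatMap : ∀ {A B : Set} {P : B → Set} (F : A → List B) xs → All (λ x → All P (F x)) xs → All P (concatMap F xs)
  All-concatMap F xs all = concat⁺ (map⁺ all)

  AllCompositions-⊛ : ∀ f g → AllCompositions f → AllCompositions g → AllCompositions (f ⊛ g)
  AllCompositions-⊛ f g cf cg = All-concatMap _ f (All.map (λ {p} cp → All-concatMap _ g (All.map (λ {q} cq →
    map⁺ (All.tabulate (λ m → IsComposition-∈qsh (proj₁ p) (proj₁ q) cp cq m))) cg)) cf)

  AllCompositions-scale : ∀ c f → AllCompositions f → AllCompositions (scale c f)
  AllCompositions-scale c f cf = map⁺ cf

  AllCompositions-logSeries : ∀ α → IsComposition α → ∀ k → AllCompositions (logSeries (M α) k)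
  AllCompositions-logSeries α cα zero    = []
  AllCompositions-logSeries α cα (suc k) = map⁺ (All.map (λ {x} 0<x → ℕ.<-≤-trans 0<x (ℕ.m≤n*m x (suc k))) cα) ∷ []

  AllCompositions-λop : ∀ α → IsComposition α → ∀ n → AllCompositions (λop n (M α))
  AllCompositions-λop α cα n =
    All-concatMap _ (upTo (suc n)) (All.tabulate (λ {m} _ → AllCompositions-scale (invFactorial m) _ (powers m n)))
    where
      powers : ∀ m j → AllCompositions (powPS m (logSeries (M α)) j)
      powers zero    zero    = [] ∷ []
      powers zero    (suc j) = []
      powers (suc m) j =
        All-concatMap _ (upTo (suc j)) (All.tabulate (λ {i} _ → AllCompositions-⊛ (logSeries (M α) i) _ (AllCompositions-logSeries α cα i) (powers m (j ∸ i))))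

  coeff-non-composition : ∀ f β → AllCompositions f → ¬ IsComposition β → coeff f β ≡ 0ℚ
  coeff-non-composition f β cf ¬cβ = trans (coeff≡⟪⟫δ f β)
    (⟪⟫-zeroᴬ f (δ β) (All.map (λ {p} cp → δ-≢ β (proj₁ p) (λ e → ¬cβ (subst IsComposition e cp))) cf))

  coeff-by-evaluation : ∀ f β → AllCompositions f → IsComposition β →
    coeff f β ≡ ⟪ Polynomials.evaluate (length β) f , (λ κ → δᵛ (fromList β) (proj₂ κ)) ⟫
  coeff-by-evaluation f β cf cβ = trans (coeff≡⟪⟫δ f β) (sym (trans (Polynomials.⟪⟫-evaluate (length β) f _)
    (⟪⟫-congᴬ f (All.map (λ {p} cp → ∑-exponents-δᵛ β (proj₁ p) cβ cp) cf))))

  private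
    both : ∀ {A B : Set} → Dec A → Dec B → ℕ
    both (yes _) (yes _) = 1
    both (yes _) (no _)  = 0
    both (no _)  _       = 0

    𝟙-*-𝟙 : ∀ {A B : Set} (a : Dec A) (b : Dec B) → 𝟙 a * 𝟙 b ≡ fromℕ (both a b)
    𝟙-*-𝟙 (yes _) (yes _) = refl
    𝟙-*-𝟙 (yes _) (no _)  = refl
    𝟙-*-𝟙 (no _)  (yes _) = refl
    𝟙-*-𝟙 (no _)  (no _)  = refl

  module _ (α β : Composition) (n : ℕ) where
    private
      L = length β
    open Polynomials L
    open Exponential L (logSeries (M α)) refl n
    open ProductFormula α L n

    private
      hit : Key → ℕ
      hit κ = both (deg κ ℕ.≟ n) (Vec.≡-dec ℕ._≟_ (proj₂ κ) (fromList β))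

      atβ : Key → ℚ
      atβ κ = δᵛ (fromList β) (proj₂ κ)

    -- The number of terms t^n x^β in the expansion of ∏_u (1 + t x^u), i.e. of n-subsets of Uα summing to β.
    subsetCount : ℕ
    subsetCount = foldr (λ p c → hit (proj₁ p) + c) 0 (∏ Uα)

    private
      AllOnes : Poly → Set
      AllOnes f = All (λ p → proj₂ p ≡ 1ℚ) f

      AllOnes-*ᴾ : ∀ f g → AllOnes f → AllOnes g → AllOnes (f *ᴾ g)
      AllOnes-*ᴾ f g 1f 1g = All-concatMap _ f (All.map (λ {p} p≡1 → map⁺ (All.map (λ {q} q≡1 → cong₂ _*_ p≡1 q≡1) 1g)) 1f)

      AllOnes-∏ : ∀ V → AllOnes (∏ V)
      AllOnes-∏ []      = refl ∷ []
      AllOnes-∏ (u ∷ V) = AllOnes-*ᴾ (1+tx^ u) (∏ V) (refl ∷ refl ∷ []) (AllOnes-∏ V)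

      ⟪⟫-AllOnes : ∀ f → AllOnes f → ⟪ f , (λ κ → fromℕ (hit κ)) ⟫ ≡ fromℕ (foldr (λ p c → hit (proj₁ p) + c) 0 f)
      ⟪⟫-AllOnes []      _          = refl
      ⟪⟫-AllOnes (p ∷ f) (p≡1 ∷ f≡1) =
        trans (cong₂ ℚ._+_ (trans (cong (_* fromℕ (hit (proj₁ p))) p≡1) (*-identityˡ (fromℕ (hit (proj₁ p))))) (⟪⟫-AllOnes f f≡1))
                                            (sym (fromℕ-+ (hit (proj₁ p)) (foldr (λ p c → hit (proj₁ p) + c) 0 f)))

      coeff-λop≡⟪expᴾ⟫ : IsComposition α → IsComposition β → coeff (λop n (M α)) β ≡ ⟪ expᴾ , onDegree n atβ ⟫
      coeff-λop≡⟪expᴾ⟫ cα cβ =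
        trans (coeff-by-evaluation (λop n (M α)) β (AllCompositions-λop α cα n) cβ) (⟪⟫-evaluate-expCoeff n ℕ.≤-refl (δᵛ (fromList β)))


    coeff-λop≡subsetCount : IsComposition α → IsComposition β → coeff (λop n (M α)) β ≡ fromℕ subsetCount
    coeff-λop≡subsetCount cα cβ = begin
      coeff (λop n (M α)) β                  ≡⟨ coeff-λop≡⟪expᴾ⟫ cα cβ ⟩
      ⟪ expᴾ , onDegree n atβ ⟫              ≡⟨ expᴾ≡∏ (onDegree n atβ) (VanishAbove-onDegree n atβ) ⟩
      ⟪ ∏ Uα , onDegree n atβ ⟫              ≡⟨ ⟪⟫-cong (∏ Uα) (λ κ → 𝟙-*-𝟙 (deg κ ℕ.≟ n) (Vec.≡-dec ℕ._≟_ (proj₂ κ) (fromList β))) ⟩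
      ⟪ ∏ Uα , (λ κ → fromℕ (hit κ)) ⟫      ≡⟨ ⟪⟫-AllOnes (∏ Uα) (AllOnes-∏ Uα) ⟩
      fromℕ subsetCount                      ∎
      where open ≡-Reasoning

    private
      on-degree-n : ∀ κ → fromℕ (deg κ) * onDegree n atβ κ ≡ fromℕ n * onDegree n atβ κ
      on-degree-n κ = by-degree (deg κ ℕ.≟ n)
        where
          by-degree : Dec (deg κ ≡ n) → fromℕ (deg κ) * onDegree n atβ κ ≡ fromℕ n * onDegree n atβ κ
          by-degree (yes d≡n) = cong (λ d → fromℕ d * onDegree n atβ κ) d≡n
          by-degree (no d≢n)  = trans (cong (fromℕ (deg κ) *_) zero-here)
            (trans (*-zeroʳ (fromℕ (deg κ))) (sym (trans (cong (fromℕ n *_) zero-here) (*-zeroʳ (fromℕ n)))))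
            where
              zero-here : onDegree n atβ κ ≡ 0ℚ
              zero-here = trans (cong (_* atβ κ) (δℕ-≢ n (deg κ) d≢n)) (*-zeroˡ (atβ κ))

      newton-term : IsComposition α → IsComposition β → ∀ k → k < suc n →
        ⟪ logSeries (M α) k , (λ γ → ∑[ e ∈ exponents γ L ] (fromℕ k * ⟪ expᴾ , (λ κ′ → onDegree n atβ ((k , e) ⊞ κ′)) ⟫)) ⟫
          ≡ fromℕ k * coeff (logSeries (M α) k ⊛ λop (n ∸ k) (M α)) β
      newton-term cα cβ k k≤n = begin
        ⟪ G k , (λ γ → ∑[ e ∈ exponents γ L ] (fromℕ k * ⟪ expᴾ , (λ κ′ → onDegree n atβ ((k , e) ⊞ κ′)) ⟫)) ⟫
          ≡⟨ ⟪⟫-cong (G k) (λ γ → trans (∑-*ˡ (exponents γ L) (fromℕ k) _) (cong (fromℕ k *_) (∑-cong (exponents γ L) (λ e →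
               trans (⟪⟫-cong expᴾ (λ κ′ → cong (_* atβ ((k , e) ⊞ κ′)) (δℕ-+ n k (deg κ′) (ℕ.≤-pred k≤n))))
                     (sym (⟪⟫-evaluate-expCoeff (n ∸ k) (ℕ.m∸n≤m n k) (λ e′ → δᵛ (fromList β) (e +ᵛ e′)))))))) ⟩
        ⟪ G k , (λ γ → fromℕ k * ∑[ e ∈ exponents γ L ] ⟪ evaluate λₙ₋ₖ , (λ κ′ → atβ ((0 , e) ⊞ κ′)) ⟫) ⟫
          ≡⟨ ⟪⟫-*ˡ (G k) (fromℕ k) _ ⟩
        fromℕ k * ⟪ G k , (λ γ → ∑[ e ∈ exponents γ L ] ⟪ evaluate λₙ₋ₖ , (λ κ′ → atβ ((0 , e) ⊞ κ′)) ⟫) ⟫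
          ≡⟨ cong (fromℕ k *_) (sym (trans (⟪⟫-evaluate-⊛ (G k) λₙ₋ₖ atβ)
                                           (trans (⟪⟫-*ᴾ (evaluate (G k)) (evaluate λₙ₋ₖ) atβ) (⟪⟫-evaluate (G k) _)))) ⟩
        fromℕ k * ⟪ evaluate (G k ⊛ λₙ₋ₖ) , atβ ⟫
          ≡⟨ cong (fromℕ k *_) (sym (coeff-by-evaluation (G k ⊛ λₙ₋ₖ) β
               (AllCompositions-⊛ (G k) λₙ₋ₖ (AllCompositions-logSeries α cα k) (AllCompositions-λop α cα (n ∸ k))) cβ)) ⟩
        fromℕ k * coeff (G k ⊛ λₙ₋ₖ) β ∎
        where
          open ≡-Reasoning
          G = logSeries (M α)
          λₙ₋ₖ = λop (n ∸ k) (M α)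

    -- Newton's identity n λ_n = ∑_k k G_k λ_(n-k), read off from θ expᴾ = θlogᴾ · expᴾ.
    newton-identity : IsComposition α → IsComposition β →
      fromℕ n * coeff (λop n (M α)) β ≡ ∑[ k < suc n ] (fromℕ k * coeff (logSeries (M α) k ⊛ λop (n ∸ k) (M α)) β)
    newton-identity cα cβ = begin
      fromℕ n * coeff (λop n (M α)) β
        ≡⟨ cong (fromℕ n *_) (coeff-λop≡⟪expᴾ⟫ cα cβ) ⟩
      fromℕ n * ⟪ expᴾ , onDegree n atβ ⟫
        ≡⟨ sym (trans (⟪⟫-cong expᴾ on-degree-n) (⟪⟫-*ˡ expᴾ (fromℕ n) (onDegree n atβ))) ⟩
      ⟪ expᴾ , (λ κ → fromℕ (deg κ) * onDegree n atβ κ) ⟫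
        ≡⟨ trans (sym (⟪⟫-θ expᴾ (onDegree n atβ))) (θ-expᴾ (onDegree n atβ) (VanishAbove-onDegree n atβ)) ⟩
      ⟪ θlogᴾ *ᴾ expᴾ , onDegree n atβ ⟫
        ≡⟨ trans (⟪⟫-*ᴾ θlogᴾ expᴾ (onDegree n atβ)) (trans (⟪⟫-θ logᴾ _) (⟪⟫-logᴾ _)) ⟩
      ∑[ k < suc n ] ⟪ logSeries (M α) k , (λ γ → ∑[ e ∈ exponents γ L ] (fromℕ k * ⟪ expᴾ , (λ κ′ → onDegree n atβ ((k , e) ⊞ κ′)) ⟫)) ⟫
        ≡⟨ ∑<-cong (suc n) (newton-term cα cβ) ⟩
      ∑[ k < suc n ] (fromℕ k * coeff (logSeries (M α) k ⊛ λop (n ∸ k) (M α)) β) ∎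
      where open ≡-Reasoning


module LeadingTerm (x : ℕ) (a′ : List ℕ) (lyndon : Lyndon (x ∷ a′)) (0<x : 0 < x) (cα : IsComposition (x ∷ a′)) where

  open import Data.Empty using (⊥; ⊥-elim)
  open import Data.List using (List; []; _∷_; map; length)
  open import Data.List.Membership.Propositional using (_∈_)
  open import Data.List.Properties using (length-++; length-map; ≡-dec; ++-identityʳ)
  open import Data.List.Relation.Unary.All using ([]; all?)
  open import Data.List.Relation.Unary.All.Properties using (++⁺)
  open import Data.Nat as ℕ using (ℕ; zero; suc; _≤_; _<_; z≤n; s≤s; _+_; _*_; _∸_)
  import Data.Nat.Properties as ℕ
  open import Data.Nat.ListAction.Properties using (sum-++)
  open import Data.Nat.Tactic.RingSolver using (solve-∀)
  open import Data.Product using (_×_; _,_; proj₁; proj₂)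
  open import Data.Rational as ℚ using (ℚ; 0ℚ; 1ℚ)
  import Data.Rational.Properties as ℚ
  open import Data.Rational.Solver using (module +-*-Solver)
  import Data.Integer as ℤ
  open import Data.Sum using (_⊎_; inj₁; inj₂)
  open import Relation.Binary.PropositionalEquality
  open import Relation.Nullary using (Dec; yes; no)
  open import Relation.Nullary.Decidable using (_⊎-dec_)

  open import Defs
  open Sum
  open Combination
  open Coefficient
  open QuasiShuffle
  open LexOrder
  open RationalArith
  open Integrality
  open LyndonShuffle x a′ lyndon 0<x
  open +-*-Solver using (solve; _:*_; _:+_; _:=_; con)

  W : ℕ
  W = wt α

  m : ℕ
  m = length α

  -- ψ_k(M_α) = M_(ψα k).
  ψα : ℕ → Composition
  ψα k = map (k *_) α

  wt-α^ : ∀ i → wt (α^ i) ≡ i * W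
  wt-α^ zero    = refl
  wt-α^ (suc i) = trans (sum-++ α (α^ i)) (cong (W +_) (wt-α^ i))

  length-α^ : ∀ i → length (α^ i) ≡ i * m
  length-α^ zero    = refl
  length-α^ (suc i) = trans (length-++ α) (cong (m +_) (length-α^ i))

  IsComposition-α^ : ∀ i → IsComposition (α^ i)
  IsComposition-α^ zero    = []
  IsComposition-α^ (suc i) = ++⁺ cα (IsComposition-α^ i)

  wt-ψα : ∀ k → wt (ψα k) ≡ k * W
  wt-ψα k = go α
    where
      go : ∀ γ → wt (map (k *_) γ) ≡ k * wt γ
      go []      = sym (ℕ.*-zeroʳ k)
      go (g ∷ γ) = trans (cong (k * g +_) (go γ)) (sym (ℕ.*-distribˡ-+ k g (wt γ)))

  ψα-1 : ψα 1 ≡ α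
  ψα-1 = go α
    where
      go : ∀ γ → map (1 *_) γ ≡ γ
      go []      = refl
      go (g ∷ γ) = cong₂ _∷_ (ℕ.+-identityʳ g) (go γ)

  _≤wll_ : Composition → Composition → Set
  γ ≤wll δ = γ ≡ δ ⊎ γ <wll δ

  Bounded : Composition → ℕ → Set
  Bounded γ i = wt γ < i * W ⊎ (wt γ ≡ i * W × length γ ≤ i * m)

  ≤wll⇒Bounded : ∀ γ i → γ ≤wll α^ i → Bounded γ i
  ≤wll⇒Bounded γ i (inj₁ refl)                      = inj₂ (wt-α^ i , ℕ.≤-reflexive (length-α^ i))
  ≤wll⇒Bounded γ i (inj₂ (inj₁ w<))                 = inj₁ (subst (wt γ <_) (wt-α^ i) w<)
  ≤wll⇒Bounded γ i (inj₂ (inj₂ (w≡ , inj₁ l<)))     = inj₂ (trans w≡ (wt-α^ i) , ℕ.<⇒≤ (subst (length γ <_) (length-α^ i) l<))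
  ≤wll⇒Bounded γ i (inj₂ (inj₂ (w≡ , inj₂ (l≡ , _)))) = inj₂ (trans w≡ (wt-α^ i) , ℕ.≤-reflexive (trans l≡ (length-α^ i)))

  -- For k ≥ 2 a shuffle with ψ_k(α) has the weight of α^(k+i) but at most m + i·m < (k+i)·m parts.
  ψα-shuffle-<wll : ∀ k i γ → Bounded γ i → ∀ w → w ∈ qsh (ψα (suc (suc k))) γ → w <wll α^ (suc (suc k) + i)
  ψα-shuffle-<wll k i γ (inj₁ w<) w mem = inj₁ (begin-strict
    wt w                      ≡⟨ trans (wt-∈qsh (ψα K) γ mem) (cong (_+ wt γ) (wt-ψα K)) ⟩
    K * W + wt γ              <⟨ ℕ.+-monoʳ-< (K * W) w< ⟩
    K * W + i * W             ≡⟨ sym (ℕ.*-distribʳ-+ W K i) ⟩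
    (K + i) * W               ≡⟨ sym (wt-α^ (K + i)) ⟩
    wt (α^ (K + i))           ∎)
    where
      open ℕ.≤-Reasoning
      K = suc (suc k)
  ψα-shuffle-<wll k i γ (inj₂ (w≡ , l≤)) w mem = inj₂ (same-weight , inj₁ (begin-strict
    length w                        ≤⟨ qsh-length-≤ (ψα K) γ mem ⟩
    length (ψα K) + length γ        ≡⟨ cong (_+ length γ) (length-map (K *_) α) ⟩
    m + length γ                    ≤⟨ ℕ.+-monoʳ-≤ m l≤ ⟩
    m + i * m                       <⟨ fewer-parts ⟩
    (K + i) * m                     ≡⟨ sym (length-α^ (K + i)) ⟩
    length (α^ (K + i))             ∎))
    where
      open ℕ.≤-Reasoning
      K = suc (suc k)
      same-weight : wt w ≡ wt (α^ (K + i))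
      same-weight = trans (wt-∈qsh (ψα K) γ mem)
        (trans (cong₂ _+_ (wt-ψα K) w≡) (trans (sym (ℕ.*-distribʳ-+ W K i)) (sym (wt-α^ (K + i)))))
      fewer-parts : m + i * m < (K + i) * m
      fewer-parts = subst (m + i * m <_) (sym (expand k i m))
        (ℕ.+-monoʳ-< m (ℕ.<-≤-trans (ℕ.n<1+n (i * m)) (ℕ.≤-trans (s≤s (ℕ.m≤n+m (i * m) (m * k))) (ℕ.+-monoˡ-≤ (m * k + i * m) {1} {m} (s≤s z≤n)))))
        where
          expand : ∀ k i m → (suc (suc k) + i) * m ≡ m + (m + (m * k + i * m))
          expand = solve-∀

  α-top : ∀ i → TopShuffle α (α^ i) (α^ (suc i)) (fromℕ (suc i))
  α-top i = α-top-shuffle i [] α (λ ()) (++-identityʳ α)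

  private
    weight-∈qsh-α : ∀ i γ w → w ∈ qsh α γ → wt γ ≡ wt (α^ i) → wt w ≡ wt (α^ (suc i))
    weight-∈qsh-α i γ w mem e = trans (wt-∈qsh α γ mem) (trans (cong (W +_) e) (sym (sum-++ α (α^ i))))

    -- At equal weight, w is either shorter than α^(i+1) or a full shuffle.
    shuffle-same-weight : ∀ i γ w → w ∈ qsh α γ → wt γ ≡ wt (α^ i) → length γ ≤ length (α^ i) →
      (FullLength α γ w → length γ ≡ length (α^ i) → (w ≡ α^ (suc i) × γ ≡ α^ i) ⊎ w ⊏ α^ (suc i)) →
      (w ≡ α^ (suc i) × γ ≡ α^ i) ⊎ w <wll α^ (suc i)
    shuffle-same-weight i γ w mem e l≤ full-case with length w ℕ.<? length (α^ (suc i))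
    ... | yes l< = inj₂ (inj₂ (weight-∈qsh-α i γ w mem e , inj₁ l<))
    ... | no  l≮ = conclude (full-case full length-γ)
      where
        T = α^ (suc i)
        length-T : length T ≡ m + length (α^ i)
        length-T = length-++ α
        length-w : length w ≡ length T
        length-w = ℕ.≤-antisym (ℕ.≤-trans (qsh-length-≤ α γ mem) (ℕ.≤-trans (ℕ.+-monoʳ-≤ m l≤) (ℕ.≤-reflexive (sym length-T))))
                               (ℕ.≮⇒≥ l≮)
        length-γ : length γ ≡ length (α^ i)
        length-γ = ℕ.≤-antisym l≤ (ℕ.+-cancelˡ-≤ m _ _
          (ℕ.≤-trans (ℕ.≤-reflexive (sym length-T)) (ℕ.≤-trans (ℕ.≤-reflexive (sym length-w)) (qsh-length-≤ α γ mem))))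
        full : FullLength α γ w
        full = trans length-w (trans length-T (cong (m +_) (sym length-γ)))
        conclude : (w ≡ T × γ ≡ α^ i) ⊎ w ⊏ T → (w ≡ T × γ ≡ α^ i) ⊎ w <wll T
        conclude (inj₁ top)       = inj₁ top
        conclude (inj₂ (_ , w⊏T)) = inj₂ (inj₂ (weight-∈qsh-α i γ w mem e , inj₂ (length-w , LexAt⇒<lex w⊏T)))

  α-shuffle-≤wll : ∀ i γ → γ ≤wll α^ i → ∀ w → w ∈ qsh α γ → (w ≡ α^ (suc i) × γ ≡ α^ i) ⊎ w <wll α^ (suc i)
  α-shuffle-≤wll i γ (inj₁ refl) w mem = shuffle-same-weight i γ w mem refl ℕ.≤-refl (λ full _ → at-top (TopShuffle.below (α-top i) w mem full))
    where
      at-top : w ⊑ α^ (suc i) → (w ≡ α^ (suc i) × α^ i ≡ α^ i) ⊎ w ⊏ α^ (suc i)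
      at-top (inj₁ w≡T) = inj₁ (w≡T , refl)
      at-top (inj₂ w⊏T) = inj₂ w⊏T
  α-shuffle-≤wll i γ (inj₂ (inj₁ w<)) w mem =
    inj₂ (inj₁ (subst (_< wt (α^ (suc i))) (sym (wt-∈qsh α γ mem)) (subst (W + wt γ <_) (sym (sum-++ α (α^ i))) (ℕ.+-monoʳ-< W w<))))
  α-shuffle-≤wll i γ (inj₂ (inj₂ (e , inj₁ l<))) w mem =
    shuffle-same-weight i γ w mem e (ℕ.<⇒≤ l<) (λ _ l≡ → ⊥-elim (ℕ.<-irrefl l≡ l<))
  α-shuffle-≤wll i γ (inj₂ (inj₂ (e , inj₂ (l≡ , γ<)))) w mem =
    shuffle-same-weight i γ w mem e (ℕ.≤-reflexive l≡) (λ full l≡′ → inj₂ (raise full l≡′))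
    where
      -- γ <lex α^i at equal length, so some full shuffle of α with α^i lies strictly above w.
      raise : FullLength α γ w → length γ ≡ length (α^ i) → w ⊏ α^ (suc i)
      raise full l≡′ with shuffle-⊏-mono α γ (α^ i) w l≡′ (<lex⇒⊏ γ< (ℕ.≤-reflexive (sym l≡′))) mem full
      ... | w′ , mem′ , full′ , (_ , w<w′) with TopShuffle.below (α-top i) w′ mem′ full′
      ...   | inj₁ refl       = _ , w<w′
      ...   | inj₂ (_ , w′<T) = LexAt-trans w<w′ w′<T

  λ^ : ℕ → QS
  λ^ j = λop j (M α)

  LeadingTerm : ℕ → Set
  LeadingTerm j = coeff (λ^ j) (α^ j) ≡ 1ℚ × (∀ β → coeff (λ^ j) β ≢ 0ℚ → β ≤wll α^ j)

  -- The number of times β arises when multiplying ψ_k(M_α) = M_(ψα k) with λ_j(M_α).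
  shuffleCount : Composition → ℕ → ℕ → ℚ
  shuffleCount β j k = ⟪ λ^ j , (λ γ → count β (qsh (ψα k) γ)) ⟫

  -- Newton's identity, with G_(k+1) = (-1)^k/(k+1) · ψ_(k+1)(M_α).
  newton-ψ : ∀ n′ β → IsComposition β →
    fromℕ (suc n′) ℚ.* coeff (λ^ (suc n′)) β ≡ ∑[ k < suc n′ ] (sign k ℚ.* shuffleCount β (n′ ∸ k) (suc k))
  newton-ψ n′ β cβ = begin
    fromℕ (suc n′) ℚ.* coeff (λ^ (suc n′)) β
      ≡⟨ newton-identity α β (suc n′) cα cβ ⟩
    ∑[ k < suc (suc n′) ] (fromℕ k ℚ.* coeff (logSeries (M α) k ⊛ λ^ (suc n′ ∸ k)) β)
      ≡⟨ ∑<-suc (suc n′) (λ k → fromℕ k ℚ.* coeff (logSeries (M α) k ⊛ λ^ (suc n′ ∸ k)) β) ⟩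
    0ℚ ℚ.* coeff (logSeries (M α) 0 ⊛ λ^ (suc n′)) β ℚ.+ (∑[ k < suc n′ ] (fromℕ (suc k) ℚ.* coeff (logSeries (M α) (suc k) ⊛ λ^ (n′ ∸ k)) β))
      ≡⟨ cong₂ ℚ._+_ (ℚ.*-zeroˡ (coeff (logSeries (M α) 0 ⊛ λ^ (suc n′)) β)) (∑<-cong (suc n′) (λ k _ → ψ-term k)) ⟩
    0ℚ ℚ.+ (∑[ k < suc n′ ] (sign k ℚ.* shuffleCount β (n′ ∸ k) (suc k)))
      ≡⟨ ℚ.+-identityˡ _ ⟩
    ∑[ k < suc n′ ] (sign k ℚ.* shuffleCount β (n′ ∸ k) (suc k)) ∎
    where
      open ≡-Reasoning
      ψ-term : ∀ k → fromℕ (suc k) ℚ.* coeff (logSeries (M α) (suc k) ⊛ λ^ (n′ ∸ k)) β ≡ sign k ℚ.* shuffleCount β (n′ ∸ k) (suc k)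
      ψ-term k = trans (cong (fromℕ (suc k) ℚ.*_) (coeff-⊛ (logSeries (M α) (suc k)) (λ^ (n′ ∸ k)) β))
        (trans (solve 3 (λ f c s → f :* ((c :* con 1ℚ) :* s :+ con 0ℚ) := (f :* c) :* s) refl
                        (fromℕ (suc k)) ((ℤ.-1ℤ ℤ.^ k) ℚ./ suc k) (shuffleCount β (n′ ∸ k) (suc k)))
               (cong (ℚ._* shuffleCount β (n′ ∸ k) (suc k)) (fromℕ-*-/ (ℤ.-1ℤ ℤ.^ k) k)))

  shuffleCount-vanishes : ∀ β j k → (∀ γ → coeff (λ^ j) γ ≢ 0ℚ → ∀ w → w ∈ qsh (ψα k) γ → w ≢ β) → shuffleCount β j k ≡ 0ℚ
  shuffleCount-vanishes β j k avoid = ⟪⟫-orthogonal (λ^ j) _ (λ γ → by-coeff γ (coeff (λ^ j) γ ℚ.≟ 0ℚ))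
    where
      by-coeff : ∀ γ → Dec (coeff (λ^ j) γ ≡ 0ℚ) → coeff (λ^ j) γ ≡ 0ℚ ⊎ count β (qsh (ψα k) γ) ≡ 0ℚ
      by-coeff γ (yes c≡0) = inj₁ c≡0
      by-coeff γ (no c≢0)  = inj₂ (count-absent β _ (avoid γ c≢0))

  module InductionStep (n′ : ℕ) (IH : ∀ i → i ≤ n′ → LeadingTerm i) where

    T : Composition
    T = α^ (suc n′)

    classify : ∀ k → k ≤ n′ → ∀ γ → coeff (λ^ (n′ ∸ k)) γ ≢ 0ℚ → ∀ w → w ∈ qsh (ψα (suc k)) γ →
               (w ≡ T × k ≡ 0 × γ ≡ α^ n′) ⊎ w <wll T
    classify zero    _   γ c≢0 w mem with α-shuffle-≤wll n′ γ (proj₂ (IH n′ ℕ.≤-refl) γ c≢0) w (subst (λ a → w ∈ qsh a γ) ψα-1 mem)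
    ... | inj₁ (w≡T , γ≡α^) = inj₁ (w≡T , refl , γ≡α^)
    ... | inj₂ w<T          = inj₂ w<T
    classify (suc k) k<n′ γ c≢0 w mem = inj₂ (subst (λ q → w <wll α^ q) (ℕ.m+[n∸m]≡n {suc (suc k)} {suc n′} (s≤s k<n′))
      (ψα-shuffle-<wll k (n′ ∸ suc k) γ (≤wll⇒Bounded γ (n′ ∸ suc k) (proj₂ (IH (n′ ∸ suc k) (ℕ.m∸n≤m n′ (suc k))) γ c≢0)) w mem))

    -- If β is neither T nor below it, every term of Newton's identity vanishes.
    support : ∀ β → coeff (λ^ (suc n′)) β ≢ 0ℚ → β ≤wll T
    support β c≢0 with all? (λ b → 0 ℕ.<? b) β
    ... | no ¬cβ = ⊥-elim (c≢0 (coeff-non-composition (λ^ (suc n′)) β (AllCompositions-λop α cα (suc n′)) ¬cβ))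
    ... | yes cβ with (≡-dec ℕ._≟_ β T) ⊎-dec (β <wll? T)
    ...   | yes β≤T = β≤T
    ...   | no  β≰T = ⊥-elim (c≢0 (fromℕ-suc-*-cancelˡ n′ _ _ (begin
      fromℕ (suc n′) ℚ.* coeff (λ^ (suc n′)) β                         ≡⟨ newton-ψ n′ β cβ ⟩
      ∑[ k < suc n′ ] (sign k ℚ.* shuffleCount β (n′ ∸ k) (suc k))    ≡⟨ ∑<-zero (suc n′) _ (λ k k≤n′ → term-vanishes k (ℕ.≤-pred k≤n′)) ⟩
      0ℚ                                                               ≡⟨ sym (ℚ.*-zeroʳ (fromℕ (suc n′))) ⟩
      fromℕ (suc n′) ℚ.* 0ℚ                                            ∎)))
      where
        open ≡-Reasoning
        term-vanishes : ∀ k → k ≤ n′ → sign k ℚ.* shuffleCount β (n′ ∸ k) (suc k) ≡ 0ℚ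
        term-vanishes k k≤n′ = trans (cong (sign k ℚ.*_) (shuffleCount-vanishes β (n′ ∸ k) (suc k) (λ γ c≢0 w mem w≡β →
          β≰T (by-class (classify k k≤n′ γ c≢0 w mem) w≡β)))) (ℚ.*-zeroʳ (sign k))
          where
            by-class : ∀ {w} {P : Set} → (w ≡ T × P) ⊎ w <wll T → w ≡ β → β ≤wll T
            by-class (inj₁ (w≡T , _)) w≡β = inj₁ (trans (sym w≡β) w≡T)
            by-class (inj₂ w<T)       w≡β = inj₂ (subst (_<wll T) w≡β w<T)

    -- Only k = 0 and γ = α^n′ contribute T, namely (n′+1) times (α-top), so (n′+1)·[T] λ = n′+1.
    leading : coeff (λ^ (suc n′)) T ≡ 1ℚ
    leading = fromℕ-suc-*-cancelˡ n′ _ _ (begin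
      fromℕ (suc n′) ℚ.* coeff (λ^ (suc n′)) T
        ≡⟨ newton-ψ n′ T (IsComposition-α^ (suc n′)) ⟩
      ∑[ k < suc n′ ] (sign k ℚ.* shuffleCount T (n′ ∸ k) (suc k))
        ≡⟨ ∑<-suc n′ (λ k → sign k ℚ.* shuffleCount T (n′ ∸ k) (suc k)) ⟩
      sign 0 ℚ.* shuffleCount T n′ 1 ℚ.+ (∑[ k < n′ ] (sign (suc k) ℚ.* shuffleCount T (n′ ∸ suc k) (suc (suc k))))
        ≡⟨ cong₂ ℚ._+_ (ℚ.*-identityˡ (shuffleCount T n′ 1)) (∑<-zero n′ _ (λ k k<n′ → trans (cong (sign (suc k) ℚ.*_) (higher k k<n′)) (ℚ.*-zeroʳ (sign (suc k))))) ⟩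
      shuffleCount T n′ 1 ℚ.+ 0ℚ
        ≡⟨ ℚ.+-identityʳ _ ⟩
      shuffleCount T n′ 1
        ≡⟨ ⟪⟫-single (λ^ n′) _ (α^ n′) only-α^n′ ⟩
      coeff (λ^ n′) (α^ n′) ℚ.* count T (qsh (ψα 1) (α^ n′))
        ≡⟨ cong₂ ℚ._*_ (proj₁ (IH n′ ℕ.≤-refl)) (trans (cong (λ a → count T (qsh a (α^ n′))) ψα-1) (TopShuffle.occurrences (α-top n′))) ⟩
      1ℚ ℚ.* fromℕ (suc n′)
        ≡⟨ ℚ.*-comm 1ℚ (fromℕ (suc n′)) ⟩
      fromℕ (suc n′) ℚ.* 1ℚ ∎)
      where
        open ≡-Reasoning
        higher : ∀ k → k < n′ → shuffleCount T (n′ ∸ suc k) (suc (suc k)) ≡ 0ℚ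
        higher k k<n′ = shuffleCount-vanishes T (n′ ∸ suc k) (suc (suc k)) (λ γ c≢0 w mem w≡T →
          by-class (classify (suc k) k<n′ γ c≢0 w mem) w≡T)
          where
            by-class : ∀ {w} {P : Set} → (w ≡ T × suc k ≡ 0 × P) ⊎ w <wll T → w ≡ T → ⊥
            by-class (inj₁ (_ , () , _))
            by-class (inj₂ w<T) w≡T = <wll-irrefl (subst (_<wll T) w≡T w<T)
        only-α^n′ : ∀ γ → γ ≢ α^ n′ → coeff (λ^ n′) γ ≡ 0ℚ ⊎ count T (qsh (ψα 1) γ) ≡ 0ℚ
        only-α^n′ γ γ≢ with coeff (λ^ n′) γ ℚ.≟ 0ℚ
        ... | yes c≡0 = inj₁ c≡0
        ... | no  c≢0 = inj₂ (count-absent T _ (λ w mem w≡T → by-class (classify 0 z≤n γ c≢0 w mem) w≡T))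
          where
            by-class : ∀ {w} → (w ≡ T × 0 ≡ 0 × γ ≡ α^ n′) ⊎ w <wll T → w ≡ T → ⊥
            by-class (inj₁ (_ , _ , γ≡)) _   = γ≢ γ≡
            by-class (inj₂ w<T)          w≡T = <wll-irrefl (subst (_<wll T) w≡T w<T)

  leading-term-0 : LeadingTerm 0
  leading-term-0 = refl , support
    where
      support : ∀ β → coeff (λ^ 0) β ≢ 0ℚ → β ≤wll []
      support β c≢0 with ≡-dec ℕ._≟_ β []
      ... | yes β≡[] = inj₁ β≡[]
      ... | no  β≢[] = ⊥-elim (c≢0 (trans (coeff≡⟪⟫δ (λ^ 0) β)
                         (cong (λ q → (invFactorial 0 ℚ.* 1ℚ) ℚ.* q ℚ.+ 0ℚ) (δ-≢ β [] (λ e → β≢[] (sym e))))))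

  leading-term : ∀ n → LeadingTerm n
  leading-term n = up-to n n ℕ.≤-refl
    where
      up-to : ∀ N i → i ≤ N → LeadingTerm i
      up-to N       zero    _        = leading-term-0
      up-to (suc N) (suc i) (s≤s i≤N) = InductionStep.leading i IH , InductionStep.support i IH
        where IH = λ j j≤i → up-to N j (ℕ.≤-trans j≤i i≤N)


module Decomposition where

  open import Data.Empty using (⊥-elim)
  open import Data.Integer as ℤ using (ℤ)
  open import Data.List using (List; []; _∷_; map; filter; deduplicate)
  open import Data.List.Membership.Propositional using (_∈_; _∉_)
  open import Data.List.Membership.Propositional.Properties using (∈-map⁺; ∈-map⁻; ∈-filter⁺; ∈-filter⁻; ∈-deduplicate⁺; ∈-deduplicate⁻)
  import Data.List.Membership.DecPropositional as DecMembership
  open import Data.List.Properties using (≡-dec; map-∘)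
  open import Data.List.Relation.Unary.All as All using (All; []; _∷_; all?)
  open import Data.List.Relation.Unary.All.Properties using (map⁺)
  open import Data.List.Relation.Unary.Any using (here; there)
  open import Data.List.Relation.Unary.Unique.Propositional using (Unique)
  open import Data.List.Relation.Unary.AllPairs using ([]; _∷_)
  open import Data.List.Relation.Unary.Unique.DecPropositional.Properties using (deduplicate-!)
  open import Data.List.Relation.Unary.Unique.Propositional.Properties using (filter⁺)
  open import Data.Nat as ℕ using (ℕ)
  open import Data.Product using (Σ; _×_; _,_; proj₁; proj₂)
  open import Data.Rational as ℚ using (ℚ; 0ℚ; 1ℚ; _+_; _*_)
  open import Data.Rational.Properties using (+-identityˡ; +-identityʳ; *-identityʳ; *-zeroʳ)
  open import Data.Sum using (_⊎_; inj₁; inj₂)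
  open import Relation.Binary.PropositionalEquality
  open import Relation.Nullary using (Dec; yes; no)
  open import Relation.Nullary.Decidable using (_×-dec_; ¬?)

  open import Defs
  open Sum
  open Combination
  open Coefficient
  open RationalArith
  open Integrality using (AllCompositions; coeff-non-composition)

  private
    _≟ᶜ_ = ≡-dec ℕ._≟_

  coeff-∉-keys : ∀ f β → β ∉ map proj₁ f → coeff f β ≡ 0ℚ
  coeff-∉-keys f β β∉ = trans (coeff≡⟪⟫δ f β)
    (⟪⟫-zeroᴬ f (δ β) (All.tabulate (λ {p} p∈f → δ-≢ β (proj₁ p) (λ e → β∉ (subst (_∈ map proj₁ f) e (∈-map⁺ proj₁ p∈f))))))

  coeff-tabulate : ∀ (E : List Composition) (g : Composition → ℚ) β → coeff (map (λ γ → γ , g γ) E) β ≡ ∑[ γ ∈ E ] (g γ * δ β γ)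
  coeff-tabulate E g β = trans (coeff≡⟪⟫δ (map (λ γ → γ , g γ) E) β) (∑-map (λ γ → γ , g γ) E (λ p → proj₂ p * δ β (proj₁ p)))

  ∑-δ-∉ : ∀ (E : List Composition) (g : Composition → ℚ) β → β ∉ E → ∑[ γ ∈ E ] (g γ * δ β γ) ≡ 0ℚ
  ∑-δ-∉ E g β β∉E = ∑-zeroᴬ E _ (All.tabulate (λ {γ} γ∈E → trans (cong (g γ *_) (δ-≢ β γ (λ e → β∉E (subst (_∈ E) e γ∈E)))) (*-zeroʳ (g γ))))

  ∑-δ-∈ : ∀ (E : List Composition) (g : Composition → ℚ) β → Unique E → β ∈ E → ∑[ γ ∈ E ] (g γ * δ β γ) ≡ g β
  ∑-δ-∈ (γ ∷ E) g β (γ∉E ∷ uE) (here refl) =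
    trans (cong₂ _+_ (trans (cong (g β *_) (δ-refl β)) (*-identityʳ (g β))) (∑-δ-∉ E g β (λ β∈E → All.lookup γ∉E β∈E refl)))
          (+-identityʳ (g β))
  ∑-δ-∈ (γ ∷ E) g β (γ∉E ∷ uE) (there β∈E) =
    trans (cong₂ _+_ (trans (cong (g γ *_) (δ-≢ β γ γ≢β)) (*-zeroʳ (g γ))) (∑-δ-∈ E g β uE β∈E)) (+-identityˡ _)
    where
      γ≢β : γ ≢ β
      γ≢β refl = All.lookup γ∉E β∈E refl

  module _ (f : QS) (T : Composition) (c : Composition → ℕ) (cf : AllCompositions f)
           (coeff≡c : ∀ β → IsComposition β → coeff f β ≡ fromℕ (c β)) where

    private
      Lower : Composition → Set
      Lower β = β ≢ T × c β ≢ 0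

      lower? : ∀ β → Dec (Lower β)
      lower? β = ¬? (β ≟ᶜ T) ×-dec ¬? (c β ℕ.≟ 0)

      lowerKeys : List Composition
      lowerKeys = filter lower? (deduplicate _≟ᶜ_ (map proj₁ f))

      lowerKeys-unique : Unique lowerKeys
      lowerKeys-unique = filter⁺ lower? (deduplicate-! _≟ᶜ_ (map proj₁ f))

      ∈lowerKeys⁻ : ∀ {β} → β ∈ lowerKeys → β ∈ map proj₁ f × Lower β
      ∈lowerKeys⁻ β∈ with ∈-filter⁻ lower? β∈
      ... | β∈keys , low = ∈-deduplicate⁻ _≟ᶜ_ (map proj₁ f) β∈keys , low

      key-composition : ∀ {β} → β ∈ map proj₁ f → IsComposition β
      key-composition β∈ with ∈-map⁻ proj₁ β∈
      ... | p , p∈f , refl = All.lookup cf p∈f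

      ∈lowerKeys⁺ : ∀ β → IsComposition β → β ≢ T → c β ≢ 0 → β ∈ lowerKeys
      ∈lowerKeys⁺ β cβ β≢T c≢0 = ∈-filter⁺ lower? (∈-deduplicate⁺ _≟ᶜ_ key) (β≢T , c≢0)
        where
          key : β ∈ map proj₁ f
          key with DecMembership._∈?_ _≟ᶜ_ β (map proj₁ f)
          ... | yes β∈ = β∈
          ... | no  β∉ = ⊥-elim (c≢0 (fromℕ-injective (c β) 0 (trans (sym (coeff≡c β cβ)) (coeff-∉-keys f β β∉))))

    lowerPart : List (Composition × ℤ)
    lowerPart = map (λ β → β , ℤ.+ c β) lowerKeys

    lowerPart-below : (∀ β → coeff f β ≢ 0ℚ → β ≡ T ⊎ β <wll T) → All (λ p → proj₁ p <wll T) lowerPart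
    lowerPart-below support = map⁺ (All.tabulate (λ {β} β∈ → below β (∈lowerKeys⁻ β∈)))
      where
        below : ∀ β → β ∈ map proj₁ f × Lower β → β <wll T
        below β (β∈ , β≢T , c≢0) with support β (λ coeff≡0 → c≢0 (fromℕ-injective (c β) 0
                                         (trans (sym (coeff≡c β (key-composition β∈))) coeff≡0)))
        ... | inj₁ β≡T = ⊥-elim (β≢T β≡T)
        ... | inj₂ β<T = β<T

    coeff-M⊕lowerPart : ∀ b → coeff (M T ⊕ fromℤ lowerPart) b ≡ coeff (M T) b + ∑[ γ ∈ lowerKeys ] (fromℕ (c γ) * δ b γ)
    coeff-M⊕lowerPart b = trans (coeff-++ (M T) (fromℤ lowerPart) b)
      (cong (coeff (M T) b +_) (trans (cong (λ q → coeff q b) (sym (map-∘ lowerKeys))) (coeff-tabulate lowerKeys _ b)))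

    coeff-M⊕lowerPart-≢ : ∀ b → b ≢ T → coeff (M T ⊕ fromℤ lowerPart) b ≡ ∑[ γ ∈ lowerKeys ] (fromℕ (c γ) * δ b γ)
    coeff-M⊕lowerPart-≢ b b≢T = trans (coeff-M⊕lowerPart b)
      (trans (cong (_+ ∑[ γ ∈ lowerKeys ] (fromℕ (c γ) * δ b γ)) (coeff-∉-keys (M T) b (λ { (here b≡T) → b≢T b≡T }))) (+-identityˡ _))

    coeff-off-T : ∀ b → b ≢ T → coeff f b ≡ coeff (M T ⊕ fromℤ lowerPart) b
    coeff-off-T b b≢T with all? (λ x → 0 ℕ.<? x) b
    ... | no ¬cb = trans (coeff-non-composition f b cf ¬cb) (sym (trans (coeff-M⊕lowerPart-≢ b b≢T)
                     (∑-δ-∉ lowerKeys (λ γ → fromℕ (c γ)) b (λ b∈ → ¬cb (key-composition (proj₁ (∈lowerKeys⁻ b∈)))))))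
    ... | yes cb with c b ℕ.≟ 0
    ...   | yes c≡0 = trans (coeff≡c b cb) (trans (cong fromℕ c≡0) (sym (trans (coeff-M⊕lowerPart-≢ b b≢T)
                        (∑-δ-∉ lowerKeys (λ γ → fromℕ (c γ)) b (λ b∈ → proj₂ (proj₂ (∈lowerKeys⁻ b∈)) c≡0)))))
    ...   | no  c≢0 = trans (coeff≡c b cb) (sym (trans (coeff-M⊕lowerPart-≢ b b≢T)
                        (∑-δ-∈ lowerKeys (λ γ → fromℕ (c γ)) b lowerKeys-unique (∈lowerKeys⁺ b cb b≢T c≢0))))

    coeff-at-T : coeff f T ≡ 1ℚ → coeff f T ≡ coeff (M T ⊕ fromℤ lowerPart) T
    coeff-at-T coeff-T = sym (begin
      coeff (M T ⊕ fromℤ lowerPart) T                                   ≡⟨ coeff-M⊕lowerPart T ⟩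
      coeff (M T) T + ∑[ γ ∈ lowerKeys ] (fromℕ (c γ) * δ T γ)          ≡⟨ cong₂ _+_ (trans (coeff≡⟪⟫δ (M T) T) (cong (λ q → 1ℚ * q + 0ℚ) (δ-refl T)))
                                                                              (∑-δ-∉ lowerKeys (λ γ → fromℕ (c γ)) T (λ T∈ → proj₁ (proj₂ (∈lowerKeys⁻ T∈)) refl)) ⟩
      1ℚ + 0ℚ                                                           ≡⟨ trans (+-identityʳ 1ℚ) (sym coeff-T) ⟩
      coeff f T                                                         ∎)
      where open ≡-Reasoning

    leading-decomposition : coeff f T ≡ 1ℚ → (∀ β → coeff f β ≢ 0ℚ → β ≡ T ⊎ β <wll T) →
      Σ (List (Composition × ℤ)) (λ R → All (λ p → proj₁ p <wll T) R × (f ≈QS (M T ⊕ fromℤ R)))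
    leading-decomposition coeff-T support = lowerPart , lowerPart-below support , same-coefficients
      where
        same-coefficients : ∀ b → coeff f b ≡ coeff (M T ⊕ fromℤ lowerPart) b
        same-coefficients b with b ≟ᶜ T
        ... | yes refl = coeff-at-T coeff-T
        ... | no  b≢T  = coeff-off-T b b≢T


open Integrality using (AllCompositions-λop; subsetCount; coeff-λop≡subsetCount)
open Decomposition using (leading-decomposition)

lemma1p10 : (α : Composition) → IsComposition α → Lyndon α → (n : ℕ) → n ≥ 1 →
    Σ (List (Composition × ℤ)) (λ R →
    All (λ p → proj₁ p <wll concatPow n α) R
    × (λop n (M α) ≈QS (M (concatPow n α) ⊕ fromℤ R)))
lemma1p10 []       _             lyndon _ _ = ⊥-elim (proj₁ lyndon refl)
lemma1p10 (x ∷ a′) cα@(0<x ∷ _) lyndon n _ =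
  leading-decomposition (λop n (M α)) (α^ n) (λ β → subsetCount α β n)
    (AllCompositions-λop α cα n) (λ β cβ → coeff-λop≡subsetCount α β n cα cβ)
    (proj₁ (leading-term n)) (proj₂ (leading-term n))
  where
    open LyndonShuffle x a′ lyndon 0<x using (α; α^)
    open LeadingTerm x a′ lyndon 0<x cα using (leading-term)
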